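{- Let $G_1,G_2$ be graphs, and let $K_1\le G_1$, $K_2\le G_2$ be $k$-cliques with $V(K_1)=\{u_1,\dots,u_k\}$, $V(K_2)=\{v_1,\dots,v_k\}$. Let $H$ be the graph obtained from the disjoint union of $G_1$ and $G_2$ by identifying $u_i$ with $v_i$ for each $i$ (keeping a single copy of each resulting edge), i.e. $H$ is obtained by gluing $G_1$ and $G_2$ along a $k$-clique $K$. Then \[\tau_H=\frac{\tau_{G_1}\tau_{G_2}}{\tau_K}.\]
   Context: All graphs are finite and simple. $X_G=\sum_\kappa\prod_{v}x_{\kappa(v)}$ over proper colourings $\kappa:V(G)\to\mathbb{Z}_{>0}$ is the chromatic symmetric function. For a partition $\lambda=(\lambda_1,\dots,\lambda_\ell)$, $\ell(\lambda)=\ell$ and $P_\lambda$ is the disjoint union of paths with $\lambda_1,\dots,\lambda_\ell$ vertices; $\{X_{P_\lambda}\}$ is a basis of the symmetric functions over $\mathbb{Q}$. The tree polynomial is $\tau_G(x)=\sum_\lambda a_\lambda x^{\ell(\lambda)}$ where $X_G=\sum_\lambda a_\lambda X_{P_\lambda}$. $K$ denotes the complete graph on $k$ vertices. -}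

module Defs where

open import Data.Bool using (Bool; true; false; _∧_; _∨_; not; if_then_else_)
open import Data.Nat using (ℕ; zero; suc; _∸_; _⊓_; _≡ᵇ_; _<ᵇ_)
open import Data.Fin using (Fin; toℕ)
open import Data.List using (List; []; _∷_; [_]; map; concatMap; upTo; filterᵇ; length; foldr; allFin)
open import Data.Bool.ListAction using (and)
open import Data.Nat.ListAction using (sum)
open import Data.Vec using (Vec; lookup) renaming ([] to []ᵥ; _∷_ to _∷ᵥ_)
open import Data.Integer using (+_)
open import Data.Rational using (ℚ; 0ℚ; _/_; _+_; _*_)
open import Data.Product using (Σ; ∃; _×_; _,_)
open import Data.Sum using (_⊎_)
open import Relation.Binary.PropositionalEquality using (_≡_; _≢_)
open import Function.Definitions using (Injective)

record Graph : Set where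
  field
    size   : ℕ
    adj    : Fin size → Fin size → Bool
    sym    : ∀ i j → adj i j ≡ adj j i
    irrefl : ∀ i → adj i i ≡ false
open Graph public

ℕtoℚ : ℕ → ℚ
ℕtoℚ n = (+ n) / 1

sumℚ : List ℚ → ℚ
sumℚ = foldr _+_ 0ℚ

_==ᶠ_ : ∀ {m} → Fin m → Fin m → Bool
a ==ᶠ b = toℕ a ≡ᵇ toℕ b

allVecs : (N m : ℕ) → List (Vec (Fin m) N)
allVecs zero    m = [ []ᵥ ]
allVecs (suc N) m = concatMap (λ c → map (c ∷ᵥ_) (allVecs N m)) (allFin m)

proper : ∀ {N m} → (Fin N → Fin N → Bool) → Vec (Fin m) N → Bool
proper {N} ad κ =
  and (concatMap (λ i → map (λ j → not (ad i j) ∨ not (lookup κ i ==ᶠ lookup κ j)) (allFin N)) (allFin N))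

mult : ∀ {N m} → Vec (Fin m) N → Fin m → ℕ
mult {N} κ c = length (filterᵇ (λ i → lookup κ i ==ᶠ c) (allFin N))

multIs : ∀ {N m} → Vec (Fin m) N → (Fin m → ℕ) → Bool
multIs {m = m} κ α = and (map (λ c → mult κ c ≡ᵇ α c) (allFin m))

-- Coefficient of the monomial x_0^{α 0} ... x_{m-1}^{α (m-1)} in the
-- chromatic symmetric function (restricted to m variables) of the graph
-- on Fin N with adjacency ad: the number of proper colourings
-- κ : Fin N → Fin m with colour multiplicities α.
coeffX : (N m : ℕ) → (Fin N → Fin N → Bool) → (Fin m → ℕ) → ℕ
coeffX N m ad α = length (filterᵇ (λ κ → proper ad κ ∧ multIs κ α) (allVecs N m))

-- Partitions of n: nonincreasing lists of positive integers summing to n.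
-- partsF fuel n m = partitions of n with all parts ≤ m (fuel ≥ n suffices).

partsF : ℕ → ℕ → ℕ → List (List ℕ)
partsF zero    zero    m = [ [] ]
partsF zero    (suc n) m = []
partsF (suc f) zero    m = [ [] ]
partsF (suc f) (suc n) m =
  concatMap (λ p → map (p ∷_) (partsF f (suc n ∸ p) p))
            (map suc (upTo (m ⊓ suc n)))

partitions : ℕ → List (List ℕ)
partitions n = partsF n n n

-- The path forest P_λ on vertices 0 .. sum λ - 1: consecutive blocks of
-- sizes λ₁, λ₂, … each forming a path.

prefixSums : ℕ → List ℕ → List ℕ
prefixSums s []       = []
prefixSums s (p ∷ ps) = (s Data.Nat.+ p) ∷ prefixSums (s Data.Nat.+ p) ps

elemℕ : ℕ → List ℕ → Bool
elemℕ x = foldr (λ y b → (x ≡ᵇ y) ∨ b) false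

pathStep : List ℕ → ℕ → ℕ → Bool
pathStep λs i j = (j ≡ᵇ suc i) ∧ not (elemℕ (suc i) (prefixSums 0 λs))

pathAdj : (λs : List ℕ) → Fin (sum λs) → Fin (sum λs) → Bool
pathAdj λs i j = pathStep λs (toℕ i) (toℕ j) ∨ pathStep λs (toℕ j) (toℕ i)

-- Expansion X_G = Σ_{λ ⊢ |V(G)|} a_λ X_{P_λ}, checked coefficientwise in
-- |V(G)| variables (restriction of homogeneous symmetric functions of
-- degree n to n variables is injective).

IsPathExpansion : Graph → (List ℕ → ℚ) → Set
IsPathExpansion G a =
  (α : Fin (size G) → ℕ) →
  ℕtoℚ (coeffX (size G) (size G) (adj G) α)
    ≡ sumℚ (map (λ λs → a λs * ℕtoℚ (coeffX (sum λs) (size G) (pathAdj λs) α))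
                (partitions (size G)))

-- Tree polynomial, as coefficient sequence: coefficient of x^j is the sum
-- of a_λ over λ ⊢ |V(G)| with ℓ(λ) = j.
treePoly : (G : Graph) → (List ℕ → ℚ) → ℕ → ℚ
treePoly G a j = sumℚ (map a (filterᵇ (λ λs → length λs ≡ᵇ j) (partitions (size G))))

polyMul : (ℕ → ℚ) → (ℕ → ℚ) → ℕ → ℚ
polyMul p q j = sumℚ (map (λ i → p i * q (j ∸ i)) (upTo (suc j)))

completeGraph : ℕ → Graph
completeGraph k = record
  { size = k
  ; adj = λ i j → not (i ==ᶠ j)
  ; sym = λ i j → symP i j
  ; irrefl = λ i → irrP (toℕ i)
  }
  where
  open import Relation.Binary.PropositionalEquality using (refl; cong)
  irrP : ∀ n → not (n ≡ᵇ n) ≡ false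
  irrP zero = refl
  irrP (suc n) = irrP n
  eqsym : ∀ a b → (a ≡ᵇ b) ≡ (b ≡ᵇ a)
  eqsym zero zero = refl
  eqsym zero (suc b) = refl
  eqsym (suc a) zero = refl
  eqsym (suc a) (suc b) = eqsym a b
  symP : ∀ (i j : Fin k) → not (i ==ᶠ j) ≡ not (j ==ᶠ i)
  symP i j = cong not (eqsym (toℕ i) (toℕ j))

record IsClique (G : Graph) (k : ℕ) (u : Fin k → Fin (size G)) : Set where
  field
    inj      : Injective _≡_ _≡_ u
    adjacent : ∀ i j → i ≢ j → adj G (u i) (u j) ≡ true

-- H is obtained from G₁ ⊔ G₂ by identifying u i with v i, via the
-- embeddings f₁ : V(G₁) → V(H), f₂ : V(G₂) → V(H).
record IsGluing (G₁ G₂ : Graph) (k : ℕ)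
                (u : Fin k → Fin (size G₁)) (v : Fin k → Fin (size G₂))
                (H : Graph) (f₁ : Fin (size G₁) → Fin (size H))
                (f₂ : Fin (size G₂) → Fin (size H)) : Set where
  field
    inj₁     : Injective _≡_ _≡_ f₁
    inj₂     : Injective _≡_ _≡_ f₂
    identify : ∀ i → f₁ (u i) ≡ f₂ (v i)
    onlyGlue : ∀ x y → f₁ x ≡ f₂ y → ∃ λ i → x ≡ u i × y ≡ v i
    cover    : ∀ w → (∃ λ x → f₁ x ≡ w) ⊎ (∃ λ y → f₂ y ≡ w)
    edges→   : ∀ a b → adj H a b ≡ true →
                 (∃ λ x → ∃ λ y → f₁ x ≡ a × f₁ y ≡ b × adj G₁ x y ≡ true)
               ⊎ (∃ λ x → ∃ λ y → f₂ x ≡ a × f₂ y ≡ b × adj G₂ x y ≡ true)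
    edges₁   : ∀ x y → adj G₁ x y ≡ true → adj H (f₁ x) (f₁ y) ≡ true
    edges₂   : ∀ x y → adj G₂ x y ≡ true → adj H (f₂ x) (f₂ y) ≡ true

-- The tree polynomial is a disguised chromatic polynomial.  The coefficients of X_G in
-- |V(G)| variables determine, for each j, the number of proper colourings using exactly the
-- colours 0, …, j-1, and these numbers determine χ_G(t) for every t.  Specialising
-- X_G = Σ a_λ X_{P_λ} therefore gives χ_G(t) = Σ a_λ t^ℓ(λ) (t-1)^(n-ℓ(λ)) = (t-1)^n τ_G(t/(t-1)).
-- Gluing along a clique multiplies chromatic polynomials, χ_H χ_K = χ_{G₁} χ_{G₂}: a colouring
-- of H is a pair of colourings of G₁ and G₂ agreeing on the clique, and the number of
-- extensions of a proper colouring of the clique does not depend on which one it is, since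
-- any two are related by a permutation of the colours.  As |V(H)| + k = |V(G₁)| + |V(G₂)|,
-- the polynomials τ_H τ_K and τ_{G₁} τ_{G₂} agree at the infinitely many points t/(t-1).

module Submission where

open import Data.Bool using (Bool; true; false; _∧_; _∨_; not; if_then_else_; T)
open import Data.Bool.ListAction using (and)
open import Data.Fin using (Fin; toℕ; fromℕ<)
import Data.Fin.Properties as Finₚ
open import Data.Vec using (Vec; lookup; tabulate) renaming ([] to []ᵥ; _∷_ to _∷ᵥ_; map to mapᵥ)
import Data.Vec.Properties as Vecₚ
import Data.Product.Properties as Productₚ
open import Data.List using (List; []; _∷_; [_]; map; concatMap; _++_; filterᵇ; length; allFin; upTo; cartesianProduct)
import Data.List.Properties as Listₚ
open import Data.List.Membership.Propositional using (_∈_; lose; find)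
open import Data.List.Membership.Propositional.Properties using (∈-allFin; ∈-++⁻; ∈-map⁺; ∈-map⁻; ∈-concatMap⁺; ∈-concatMap⁻)
open import Data.List.Relation.Unary.Any using (here; there)
open import Data.List.Relation.Unary.All using (All; []; _∷_)
import Data.List.Relation.Unary.All as All
open import Data.List.Relation.Unary.AllPairs using ([]; _∷_)
open import Data.List.Relation.Unary.Unique.Propositional using (Unique)
open import Data.List.Relation.Unary.Unique.Propositional.Properties using (upTo⁺; allFin⁺)
open import Data.Product using (∃; _×_; _,_; proj₁; proj₂)
open import Data.Sum using (_⊎_; inj₁; inj₂; [_,_]′)
open import Data.Unit using (⊤; tt)
open import Data.Empty using (⊥; ⊥-elim)
open import Function.Definitions using (Injective)
open import Relation.Binary.PropositionalEquality hiding ([_])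
open import Relation.Binary.Definitions using (DecidableEquality)
open import Relation.Nullary using (yes; no; ¬_)
open import Relation.Nullary.Decidable using (does; dec-true; dec-false; T?)
open import Function using (_∘_)
open import Data.Nat using (ℕ; zero; suc; _≡ᵇ_; _<ᵇ_)
open import Data.Rational using (ℚ)
open import Defs hiding (sym)

module Colourings where

  open import Data.Nat
  open import Data.Nat.Properties
  open import Data.Bool.Properties using (∨-zeroʳ; ∧-identityʳ; ∧-zeroʳ; ∧-assoc; ∨-assoc)
  open import Data.Nat.ListAction using (sum)
  open import Data.Nat.Solver using (module +-*-Solver)
  import Data.List
  open import Algebra.Properties.CommutativeSemigroup +-commutativeSemigroup using (interchange)

  ⟦_⟧ : Bool → ℕ
  ⟦ true ⟧ = 1
  ⟦ false ⟧ = 0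

  ⟦∧⟧ : ∀ a b → ⟦ a ∧ b ⟧ ≡ ⟦ a ⟧ * ⟦ b ⟧
  ⟦∧⟧ true b = sym (+-identityʳ ⟦ b ⟧)
  ⟦∧⟧ false b = refl

  ⟦⟧≤1 : ∀ a → ⟦ a ⟧ ≤ 1
  ⟦⟧≤1 true = s≤s z≤n
  ⟦⟧≤1 false = z≤n

  ∑ : {A : Set} → List A → (A → ℕ) → ℕ
  ∑ xs f = sum (map f xs)

  module _ {A : Set} where

    ∑-cong : (xs : List A) {f g : A → ℕ} → (∀ x → x ∈ xs → f x ≡ g x) → ∑ xs f ≡ ∑ xs g
    ∑-cong [] h = refl
    ∑-cong (x ∷ xs) h = cong₂ _+_ (h x (here refl)) (∑-cong xs (λ y m → h y (there m)))

    ∑-ext : (xs : List A) {f g : A → ℕ} → (∀ x → f x ≡ g x) → ∑ xs f ≡ ∑ xs g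
    ∑-ext xs h = ∑-cong xs (λ x _ → h x)

    ∑-+ : (xs : List A) (f g : A → ℕ) → ∑ xs (λ x → f x + g x) ≡ ∑ xs f + ∑ xs g
    ∑-+ [] f g = refl
    ∑-+ (x ∷ xs) f g = trans (cong (f x + g x +_) (∑-+ xs f g)) (interchange (f x) (g x) (∑ xs f) (∑ xs g))

    ∑-*ˡ : (xs : List A) (c : ℕ) (f : A → ℕ) → ∑ xs (λ x → c * f x) ≡ c * ∑ xs f
    ∑-*ˡ [] c f = sym (*-zeroʳ c)
    ∑-*ˡ (x ∷ xs) c f = trans (cong (c * f x +_) (∑-*ˡ xs c f)) (sym (*-distribˡ-+ c (f x) (∑ xs f)))

    ∑-*ʳ : (xs : List A) (c : ℕ) (f : A → ℕ) → ∑ xs (λ x → f x * c) ≡ ∑ xs f * c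
    ∑-*ʳ xs c f = trans (∑-ext xs (λ x → *-comm (f x) c)) (trans (∑-*ˡ xs c f) (*-comm c _))

    ∑-zero : (xs : List A) {f : A → ℕ} → (∀ x → x ∈ xs → f x ≡ 0) → ∑ xs f ≡ 0
    ∑-zero [] h = refl
    ∑-zero (x ∷ xs) h = cong₂ _+_ (h x (here refl)) (∑-zero xs (λ y m → h y (there m)))

    ∑-++ : (xs ys : List A) (f : A → ℕ) → ∑ (xs ++ ys) f ≡ ∑ xs f + ∑ ys f
    ∑-++ [] ys f = refl
    ∑-++ (x ∷ xs) ys f = trans (cong (f x +_) (∑-++ xs ys f)) (sym (+-assoc (f x) (∑ xs f) (∑ ys f)))

    ∑-const : (xs : List A) (c : ℕ) → ∑ xs (λ _ → c) ≡ length xs * c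
    ∑-const [] c = refl
    ∑-const (x ∷ xs) c = cong (c +_) (∑-const xs c)

    ∑-1 : (xs : List A) → ∑ xs (λ _ → 1) ≡ length xs
    ∑-1 xs = trans (∑-const xs 1) (*-identityʳ (length xs))

    length-filterᵇ : (xs : List A) (p : A → Bool) → length (filterᵇ p xs) ≡ ∑ xs (λ x → ⟦ p x ⟧)
    length-filterᵇ [] p = refl
    length-filterᵇ (x ∷ xs) p with p x
    ... | true = cong suc (length-filterᵇ xs p)
    ... | false = length-filterᵇ xs p

    ∑-filterᵇ : (xs : List A) (p : A → Bool) (f : A → ℕ) → ∑ (filterᵇ p xs) f ≡ ∑ xs (λ x → ⟦ p x ⟧ * f x)
    ∑-filterᵇ [] p f = refl
    ∑-filterᵇ (x ∷ xs) p f with p x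
    ... | true = cong₂ _+_ (sym (+-identityʳ (f x))) (∑-filterᵇ xs p f)
    ... | false = ∑-filterᵇ xs p f

  ∑-map : {A B : Set} (xs : List A) (g : A → B) (f : B → ℕ) → ∑ (map g xs) f ≡ ∑ xs (λ x → f (g x))
  ∑-map xs g f = cong sum (sym (Listₚ.map-∘ xs))

  ∑-concatMap : {A B : Set} (xs : List A) (g : A → List B) (f : B → ℕ) →
    ∑ (concatMap g xs) f ≡ ∑ xs (λ x → ∑ (g x) f)
  ∑-concatMap [] g f = refl
  ∑-concatMap (x ∷ xs) g f = trans (∑-++ (g x) (concatMap g xs) f) (cong (∑ (g x) f +_) (∑-concatMap xs g f))

  ∑-comm : {A B : Set} (xs : List A) (ys : List B) (h : A → B → ℕ) →
    ∑ xs (λ x → ∑ ys (h x)) ≡ ∑ ys (λ y → ∑ xs (λ x → h x y))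
  ∑-comm [] ys h = sym (∑-zero ys (λ _ _ → refl))
  ∑-comm (x ∷ xs) ys h = trans (cong (∑ ys (h x) +_) (∑-comm xs ys h)) (sym (∑-+ ys (h x) _))

  ∑-*-∑ : {A B : Set} (xs : List A) (ys : List B) (f : A → ℕ) (g : B → ℕ) →
    ∑ xs f * ∑ ys g ≡ ∑ xs (λ x → ∑ ys (λ y → f x * g y))
  ∑-*-∑ xs ys f g = trans (sym (∑-*ʳ xs (∑ ys g) f)) (∑-ext xs (λ x → sym (∑-*ˡ ys (f x) g)))

  module _ {A : Set} (_≟_ : DecidableEquality A) where

    eqb : A → A → Bool
    eqb x y = does (x ≟ y)

    eqb-refl : ∀ x → eqb x x ≡ true
    eqb-refl x = dec-true (x ≟ x) refl

    eqb⇒≡ : ∀ {x y} → eqb x y ≡ true → x ≡ y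
    eqb⇒≡ {x} {y} e with x ≟ y
    ... | yes p = p

    ≢⇒eqb : ∀ {x y} → x ≢ y → eqb x y ≡ false
    ≢⇒eqb {x} {y} = dec-false (x ≟ y)

    ≡⇒eqb : ∀ {x y} → x ≡ y → eqb x y ≡ true
    ≡⇒eqb {x} refl = eqb-refl x

    eqb-sym : ∀ x y → eqb x y ≡ eqb y x
    eqb-sym x y with x ≟ y
    ... | yes refl = sym (eqb-refl x)
    ... | no x≢y = sym (≢⇒eqb (λ y≡x → x≢y (sym y≡x)))

    Enumerates : List A → (A → Bool) → Set
    Enumerates xs V = ∀ z → ∑ xs (λ x → ⟦ eqb x z ⟧) ≡ ⟦ V z ⟧

    ∑-select : ∀ xs V → Enumerates xs V → ∀ z (g : A → ℕ) → ∑ xs (λ x → ⟦ eqb x z ⟧ * g x) ≡ ⟦ V z ⟧ * g z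
    ∑-select xs V en z g = trans (∑-ext xs at-z) (trans (∑-*ʳ xs (g z) _) (cong (_* g z) (en z)))
      where
      at-z : ∀ x → ⟦ eqb x z ⟧ * g x ≡ ⟦ eqb x z ⟧ * g z
      at-z x with x ≟ z
      ... | yes refl = refl
      ... | no _ = refl

    ∑-eqb-∈ : ∀ {x} xs → x ∈ xs → ∑ xs (λ y → ⟦ eqb y x ⟧) ≢ 0
    ∑-eqb-∈ {x} (y ∷ ys) (here refl) rewrite eqb-refl x = λ ()
    ∑-eqb-∈ {x} (y ∷ ys) (there x∈ys) with eqb y x
    ... | true = λ ()
    ... | false = ∑-eqb-∈ ys x∈ys

    enumerated-valid : ∀ xs V → Enumerates xs V → ∀ x → x ∈ xs → V x ≡ true
    enumerated-valid xs V en x x∈xs with V x in Vx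
    ... | true = refl
    ... | false = ⊥-elim (∑-eqb-∈ xs x∈xs (trans (en x) (cong ⟦_⟧ Vx)))

    ∑-eqb-unique : ∀ xs → Unique xs → ∀ {z} → z ∈ xs → ∑ xs (λ x → ⟦ eqb x z ⟧) ≡ 1
    ∑-eqb-unique (x ∷ xs) (x∉xs ∷ _) (here refl) rewrite eqb-refl x =
      cong suc (∑-zero xs (λ y y∈xs → cong ⟦_⟧ (≢⇒eqb (λ y≡x → All.lookup x∉xs y∈xs (sym y≡x)))))
    ∑-eqb-unique (x ∷ xs) (x∉xs ∷ u) {z} (there z∈xs)
      rewrite ≢⇒eqb {x} {z} (All.lookup x∉xs z∈xs) = ∑-eqb-unique xs u z∈xs

  record Bijection {A B : Set} (VA : A → Bool) (VB : B → Bool) (p : A → Bool) (q : B → Bool) : Set where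
    field
      to : A → B
      from : B → A
      to-valid : ∀ x → VA x ≡ true → p x ≡ true → VB (to x) ≡ true
      to-pred : ∀ x → VA x ≡ true → p x ≡ true → q (to x) ≡ true
      from-valid : ∀ y → VB y ≡ true → q y ≡ true → VA (from y) ≡ true
      from-pred : ∀ y → VB y ≡ true → q y ≡ true → p (from y) ≡ true
      to∘from : ∀ y → VB y ≡ true → q y ≡ true → to (from y) ≡ y
      from∘to : ∀ x → VA x ≡ true → p x ≡ true → from (to x) ≡ x

  count-bijection : ∀ {A B : Set} (_≟A_ : DecidableEquality A) (_≟B_ : DecidableEquality B)
    (xs : List A) (ys : List B) {VA : A → Bool} {VB : B → Bool} {p : A → Bool} {q : B → Bool} →
    Enumerates _≟A_ xs VA → Enumerates _≟B_ ys VB → Bijection VA VB p q →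
    ∑ xs (λ x → ⟦ p x ⟧) ≡ ∑ ys (λ y → ⟦ q y ⟧)
  count-bijection {A} {B} _≟A_ _≟B_ xs ys {VA} {VB} {p} {q} enA enB bij = sym (begin
    ∑ ys (λ y → ⟦ q y ⟧)
      ≡⟨ ∑-cong ys fibre-of-y ⟩
    ∑ ys (λ y → ∑ xs (λ x → ⟦ p x ⟧ * ⟦ eqb _≟B_ y (to x) ⟧))
      ≡⟨ ∑-comm ys xs _ ⟩
    ∑ xs (λ x → ∑ ys (λ y → ⟦ p x ⟧ * ⟦ eqb _≟B_ y (to x) ⟧))
      ≡⟨ ∑-cong xs image-of-x ⟩
    ∑ xs (λ x → ⟦ p x ⟧) ∎)
    where
    open ≡-Reasoning
    open Bijection bij
    validA : ∀ x → x ∈ xs → VA x ≡ true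
    validA = enumerated-valid _≟A_ xs VA enA
    validB : ∀ y → y ∈ ys → VB y ≡ true
    validB = enumerated-valid _≟B_ ys VB enB

    image-of-x : ∀ x → x ∈ xs → ∑ ys (λ y → ⟦ p x ⟧ * ⟦ eqb _≟B_ y (to x) ⟧) ≡ ⟦ p x ⟧
    image-of-x x x∈xs with p x in px
    ... | false = ∑-zero ys (λ _ _ → refl)
    ... | true = trans (∑-ext ys (λ y → +-identityʳ _))
                       (trans (enB (to x)) (cong ⟦_⟧ (to-valid x (validA x x∈xs) px)))

    fibre-of-y : ∀ y → y ∈ ys → ⟦ q y ⟧ ≡ ∑ xs (λ x → ⟦ p x ⟧ * ⟦ eqb _≟B_ y (to x) ⟧)
    fibre-of-y y y∈ys with q y in qy
    ... | true = sym (trans (∑-cong xs preimage) (trans (enA (from y)) (cong ⟦_⟧ (from-valid y vy qy))))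
      where
      vy : VB y ≡ true
      vy = validB y y∈ys
      preimage : ∀ x → x ∈ xs → ⟦ p x ⟧ * ⟦ eqb _≟B_ y (to x) ⟧ ≡ ⟦ eqb _≟A_ x (from y) ⟧
      preimage x x∈xs with x ≟A from y
      ... | yes refl rewrite from-pred y vy qy | to∘from y vy qy | eqb-refl _≟B_ y = refl
      ... | no x≢ with p x in px
      ... | false = refl
      ... | true with y ≟B to x
      ... | no _ = refl
      ... | yes refl = ⊥-elim (x≢ (sym (from∘to x (validA x x∈xs) px)))
    ... | false = sym (∑-zero xs no-preimage)
      where
      no-preimage : ∀ x → x ∈ xs → ⟦ p x ⟧ * ⟦ eqb _≟B_ y (to x) ⟧ ≡ 0
      no-preimage x x∈xs with p x in px
      ... | false = refl
      ... | true with y ≟B to x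
      ... | no _ = refl
      ... | yes refl with () ← trans (sym (to-pred x (validA x x∈xs) px)) qy


  true≢false : true ≢ false
  true≢false ()

  bool-ext : ∀ {a b : Bool} → (a ≡ true → b ≡ true) → (b ≡ true → a ≡ true) → a ≡ b
  bool-ext {true} {true} f g = refl
  bool-ext {true} {false} f g = sym (f refl)
  bool-ext {false} {true} f g = g refl
  bool-ext {false} {false} f g = refl

  ∧-trueˡ : ∀ {a b} → (a ∧ b) ≡ true → a ≡ true
  ∧-trueˡ {true} e = refl

  ∧-trueʳ : ∀ {a b} → (a ∧ b) ≡ true → b ≡ true
  ∧-trueʳ {true} e = e

  ∧-true : ∀ {a b} → a ≡ true → b ≡ true → (a ∧ b) ≡ true
  ∧-true refl refl = refl

  ∨-falseˡ : ∀ {a b} → (a ∨ b) ≡ false → a ≡ false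
  ∨-falseˡ {false} e = refl

  ∨-falseʳ : ∀ {a b} → (a ∨ b) ≡ false → b ≡ false
  ∨-falseʳ {false} e = e

  ∨-false : ∀ {a b} → a ≡ false → b ≡ false → (a ∨ b) ≡ false
  ∨-false refl refl = refl

  ∨-trueʳ : ∀ a {b} → b ≡ true → (a ∨ b) ≡ true
  ∨-trueʳ a refl = ∨-zeroʳ a

  ∨-true⇒⊎ : ∀ {a b} → (a ∨ b) ≡ true → a ≡ true ⊎ b ≡ true
  ∨-true⇒⊎ {true} e = inj₁ refl
  ∨-true⇒⊎ {false} e = inj₂ e

  ≡ᵇ⇒≡′ : ∀ {x y} → (x ≡ᵇ y) ≡ true → x ≡ y
  ≡ᵇ⇒≡′ = eqb⇒≡ _≟_

  ≡ᵇ-refl : ∀ x → (x ≡ᵇ x) ≡ true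
  ≡ᵇ-refl = eqb-refl _≟_

  ≢⇒≡ᵇ-false : ∀ {x y} → x ≢ y → (x ≡ᵇ y) ≡ false
  ≢⇒≡ᵇ-false = ≢⇒eqb _≟_

  ≡ᵇ-sym : ∀ x y → (x ≡ᵇ y) ≡ (y ≡ᵇ x)
  ≡ᵇ-sym = eqb-sym _≟_

  <ᵇ⇒<′ : ∀ {x t} → (x <ᵇ t) ≡ true → x < t
  <ᵇ⇒<′ {x} {t} e = <ᵇ⇒< x t (subst T (sym e) tt)

  <⇒<ᵇ′ : ∀ {x t} → x < t → (x <ᵇ t) ≡ true
  <⇒<ᵇ′ {x} {t} x<t with x <ᵇ t | <⇒<ᵇ x<t
  ... | true | _ = refl

  ≮⇒<ᵇ-false : ∀ {x t} → ¬ x < t → (x <ᵇ t) ≡ false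
  ≮⇒<ᵇ-false {x} {t} x≮t with x <ᵇ t in e
  ... | false = refl
  ... | true = ⊥-elim (x≮t (<ᵇ⇒<′ e))

  and-∈ : ∀ {xs : List Bool} {x} → and xs ≡ true → x ∈ xs → x ≡ true
  and-∈ {y ∷ xs} e (here refl) = ∧-trueˡ e
  and-∈ {y ∷ xs} e (there m) = and-∈ {xs} (∧-trueʳ {y} e) m

  and-true : ∀ (xs : List Bool) → (∀ x → x ∈ xs → x ≡ true) → and xs ≡ true
  and-true [] h = refl
  and-true (y ∷ xs) h = ∧-true (h y (here refl)) (and-true xs (λ x m → h x (there m)))

  and-allFin : ∀ {m} (F : Fin m → Bool) → and (map F (allFin m)) ≡ true → ∀ c → F c ≡ true
  and-allFin {m} F e c = and-∈ {map F (allFin m)} e (∈-map⁺ F (∈-allFin c))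

  and-allFin⁻ : ∀ {m} (F : Fin m → Bool) → (∀ c → F c ≡ true) → and (map F (allFin m)) ≡ true
  and-allFin⁻ {m} F h = and-true (map F (allFin m)) λ x x∈ → let c , _ , x≡Fc = ∈-map⁻ F x∈ in trans x≡Fc (h c)

  and-allFin² : ∀ {N} (F : Fin N → Fin N → Bool) →
    and (concatMap (λ i → map (F i) (allFin N)) (allFin N)) ≡ true → ∀ i j → F i j ≡ true
  and-allFin² {N} F e i j =
    and-∈ e (∈-concatMap⁺ (λ i → map (F i) (allFin N)) (lose (∈-allFin i) (∈-map⁺ (F i) (∈-allFin j))))

  and-allFin²⁻ : ∀ {N} (F : Fin N → Fin N → Bool) → (∀ i j → F i j ≡ true) →
    and (concatMap (λ i → map (F i) (allFin N)) (allFin N)) ≡ true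
  and-allFin²⁻ {N} F h = and-true _ λ x x∈ →
    let i , _ , x∈Fi = find (∈-concatMap⁻ (λ i → map (F i) (allFin N)) {allFin N} x∈)
        j , _ , x≡Fij = ∈-map⁻ (F i) x∈Fi
    in trans x≡Fij (h i j)

  ∑-cartesianProduct : {A B : Set} (xs : List A) (ys : List B) (h : A × B → ℕ) →
    ∑ (cartesianProduct xs ys) h ≡ ∑ xs (λ a → ∑ ys (λ b → h (a , b)))
  ∑-cartesianProduct [] ys h = refl
  ∑-cartesianProduct (x ∷ xs) ys h =
    trans (∑-++ (map (x ,_) ys) (cartesianProduct xs ys) h)
          (cong₂ _+_ (∑-map ys (x ,_) h) (∑-cartesianProduct xs ys h))

  module _ {A B : Set} (_≟A_ : DecidableEquality A) (_≟B_ : DecidableEquality B) where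

    _≟×_ : DecidableEquality (A × B)
    _≟×_ = Productₚ.≡-dec _≟A_ _≟B_

    eqb-× : ∀ a b a′ b′ → eqb _≟×_ (a , b) (a′ , b′) ≡ eqb _≟A_ a a′ ∧ eqb _≟B_ b b′
    eqb-× a b a′ b′ = bool-ext
      (λ e → let p = eqb⇒≡ _≟×_ e in ∧-true (≡⇒eqb _≟A_ (cong proj₁ p)) (≡⇒eqb _≟B_ (cong proj₂ p)))
      (λ e → ≡⇒eqb _≟×_ (cong₂ _,_ (eqb⇒≡ _≟A_ (∧-trueˡ e)) (eqb⇒≡ _≟B_ (∧-trueʳ {eqb _≟A_ a a′} e))))

    cartesianProduct-enumerates : ∀ xs ys {VA VB} → Enumerates _≟A_ xs VA → Enumerates _≟B_ ys VB →
      Enumerates _≟×_ (cartesianProduct xs ys) (λ (a , b) → VA a ∧ VB b)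
    cartesianProduct-enumerates xs ys {VA} {VB} enA enB (a , b) = begin
      ∑ (cartesianProduct xs ys) (λ p → ⟦ eqb _≟×_ p (a , b) ⟧)
        ≡⟨ ∑-cartesianProduct xs ys _ ⟩
      ∑ xs (λ a′ → ∑ ys (λ b′ → ⟦ eqb _≟×_ (a′ , b′) (a , b) ⟧))
        ≡⟨ ∑-ext xs (λ a′ → trans (∑-ext ys (λ b′ → trans (cong ⟦_⟧ (eqb-× a′ b′ a b)) (⟦∧⟧ (eqb _≟A_ a′ a) _)))
                                  (∑-*ˡ ys ⟦ eqb _≟A_ a′ a ⟧ _)) ⟩
      ∑ xs (λ a′ → ⟦ eqb _≟A_ a′ a ⟧ * ∑ ys (λ b′ → ⟦ eqb _≟B_ b′ b ⟧))
        ≡⟨ trans (∑-*ʳ xs _ _) (cong₂ _*_ (enA a) (enB b)) ⟩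
      ⟦ VA a ⟧ * ⟦ VB b ⟧
        ≡⟨ sym (⟦∧⟧ (VA a) _) ⟩
      ⟦ VA a ∧ VB b ⟧ ∎
      where open ≡-Reasoning

  Distinct : List ℕ → Set
  Distinct [] = ⊤
  Distinct (a ∷ L) = elemℕ a L ≡ false × Distinct L

  elemℕ-++ : ∀ x R S → elemℕ x (R ++ S) ≡ elemℕ x R ∨ elemℕ x S
  elemℕ-++ x [] S = refl
  elemℕ-++ x (a ∷ R) S rewrite elemℕ-++ x R S = sym (∨-assoc (x ≡ᵇ a) _ _)

  elemℕ-middle : ∀ c R F → elemℕ c (R ++ c ∷ F) ≡ true
  elemℕ-middle c [] F rewrite ≡ᵇ-refl c = refl
  elemℕ-middle c (a ∷ R) F = ∨-trueʳ (c ≡ᵇ a) (elemℕ-middle c R F)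

  ∈⇒elemℕ : ∀ {x L} → x ∈ L → elemℕ x L ≡ true
  ∈⇒elemℕ {x} (here refl) rewrite ≡ᵇ-refl x = refl
  ∈⇒elemℕ {x} {a ∷ L} (there m) = ∨-trueʳ (x ≡ᵇ a) (∈⇒elemℕ m)

  module _ (R : List ℕ) (c : ℕ) (F : List ℕ) where

    Distinct-middleˡ : Distinct (R ++ c ∷ F) → elemℕ c R ≡ false
    Distinct-middleˡ = go R
      where
      go : ∀ R → Distinct (R ++ c ∷ F) → elemℕ c R ≡ false
      go [] d = refl
      go (a ∷ R) (a∉ , d) = ∨-false (≢⇒≡ᵇ-false c≢a) (go R d)
        where
        c≢a : c ≢ a
        c≢a refl = true≢false (trans (sym (elemℕ-middle c R F)) a∉)

    Distinct-middleʳ : Distinct (R ++ c ∷ F) → elemℕ c F ≡ false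
    Distinct-middleʳ = go R
      where
      go : ∀ R → Distinct (R ++ c ∷ F) → elemℕ c F ≡ false
      go [] (c∉ , _) = c∉
      go (a ∷ R) (_ , d) = go R d

    Distinct-removeMiddle : Distinct (R ++ c ∷ F) → Distinct (R ++ F)
    Distinct-removeMiddle = go R
      where
      go : ∀ R → Distinct (R ++ c ∷ F) → Distinct (R ++ F)
      go [] (_ , d) = d
      go (a ∷ R) (a∉ , d) = a∉RF , go R d
        where
        a∉RcF : (elemℕ a R ∨ ((a ≡ᵇ c) ∨ elemℕ a F)) ≡ false
        a∉RcF = trans (sym (elemℕ-++ a R (c ∷ F))) a∉
        a∉RF : elemℕ a (R ++ F) ≡ false
        a∉RF = trans (elemℕ-++ a R F)
          (∨-false (∨-falseˡ a∉RcF) (∨-falseʳ {a ≡ᵇ c} (∨-falseʳ {elemℕ a R} a∉RcF)))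

  Distinct-enumerates : ∀ L → Distinct L → Enumerates _≟_ L (λ z → elemℕ z L)
  Distinct-enumerates [] d z = refl
  Distinct-enumerates (a ∷ L) (a∉ , d) z with a ≟ z
  ... | yes refl rewrite ≡ᵇ-refl a = cong suc (∑-zero L not-a)
    where
    not-a : ∀ x → x ∈ L → ⟦ x ≡ᵇ a ⟧ ≡ 0
    not-a x x∈L = cong ⟦_⟧ (≢⇒≡ᵇ-false {x} {a} λ { refl → true≢false (trans (sym (∈⇒elemℕ x∈L)) a∉) })
  ... | no a≢z rewrite ≢⇒≡ᵇ-false a≢z | ≢⇒≡ᵇ-false (λ z≡a → a≢z (sym z≡a)) = Distinct-enumerates L d z

  Unique⇒Distinct : ∀ L → Unique L → Distinct L
  Unique⇒Distinct [] [] = tt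
  Unique⇒Distinct (a ∷ L) (a∉ ∷ u) = notElem a L a∉ , Unique⇒Distinct L u
    where
    notElem : ∀ a L → All (a ≢_) L → elemℕ a L ≡ false
    notElem a [] [] = refl
    notElem a (b ∷ L) (a≢b ∷ a∉) = ∨-false (≢⇒≡ᵇ-false a≢b) (notElem a L a∉)

  Distinct-upTo : ∀ t → Distinct (upTo t)
  Distinct-upTo t = Unique⇒Distinct (upTo t) (upTo⁺ t)

  -- Proper colourings with natural-number colours

  _≟ᵥ_ : ∀ {N} → DecidableEquality (Vec ℕ N)
  _≟ᵥ_ = Vecₚ.≡-dec _≟_

  colourings : (N : ℕ) → List ℕ → List (Vec ℕ N)
  colourings zero L = [ []ᵥ ]
  colourings (suc N) L = concatMap (λ c → map (c ∷ᵥ_) (colourings N L)) L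

  ∑-colourings-suc : ∀ N L (h : Vec ℕ (suc N) → ℕ) →
    ∑ (colourings (suc N) L) h ≡ ∑ L (λ c → ∑ (colourings N L) (λ κ → h (c ∷ᵥ κ)))
  ∑-colourings-suc N L h = trans (∑-concatMap L _ h) (∑-ext L (λ c → ∑-map (colourings N L) _ h))

  allᵥ : ∀ {N} → (ℕ → Bool) → Vec ℕ N → Bool
  allᵥ P []ᵥ = true
  allᵥ P (x ∷ᵥ κ) = P x ∧ allᵥ P κ

  allᵥ⇒lookup : ∀ {N} (P : ℕ → Bool) (κ : Vec ℕ N) → allᵥ P κ ≡ true → ∀ i → P (lookup κ i) ≡ true
  allᵥ⇒lookup P (x ∷ᵥ κ) e Fin.zero = ∧-trueˡ e
  allᵥ⇒lookup P (x ∷ᵥ κ) e (Fin.suc i) = allᵥ⇒lookup P κ (∧-trueʳ {P x} e) i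

  lookup⇒allᵥ : ∀ {N} (P : ℕ → Bool) (κ : Vec ℕ N) → (∀ i → P (lookup κ i) ≡ true) → allᵥ P κ ≡ true
  lookup⇒allᵥ P []ᵥ h = refl
  lookup⇒allᵥ P (x ∷ᵥ κ) h = ∧-true (h Fin.zero) (lookup⇒allᵥ P κ (λ i → h (Fin.suc i)))

  allᵥ-map : ∀ {N} {P Q : ℕ → Bool} (σ : ℕ → ℕ) (κ : Vec ℕ N) →
    (∀ x → P x ≡ true → Q (σ x) ≡ true) → allᵥ P κ ≡ true → allᵥ Q (mapᵥ σ κ) ≡ true
  allᵥ-map σ []ᵥ h e = refl
  allᵥ-map {P = P} σ (x ∷ᵥ κ) h e = ∧-true (h x (∧-trueˡ e)) (allᵥ-map σ κ h (∧-trueʳ {P x} e))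

  map-inverseᵥ : ∀ {N} {P : ℕ → Bool} (σ σ′ : ℕ → ℕ) (κ : Vec ℕ N) →
    (∀ x → P x ≡ true → σ′ (σ x) ≡ x) → allᵥ P κ ≡ true → mapᵥ σ′ (mapᵥ σ κ) ≡ κ
  map-inverseᵥ σ σ′ []ᵥ h e = refl
  map-inverseᵥ {P = P} σ σ′ (x ∷ᵥ κ) h e =
    cong₂ _∷ᵥ_ (h x (∧-trueˡ e)) (map-inverseᵥ σ σ′ κ h (∧-trueʳ {P x} e))

  colourings-enumerates : ∀ N L (P : ℕ → Bool) → Enumerates _≟_ L P → Enumerates _≟ᵥ_ (colourings N L) (allᵥ P)
  colourings-enumerates zero L P en []ᵥ = refl
  colourings-enumerates (suc N) L P en (z ∷ᵥ w) = begin
    ∑ (colourings (suc N) L) (λ κ → ⟦ eqb _≟ᵥ_ κ (z ∷ᵥ w) ⟧)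
      ≡⟨ ∑-colourings-suc N L _ ⟩
    ∑ L (λ c → ∑ (colourings N L) (λ κ → ⟦ eqb _≟ᵥ_ (c ∷ᵥ κ) (z ∷ᵥ w) ⟧))
      ≡⟨ ∑-ext L (λ c → trans (∑-ext (colourings N L) (λ κ → trans (cong ⟦_⟧ (eqb-∷ c κ)) (⟦∧⟧ (c ≡ᵇ z) _)))
                              (∑-*ˡ (colourings N L) ⟦ c ≡ᵇ z ⟧ _)) ⟩
    ∑ L (λ c → ⟦ c ≡ᵇ z ⟧ * ∑ (colourings N L) (λ κ → ⟦ eqb _≟ᵥ_ κ w ⟧))
      ≡⟨ ∑-*ʳ L _ _ ⟩
    ∑ L (λ c → ⟦ c ≡ᵇ z ⟧) * ∑ (colourings N L) (λ κ → ⟦ eqb _≟ᵥ_ κ w ⟧)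
      ≡⟨ cong₂ _*_ (en z) (colourings-enumerates N L P en w) ⟩
    ⟦ P z ⟧ * ⟦ allᵥ P w ⟧
      ≡⟨ sym (⟦∧⟧ (P z) _) ⟩
    ⟦ allᵥ P (z ∷ᵥ w) ⟧ ∎
    where
    open ≡-Reasoning
    eqb-∷ : ∀ c κ → eqb _≟ᵥ_ (c ∷ᵥ κ) (z ∷ᵥ w) ≡ (c ≡ᵇ z) ∧ eqb _≟ᵥ_ κ w
    eqb-∷ c κ with c ≟ z | κ ≟ᵥ w
    ... | yes refl | yes refl = refl
    ... | yes refl | no _ = refl
    ... | no _ | _ = refl

  ∑-colourings-restrict : ∀ N (L : List ℕ) (P : ℕ → Bool) (h : Vec ℕ N → ℕ) →
    ∑ (colourings N L) (λ κ → ⟦ allᵥ P κ ⟧ * h κ) ≡ ∑ (colourings N (filterᵇ P L)) h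
  ∑-colourings-restrict zero L P h = cong (_+ 0) (+-identityʳ (h []ᵥ))
  ∑-colourings-restrict (suc N) L P h = begin
    ∑ (colourings (suc N) L) (λ κ → ⟦ allᵥ P κ ⟧ * h κ)
      ≡⟨ ∑-colourings-suc N L _ ⟩
    ∑ L (λ c → ∑ (colourings N L) (λ κ → ⟦ P c ∧ allᵥ P κ ⟧ * h (c ∷ᵥ κ)))
      ≡⟨ ∑-ext L (λ c → trans (∑-ext (colourings N L) (λ κ → trans (cong (_* h (c ∷ᵥ κ)) (⟦∧⟧ (P c) _))
                                                                   (*-assoc ⟦ P c ⟧ _ _)))
                              (∑-*ˡ (colourings N L) ⟦ P c ⟧ _)) ⟩
    ∑ L (λ c → ⟦ P c ⟧ * ∑ (colourings N L) (λ κ → ⟦ allᵥ P κ ⟧ * h (c ∷ᵥ κ)))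
      ≡⟨ ∑-ext L (λ c → cong (⟦ P c ⟧ *_) (∑-colourings-restrict N L P (λ κ → h (c ∷ᵥ κ)))) ⟩
    ∑ L (λ c → ⟦ P c ⟧ * ∑ (colourings N (filterᵇ P L)) (λ κ → h (c ∷ᵥ κ)))
      ≡⟨ sym (∑-filterᵇ L P _) ⟩
    ∑ (filterᵇ P L) (λ c → ∑ (colourings N (filterᵇ P L)) (λ κ → h (c ∷ᵥ κ)))
      ≡⟨ sym (∑-colourings-suc N (filterᵇ P L) h) ⟩
    ∑ (colourings (suc N) (filterᵇ P L)) h ∎
    where open ≡-Reasoning

  properℕ : ∀ {N} → (Fin N → Fin N → Bool) → Vec ℕ N → Bool
  properℕ {N} ad κ =
    and (concatMap (λ i → map (λ j → not (ad i j) ∨ not (lookup κ i ≡ᵇ lookup κ j)) (allFin N)) (allFin N))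

  Proper : ∀ {N} → (Fin N → Fin N → Bool) → Vec ℕ N → Set
  Proper ad κ = ∀ i j → ad i j ≡ true → lookup κ i ≢ lookup κ j

  properℕ⇒Proper : ∀ {N} (ad : Fin N → Fin N → Bool) κ → properℕ ad κ ≡ true → Proper ad κ
  properℕ⇒Proper ad κ e i j aij κi≡κj = true≢false (trans (sym (and-allFin² _ e i j)) clash)
    where
    clash : (not (ad i j) ∨ not (lookup κ i ≡ᵇ lookup κ j)) ≡ false
    clash rewrite aij | κi≡κj | ≡ᵇ-refl (lookup κ j) = refl

  Proper⇒properℕ : ∀ {N} (ad : Fin N → Fin N → Bool) κ → Proper ad κ → properℕ ad κ ≡ true
  Proper⇒properℕ ad κ h = and-allFin²⁻ _ edge-ok
    where
    edge-ok : ∀ i j → (not (ad i j) ∨ not (lookup κ i ≡ᵇ lookup κ j)) ≡ true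
    edge-ok i j with ad i j in aij
    ... | false = refl
    ... | true rewrite ≢⇒≡ᵇ-false (h i j aij) = refl

  properℕ-map : ∀ {N} (ad : Fin N → Fin N → Bool) (σ : ℕ → ℕ) (κ : Vec ℕ N) →
    (∀ i j → σ (lookup κ i) ≡ σ (lookup κ j) → lookup κ i ≡ lookup κ j) →
    properℕ ad (mapᵥ σ κ) ≡ properℕ ad κ
  properℕ-map ad σ κ σ-inj = bool-ext
    (λ e → Proper⇒properℕ ad κ (λ i j a eq → properℕ⇒Proper ad (mapᵥ σ κ) e i j a
         (trans (Vecₚ.lookup-map i σ κ) (trans (cong σ eq) (sym (Vecₚ.lookup-map j σ κ))))))
    (λ e → Proper⇒properℕ ad (mapᵥ σ κ) (λ i j a eq → properℕ⇒Proper ad κ e i j a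
         (σ-inj i j (trans (sym (Vecₚ.lookup-map i σ κ)) (trans eq (Vecₚ.lookup-map j σ κ))))))

  occurs : ∀ {N} → ℕ → Vec ℕ N → Bool
  occurs c []ᵥ = false
  occurs c (x ∷ᵥ κ) = (x ≡ᵇ c) ∨ occurs c κ

  usesAll : ∀ {N} → List ℕ → Vec ℕ N → Bool
  usesAll [] κ = true
  usesAll (c ∷ R) κ = occurs c κ ∧ usesAll R κ

  usesAll-++ : ∀ {N} R S (κ : Vec ℕ N) → usesAll (R ++ S) κ ≡ usesAll R κ ∧ usesAll S κ
  usesAll-++ [] S κ = refl
  usesAll-++ (c ∷ R) S κ rewrite usesAll-++ R S κ = sym (∧-assoc (occurs c κ) _ _)

  not-occurs : ∀ {N} c (κ : Vec ℕ N) → not (occurs c κ) ≡ allᵥ (λ x → not (x ≡ᵇ c)) κ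
  not-occurs c []ᵥ = refl
  not-occurs c (x ∷ᵥ κ) with x ≡ᵇ c
  ... | true = refl
  ... | false = not-occurs c κ

  occurs-lookup : ∀ {N} (κ : Vec ℕ N) i → occurs (lookup κ i) κ ≡ true
  occurs-lookup (x ∷ᵥ κ) Fin.zero rewrite ≡ᵇ-refl x = refl
  occurs-lookup (x ∷ᵥ κ) (Fin.suc i) = ∨-trueʳ _ (occurs-lookup κ i)

  occurs⇒lookup : ∀ {N} (κ : Vec ℕ N) x → occurs x κ ≡ true → ∃ λ i → lookup κ i ≡ x
  occurs⇒lookup (y ∷ᵥ κ) x e with y ≡ᵇ x in y≡x
  ... | true = Fin.zero , ≡ᵇ⇒≡′ y≡x
  ... | false with occurs⇒lookup κ x e
  ... | i , κi≡x = Fin.suc i , κi≡x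

  occurs-map : ∀ {N} (σ : ℕ → ℕ) x (κ : Vec ℕ N) → occurs x κ ≡ true → occurs (σ x) (mapᵥ σ κ) ≡ true
  occurs-map σ x κ e with i , κi≡x ← occurs⇒lookup κ x e =
    subst (λ z → occurs z (mapᵥ σ κ) ≡ true) (trans (Vecₚ.lookup-map i σ κ) (cong σ κi≡x)) (occurs-lookup (mapᵥ σ κ) i)

  usesAll⇒occurs : ∀ {N} R (κ : Vec ℕ N) → usesAll R κ ≡ true → ∀ c → elemℕ c R ≡ true → occurs c κ ≡ true
  usesAll⇒occurs (a ∷ R) κ e c c∈ with c ≡ᵇ a in c≡a
  ... | true = subst (λ z → occurs z κ ≡ true) (sym (≡ᵇ⇒≡′ c≡a)) (∧-trueˡ e)
  ... | false = usesAll⇒occurs R κ (∧-trueʳ {occurs a κ} e) c c∈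

  occurs⇒usesAll : ∀ {N} R (κ : Vec ℕ N) → (∀ c → elemℕ c R ≡ true → occurs c κ ≡ true) → usesAll R κ ≡ true
  occurs⇒usesAll [] κ h = refl
  occurs⇒usesAll (a ∷ R) κ h =
    ∧-true (h a (cong (_∨ elemℕ a R) (≡ᵇ-refl a))) (occurs⇒usesAll R κ (λ c c∈ → h c (∨-trueʳ (c ≡ᵇ a) c∈)))

  -- The chromatic polynomial through colourings onto a palette

  χ : ∀ {N} → (Fin N → Fin N → Bool) → ℕ → ℕ
  χ {N} ad t = ∑ (colourings N (upTo t)) (λ κ → ⟦ properℕ ad κ ⟧)

  onto : ∀ {N} → (Fin N → Fin N → Bool) → List ℕ → ℕ
  onto {N} ad L = ∑ (colourings N L) (λ κ → ⟦ properℕ ad κ ∧ usesAll L κ ⟧)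

  ontoCount : ∀ {N} → (Fin N → Fin N → Bool) → ℕ → ℕ
  ontoCount ad j = onto ad (upTo j)

  sublists : List ℕ → List (List ℕ)
  sublists [] = [ [] ]
  sublists (c ∷ F) = map (c ∷_) (sublists F) ++ sublists F

  filterᵇ-≢-∉ : ∀ c L → elemℕ c L ≡ false → filterᵇ (λ x → not (x ≡ᵇ c)) L ≡ L
  filterᵇ-≢-∉ c [] e = refl
  filterᵇ-≢-∉ c (a ∷ L) e rewrite ≡ᵇ-sym a c | ∨-falseˡ {c ≡ᵇ a} e =
    cong (a ∷_) (filterᵇ-≢-∉ c L (∨-falseʳ {c ≡ᵇ a} e))

  filterᵇ-≢-middle : ∀ c R F → elemℕ c R ≡ false → elemℕ c F ≡ false →
    filterᵇ (λ x → not (x ≡ᵇ c)) (R ++ c ∷ F) ≡ R ++ F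
  filterᵇ-≢-middle c R F c∉R c∉F
    rewrite Listₚ.filter-++ (T? ∘ λ x → not (x ≡ᵇ c)) R (c ∷ F) | ≡ᵇ-refl c
          | filterᵇ-≢-∉ c R c∉R | filterᵇ-≢-∉ c F c∉F = refl

  module SublistExpansion {N : ℕ} (ad : Fin N → Fin N → Bool) where

    usingAll : List ℕ → List ℕ → ℕ
    usingAll R F = ∑ (colourings N (R ++ F)) (λ κ → ⟦ properℕ ad κ ∧ usesAll R κ ⟧)

    ∑-avoiding : ∀ c R F (h : Vec ℕ N → ℕ) → elemℕ c R ≡ false → elemℕ c F ≡ false →
      ∑ (colourings N (R ++ c ∷ F)) (λ κ → ⟦ not (occurs c κ) ⟧ * h κ) ≡ ∑ (colourings N (R ++ F)) h
    ∑-avoiding c R F h c∉R c∉F = begin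
      ∑ (colourings N (R ++ c ∷ F)) (λ κ → ⟦ not (occurs c κ) ⟧ * h κ)
        ≡⟨ ∑-ext (colourings N (R ++ c ∷ F)) (λ κ → cong (λ b → ⟦ b ⟧ * h κ) (not-occurs c κ)) ⟩
      ∑ (colourings N (R ++ c ∷ F)) (λ κ → ⟦ allᵥ (λ x → not (x ≡ᵇ c)) κ ⟧ * h κ)
        ≡⟨ ∑-colourings-restrict N (R ++ c ∷ F) _ h ⟩
      ∑ (colourings N (filterᵇ (λ x → not (x ≡ᵇ c)) (R ++ c ∷ F))) h
        ≡⟨ cong (λ L → ∑ (colourings N L) h) (filterᵇ-≢-middle c R F c∉R c∉F) ⟩
      ∑ (colourings N (R ++ F)) h ∎
      where open ≡-Reasoning

    usingAll-step : ∀ R c F → Distinct (R ++ c ∷ F) → usingAll R (c ∷ F) ≡ usingAll (R ++ [ c ]) F + usingAll R F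
    usingAll-step R c F d = begin
      usingAll R (c ∷ F)
        ≡⟨ ∑-ext (colourings N (R ++ c ∷ F)) (λ κ → split (properℕ ad κ ∧ usesAll R κ) (occurs c κ)) ⟩
      ∑ (colourings N (R ++ c ∷ F)) (λ κ → ⟦ (properℕ ad κ ∧ usesAll R κ) ∧ occurs c κ ⟧
                                          + ⟦ not (occurs c κ) ⟧ * ⟦ properℕ ad κ ∧ usesAll R κ ⟧)
        ≡⟨ ∑-+ (colourings N (R ++ c ∷ F)) _ _ ⟩
      ∑ (colourings N (R ++ c ∷ F)) (λ κ → ⟦ (properℕ ad κ ∧ usesAll R κ) ∧ occurs c κ ⟧)
        + ∑ (colourings N (R ++ c ∷ F)) (λ κ → ⟦ not (occurs c κ) ⟧ * ⟦ properℕ ad κ ∧ usesAll R κ ⟧)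
        ≡⟨ cong₂ _+_ using-c (∑-avoiding c R F _ (Distinct-middleˡ R c F d) (Distinct-middleʳ R c F d)) ⟩
      usingAll (R ++ [ c ]) F + usingAll R F ∎
      where
      open ≡-Reasoning
      split : ∀ b o → ⟦ b ⟧ ≡ ⟦ b ∧ o ⟧ + ⟦ not o ⟧ * ⟦ b ⟧
      split true true = refl
      split true false = refl
      split false true = refl
      split false false = refl
      using-c : ∑ (colourings N (R ++ c ∷ F)) (λ κ → ⟦ (properℕ ad κ ∧ usesAll R κ) ∧ occurs c κ ⟧)
                ≡ usingAll (R ++ [ c ]) F
      using-c rewrite Listₚ.++-assoc R [ c ] F = ∑-ext (colourings N (R ++ c ∷ F)) λ κ →
        cong ⟦_⟧ (trans (∧-assoc (properℕ ad κ) _ _)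
                 (cong (properℕ ad κ ∧_) (trans (cong (usesAll R κ ∧_) (sym (∧-identityʳ (occurs c κ))))
                                                (sym (usesAll-++ R [ c ] κ)))))

    usingAll-sublists : ∀ F R → Distinct (R ++ F) → usingAll R F ≡ ∑ (sublists F) (λ F′ → onto ad (R ++ F′))
    usingAll-sublists [] R d rewrite Listₚ.++-identityʳ R = sym (+-identityʳ _)
    usingAll-sublists (c ∷ F) R d = begin
      usingAll R (c ∷ F)
        ≡⟨ usingAll-step R c F d ⟩
      usingAll (R ++ [ c ]) F + usingAll R F
        ≡⟨ cong₂ _+_ (usingAll-sublists F (R ++ [ c ]) (subst Distinct (sym (Listₚ.++-assoc R [ c ] F)) d))
                     (usingAll-sublists F R (Distinct-removeMiddle R c F d)) ⟩
      ∑ (sublists F) (λ F′ → onto ad ((R ++ [ c ]) ++ F′)) + ∑ (sublists F) (λ F′ → onto ad (R ++ F′))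
        ≡⟨ cong (_+ ∑ (sublists F) (λ F′ → onto ad (R ++ F′)))
                (trans (∑-ext (sublists F) (λ F′ → cong (onto ad) (Listₚ.++-assoc R [ c ] F′)))
                       (sym (∑-map (sublists F) (c ∷_) (λ F′ → onto ad (R ++ F′))))) ⟩
      ∑ (map (c ∷_) (sublists F)) (λ F′ → onto ad (R ++ F′)) + ∑ (sublists F) (λ F′ → onto ad (R ++ F′))
        ≡⟨ sym (∑-++ (map (c ∷_) (sublists F)) (sublists F) _) ⟩
      ∑ (sublists (c ∷ F)) (λ F′ → onto ad (R ++ F′)) ∎
      where open ≡-Reasoning

    χ-sublists : ∀ t → χ ad t ≡ ∑ (sublists (upTo t)) (onto ad)
    χ-sublists t = trans (∑-ext (colourings N (upTo t)) (λ κ → cong ⟦_⟧ (sym (∧-identityʳ (properℕ ad κ)))))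
                         (usingAll-sublists (upTo t) [] (Distinct-upTo t))

  relabel : List ℕ → List ℕ → ℕ → ℕ
  relabel [] L′ x = x
  relabel (a ∷ L) [] x = x
  relabel (a ∷ L) (b ∷ L′) x = if x ≡ᵇ a then b else relabel L L′ x

  relabel-elemℕ : ∀ L L′ x → length L ≡ length L′ → elemℕ x L ≡ true → elemℕ (relabel L L′ x) L′ ≡ true
  relabel-elemℕ (a ∷ L) (b ∷ L′) x len x∈ with x ≡ᵇ a
  ... | true rewrite ≡ᵇ-refl b = refl
  ... | false = ∨-trueʳ _ (relabel-elemℕ L L′ x (suc-injective len) x∈)

  relabel-≢ : ∀ L L′ x b → elemℕ b L′ ≡ false → length L ≡ length L′ → elemℕ x L ≡ true →
    (relabel L L′ x ≡ᵇ b) ≡ false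
  relabel-≢ L L′ x b b∉L′ len x∈ = ≢⇒≡ᵇ-false {relabel L L′ x} {b}
    λ { refl → true≢false (trans (sym (relabel-elemℕ L L′ x len x∈)) b∉L′) }

  relabel-inverse : ∀ L L′ x → Distinct L → Distinct L′ → length L ≡ length L′ → elemℕ x L ≡ true →
    relabel L′ L (relabel L L′ x) ≡ x
  relabel-inverse (a ∷ L) (b ∷ L′) x (_ , dL) (b∉L′ , dL′) len x∈ with x ≡ᵇ a in x≡a
  ... | true rewrite ≡ᵇ-refl b = sym (≡ᵇ⇒≡′ x≡a)
  ... | false rewrite relabel-≢ L L′ x b b∉L′ (suc-injective len) x∈ =
    relabel-inverse L L′ x dL dL′ (suc-injective len) x∈

  module _ {N : ℕ} (ad : Fin N → Fin N → Bool) where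

    private
      relabel-onto : ∀ L L′ → Distinct L → Distinct L′ → length L ≡ length L′ → ∀ κ →
        allᵥ (λ z → elemℕ z L) κ ≡ true → (properℕ ad κ ∧ usesAll L κ) ≡ true →
        (properℕ ad (mapᵥ (relabel L L′) κ) ∧ usesAll L′ (mapᵥ (relabel L L′) κ)) ≡ true
      relabel-onto L L′ dL dL′ len κ κ∈L onto-κ = ∧-true proper′ uses′
        where
        σ = relabel L L′
        σ⁻¹ = relabel L′ L
        σ-inj : ∀ i j → σ (lookup κ i) ≡ σ (lookup κ j) → lookup κ i ≡ lookup κ j
        σ-inj i j e = trans (sym (relabel-inverse L L′ _ dL dL′ len (allᵥ⇒lookup _ κ κ∈L i)))
                            (trans (cong σ⁻¹ e) (relabel-inverse L L′ _ dL dL′ len (allᵥ⇒lookup _ κ κ∈L j)))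
        proper′ : properℕ ad (mapᵥ σ κ) ≡ true
        proper′ = trans (properℕ-map ad σ κ σ-inj) (∧-trueˡ onto-κ)
        uses′ : usesAll L′ (mapᵥ σ κ) ≡ true
        uses′ = occurs⇒usesAll L′ (mapᵥ σ κ) λ y y∈L′ →
          subst (λ z → occurs z (mapᵥ σ κ) ≡ true) (relabel-inverse L′ L y dL′ dL (sym len) y∈L′)
            (occurs-map σ (σ⁻¹ y) κ (usesAll⇒occurs L κ (∧-trueʳ {properℕ ad κ} onto-κ) (σ⁻¹ y)
                                                        (relabel-elemℕ L′ L y (sym len) y∈L′)))

    onto-relabel : ∀ L L′ → Distinct L → Distinct L′ → length L ≡ length L′ → onto ad L ≡ onto ad L′
    onto-relabel L L′ dL dL′ len = count-bijection _≟ᵥ_ _≟ᵥ_ (colourings N L) (colourings N L′)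
      (colourings-enumerates N L _ (Distinct-enumerates L dL))
      (colourings-enumerates N L′ _ (Distinct-enumerates L′ dL′))
      record
        { to = mapᵥ (relabel L L′)
        ; from = mapᵥ (relabel L′ L)
        ; to-valid = λ κ κ∈L _ → allᵥ-map (relabel L L′) κ (λ x → relabel-elemℕ L L′ x len) κ∈L
        ; to-pred = relabel-onto L L′ dL dL′ len
        ; from-valid = λ κ κ∈L′ _ → allᵥ-map (relabel L′ L) κ (λ x → relabel-elemℕ L′ L x (sym len)) κ∈L′
        ; from-pred = relabel-onto L′ L dL′ dL (sym len)
        ; to∘from = λ κ κ∈L′ _ → map-inverseᵥ (relabel L′ L) (relabel L L′) κ
                                   (λ x → relabel-inverse L′ L x dL′ dL (sym len)) κ∈L′
        ; from∘to = λ κ κ∈L _ → map-inverseᵥ (relabel L L′) (relabel L′ L) κ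
                                   (λ x → relabel-inverse L L′ x dL dL′ len) κ∈L
        }

  elemℕ-filterᵇ : ∀ (p : ℕ → Bool) c L → elemℕ c (filterᵇ p L) ≡ true → p c ≡ true × elemℕ c L ≡ true
  elemℕ-filterᵇ p c (a ∷ L) c∈ with p a in pa
  ... | false = let pc , c∈L = elemℕ-filterᵇ p c L c∈ in pc , ∨-trueʳ (c ≡ᵇ a) c∈L
  ... | true with c ≡ᵇ a in c≡a
  ...   | true = subst (λ z → p z ≡ true) (sym (≡ᵇ⇒≡′ c≡a)) pa , refl
  ...   | false = elemℕ-filterᵇ p c L c∈

  Distinct-filterᵇ : ∀ (p : ℕ → Bool) L → Distinct L → Distinct (filterᵇ p L)
  Distinct-filterᵇ p [] d = tt
  Distinct-filterᵇ p (a ∷ L) (a∉ , d) with p a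
  ... | true = a∉filter , Distinct-filterᵇ p L d
    where
    a∉filter : elemℕ a (filterᵇ p L) ≡ false
    a∉filter with elemℕ a (filterᵇ p L) in a∈
    ... | false = refl
    ... | true = ⊥-elim (true≢false (trans (sym (proj₂ (elemℕ-filterᵇ p a L a∈))) a∉))
  ... | false = Distinct-filterᵇ p L d

  length-remove : ∀ d L → Distinct L → length L ≤ suc (length (filterᵇ (λ x → not (x ≡ᵇ d)) L))
  length-remove d [] _ = z≤n
  length-remove d (a ∷ L) (a∉ , dL) with a ≡ᵇ d in a≡d
  ... | true rewrite filterᵇ-≢-∉ d L (subst (λ z → elemℕ z L ≡ false) (≡ᵇ⇒≡′ {a} {d} a≡d) a∉) = ≤-refl
  ... | false = s≤s (length-remove d L dL)

  usesAll-pigeonhole : ∀ N L → Distinct L → N < length L → (κ : Vec ℕ N) → usesAll L κ ≡ false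
  usesAll-pigeonhole zero (a ∷ L) d lt []ᵥ = refl
  usesAll-pigeonhole (suc N) L d lt (x ∷ᵥ κ) with usesAll L (x ∷ᵥ κ) in uses
  ... | false = refl
  ... | true = ⊥-elim (true≢false (trans (sym uses′) (usesAll-pigeonhole N L′ (Distinct-filterᵇ _ L d) lt′ κ)))
    where
    L′ = filterᵇ (λ y → not (y ≡ᵇ x)) L
    lt′ : N < length L′
    lt′ = ≤-pred (≤-trans lt (length-remove x L d))
    occurs-rest : ∀ c → not (c ≡ᵇ x) ≡ true × elemℕ c L ≡ true → occurs c κ ≡ true
    occurs-rest c (c≢x , c∈L) with usesAll⇒occurs L (x ∷ᵥ κ) uses c c∈L
    ... | c∈xκ rewrite ≡ᵇ-sym x c with c ≡ᵇ x
    ... | false = c∈xκ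
    occurs-rest c (() , c∈L) | _ | true
    uses′ : usesAll L′ κ ≡ true
    uses′ = occurs⇒usesAll L′ κ λ c c∈ → occurs-rest c (elemℕ-filterᵇ _ c L c∈)

  sublists-elemℕ : ∀ L F x → F ∈ sublists L → elemℕ x F ≡ true → elemℕ x L ≡ true
  sublists-elemℕ [] .[] x (here refl) ()
  sublists-elemℕ (c ∷ L) F x F∈ x∈F with ∈-++⁻ (map (c ∷_) (sublists L)) F∈
  ... | inj₂ F∈′ = ∨-trueʳ (x ≡ᵇ c) (sublists-elemℕ L F x F∈′ x∈F)
  ... | inj₁ F∈′ with ∈-map⁻ (c ∷_) F∈′
  ... | F′ , F′∈ , refl with x ≡ᵇ c
  ... | true = refl
  ... | false = sublists-elemℕ L F′ x F′∈ x∈F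

  sublists-Distinct : ∀ L F → Distinct L → F ∈ sublists L → Distinct F
  sublists-Distinct [] .[] d (here refl) = tt
  sublists-Distinct (c ∷ L) F (c∉ , d) F∈ with ∈-++⁻ (map (c ∷_) (sublists L)) F∈
  ... | inj₂ F∈′ = sublists-Distinct L F d F∈′
  ... | inj₁ F∈′ with ∈-map⁻ (c ∷_) F∈′
  ... | F′ , F′∈ , refl = c∉F′ , sublists-Distinct L F′ d F′∈
    where
    c∉F′ : elemℕ c F′ ≡ false
    c∉F′ with elemℕ c F′ in c∈
    ... | false = refl
    ... | true = ⊥-elim (true≢false (trans (sym (sublists-elemℕ L F′ c F′∈ c∈)) c∉))

  module _ {N : ℕ} (ad : Fin N → Fin N → Bool) where

    ontoCount-vanishes : ∀ j → N < j → ontoCount ad j ≡ 0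
    ontoCount-vanishes j N<j = ∑-zero (colourings N (upTo j)) λ κ _ →
      trans (cong (λ b → ⟦ properℕ ad κ ∧ b ⟧)
                  (usesAll-pigeonhole N (upTo j) (Distinct-upTo j) (subst (N <_) (sym (Listₚ.length-upTo j)) N<j) κ))
            (cong ⟦_⟧ (∧-zeroʳ (properℕ ad κ)))

    χ-ontoCount : ∀ t → χ ad t ≡ ∑ (sublists (upTo t)) (λ F → ontoCount ad (length F))
    χ-ontoCount t = trans (SublistExpansion.χ-sublists ad t) (∑-cong (sublists (upTo t)) λ F F∈ →
      onto-relabel ad F (upTo (length F)) (sublists-Distinct (upTo t) F (Distinct-upTo t) F∈)
                   (Distinct-upTo (length F)) (sym (Listₚ.length-upTo _)))

  -- Surjective colouring counts from the coefficients of X_G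

  tabulate-toℕ : ∀ {A : Set} (f : ℕ → A) n → Data.List.tabulate {n = n} (f ∘ toℕ) ≡ Data.List.applyUpTo f n
  tabulate-toℕ f zero = refl
  tabulate-toℕ f (suc n) = cong (f 0 ∷_) (tabulate-toℕ (f ∘ suc) n)

  map-toℕ-allFin : ∀ m → map toℕ (allFin m) ≡ upTo m
  map-toℕ-allFin m = trans (Listₚ.map-tabulate (λ i → i) toℕ) (tabulate-toℕ (λ i → i) m)

  ∑-allFin-suc : ∀ {N} (g : Fin (suc N) → ℕ) → ∑ (allFin (suc N)) g ≡ g Fin.zero + ∑ (allFin N) (g ∘ Fin.suc)
  ∑-allFin-suc g = cong (g Fin.zero +_) (cong sum (trans (Listₚ.map-tabulate Fin.suc g)
                                                        (sym (Listₚ.map-tabulate (λ i → i) (g ∘ Fin.suc)))))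

  ∑-allVecs : ∀ N m (h : Vec ℕ N → ℕ) → ∑ (allVecs N m) (h ∘ mapᵥ toℕ) ≡ ∑ (colourings N (upTo m)) h
  ∑-allVecs N m h = trans (go N h) (cong (λ L → ∑ (colourings N L) h) (map-toℕ-allFin m))
    where
    go : ∀ N (h : Vec ℕ N → ℕ) → ∑ (allVecs N m) (h ∘ mapᵥ toℕ) ≡ ∑ (colourings N (map toℕ (allFin m))) h
    go zero h = refl
    go (suc N) h = begin
      ∑ (allVecs (suc N) m) (h ∘ mapᵥ toℕ)
        ≡⟨ ∑-concatMap (allFin m) _ _ ⟩
      ∑ (allFin m) (λ c → ∑ (map (c ∷ᵥ_) (allVecs N m)) (h ∘ mapᵥ toℕ))
        ≡⟨ ∑-ext (allFin m) (λ c → trans (∑-map (allVecs N m) _ _) (go N (λ κ → h (toℕ c ∷ᵥ κ)))) ⟩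
      ∑ (allFin m) (λ c → ∑ (colourings N (map toℕ (allFin m))) (λ κ → h (toℕ c ∷ᵥ κ)))
        ≡⟨ sym (∑-map (allFin m) toℕ _) ⟩
      ∑ (map toℕ (allFin m)) (λ c → ∑ (colourings N (map toℕ (allFin m))) (λ κ → h (c ∷ᵥ κ)))
        ≡⟨ sym (∑-colourings-suc N (map toℕ (allFin m)) h) ⟩
      ∑ (colourings (suc N) (map toℕ (allFin m))) h ∎
      where open ≡-Reasoning

  proper≡properℕ : ∀ {N m} (ad : Fin N → Fin N → Bool) (κ : Vec (Fin m) N) → proper ad κ ≡ properℕ ad (mapᵥ toℕ κ)
  proper≡properℕ ad κ = bool-ext
    (λ e → and-allFin²⁻ _ λ i j → trans (cong₂ edge-ok (Vecₚ.lookup-map i toℕ κ) (Vecₚ.lookup-map j toℕ κ))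
                                        (and-allFin² _ e i j))
    (λ e → and-allFin²⁻ _ λ i j → trans (cong₂ edge-ok (sym (Vecₚ.lookup-map i toℕ κ)) (sym (Vecₚ.lookup-map j toℕ κ)))
                                        (and-allFin² _ e i j))
    where
    edge-ok : ∀ {i j} → ℕ → ℕ → Bool
    edge-ok {i} {j} a b = not (ad i j) ∨ not (a ≡ᵇ b)

  multiplicity : ∀ {N} → Vec ℕ N → ℕ → ℕ
  multiplicity []ᵥ y = 0
  multiplicity (x ∷ᵥ κ) y = ⟦ x ≡ᵇ y ⟧ + multiplicity κ y

  mult≡multiplicity : ∀ {N m} (κ : Vec (Fin m) N) c → mult κ c ≡ multiplicity (mapᵥ toℕ κ) (toℕ c)
  mult≡multiplicity {N} κ c = trans (length-filterᵇ (allFin N) _) (go κ)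
    where
    go : ∀ {N} (κ : Vec (Fin _) N) → ∑ (allFin N) (λ i → ⟦ lookup κ i ==ᶠ c ⟧) ≡ multiplicity (mapᵥ toℕ κ) (toℕ c)
    go []ᵥ = refl
    go (x ∷ᵥ κ) = trans (∑-allFin-suc (λ i → ⟦ lookup (x ∷ᵥ κ) i ==ᶠ c ⟧)) (cong (⟦ x ==ᶠ c ⟧ +_) (go κ))

  ¬occurs⇒multiplicity≡0 : ∀ {N} (κ : Vec ℕ N) y → occurs y κ ≡ false → multiplicity κ y ≡ 0
  ¬occurs⇒multiplicity≡0 []ᵥ y e = refl
  ¬occurs⇒multiplicity≡0 (x ∷ᵥ κ) y e rewrite ∨-falseˡ {x ≡ᵇ y} e = ¬occurs⇒multiplicity≡0 κ y (∨-falseʳ {x ≡ᵇ y} e)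

  occurs⇒multiplicity≢0 : ∀ {N} (κ : Vec ℕ N) y → occurs y κ ≡ true → multiplicity κ y ≢ 0
  occurs⇒multiplicity≢0 (x ∷ᵥ κ) y e with x ≡ᵇ y
  ... | true = λ ()
  ... | false = occurs⇒multiplicity≢0 κ y e

  multiplicity≤ : ∀ {N} (κ : Vec ℕ N) y → multiplicity κ y ≤ N
  multiplicity≤ []ᵥ y = z≤n
  multiplicity≤ (x ∷ᵥ κ) y = +-mono-≤ (⟦⟧≤1 (x ≡ᵇ y)) (multiplicity≤ κ y)

  elemℕ-upTo : ∀ x t → elemℕ x (upTo t) ≡ (x <ᵇ t)
  elemℕ-upTo x zero = refl
  elemℕ-upTo zero (suc t) = refl
  elemℕ-upTo (suc x) (suc t) rewrite sym (Listₚ.map-upTo suc t) = trans (elemℕ-map-suc (upTo t)) (elemℕ-upTo x t)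
    where
    elemℕ-map-suc : ∀ L → elemℕ (suc x) (map suc L) ≡ elemℕ x L
    elemℕ-map-suc [] = refl
    elemℕ-map-suc (a ∷ L) = cong ((x ≡ᵇ a) ∨_) (elemℕ-map-suc L)

  ∈-upTo⇒< : ∀ {i K} → i ∈ upTo K → i < K
  ∈-upTo⇒< {i} {K} i∈ = <ᵇ⇒<′ (trans (sym (elemℕ-upTo i K)) (∈⇒elemℕ i∈))

  filterᵇ-all : ∀ (p : ℕ → Bool) L → (∀ x → elemℕ x L ≡ true → p x ≡ true) → filterᵇ p L ≡ L
  filterᵇ-all p [] h = refl
  filterᵇ-all p (a ∷ L) h rewrite h a (cong (_∨ elemℕ a L) (≡ᵇ-refl a)) =
    cong (a ∷_) (filterᵇ-all p L (λ x x∈ → h x (∨-trueʳ (x ≡ᵇ a) x∈)))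

  filterᵇ-<-upTo : ∀ j m → j ≤ m → filterᵇ (_<ᵇ j) (upTo m) ≡ upTo j
  filterᵇ-<-upTo .zero zero z≤n = refl
  filterᵇ-<-upTo j (suc m) j≤1+m with j ≟ suc m
  ... | yes refl = filterᵇ-all _ (upTo (suc m)) (λ x x∈ → trans (sym (elemℕ-upTo x (suc m))) x∈)
  ... | no j≢1+m = begin
    filterᵇ (_<ᵇ j) (upTo (suc m))
      ≡⟨ cong (filterᵇ (_<ᵇ j)) (sym (Listₚ.upTo-∷ʳ m)) ⟩
    filterᵇ (_<ᵇ j) (upTo m ++ [ m ])
      ≡⟨ Listₚ.filter-++ (T? ∘ (_<ᵇ j)) (upTo m) [ m ] ⟩
    filterᵇ (_<ᵇ j) (upTo m) ++ filterᵇ (_<ᵇ j) [ m ]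
      ≡⟨ cong (filterᵇ (_<ᵇ j) (upTo m) ++_) drop-m ⟩
    filterᵇ (_<ᵇ j) (upTo m) ++ []
      ≡⟨ Listₚ.++-identityʳ _ ⟩
    filterᵇ (_<ᵇ j) (upTo m)
      ≡⟨ filterᵇ-<-upTo j m j≤m ⟩
    upTo j ∎
    where
    open ≡-Reasoning
    j≤m : j ≤ m
    j≤m = ≤-pred (≤∧≢⇒< j≤1+m j≢1+m)
    drop-m : filterᵇ (_<ᵇ j) [ m ] ≡ []
    drop-m rewrite ≮⇒<ᵇ-false {m} {j} (λ m<j → <-irrefl refl (<-≤-trans m<j j≤m)) = refl

  exactSupport : ℕ → (m : ℕ) → Vec ℕ m → Bool
  exactSupport j m w =
    and (map (λ c → if toℕ c <ᵇ j then not (lookup w c ≡ᵇ 0) else (lookup w c ≡ᵇ 0)) (allFin m))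

  usesExactly : ∀ {N} → ℕ → Vec ℕ N → Bool
  usesExactly j κ = allᵥ (_<ᵇ j) κ ∧ usesAll (upTo j) κ

  multiplicities : ∀ {N m} → Vec (Fin m) N → Vec ℕ m
  multiplicities κ = tabulate (mult κ)

  lookup-multiplicities : ∀ {N m} (κ : Vec (Fin m) N) c →
    lookup (multiplicities κ) c ≡ multiplicity (mapᵥ toℕ κ) (toℕ c)
  lookup-multiplicities κ c = trans (Vecₚ.lookup∘tabulate (mult κ) c) (mult≡multiplicity κ c)

  module _ {N m : ℕ} (j : ℕ) (j≤m : j ≤ m) (κ : Vec (Fin m) N) where

    private
      κ′ = mapᵥ toℕ κ
      μ = multiplicities κ
      supportOK : Fin m → Bool
      supportOK c = if toℕ c <ᵇ j then not (lookup μ c ≡ᵇ 0) else (lookup μ c ≡ᵇ 0)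

    exactSupport⇒usesExactly : exactSupport j m μ ≡ true → usesExactly j κ′ ≡ true
    exactSupport⇒usesExactly e = ∧-true (lookup⇒allᵥ _ κ′ below) (occurs⇒usesAll (upTo j) κ′ used)
      where
      ok : ∀ c → supportOK c ≡ true
      ok = and-allFin supportOK e
      below : ∀ i → (lookup κ′ i <ᵇ j) ≡ true
      below i with lookup κ′ i <ᵇ j in κi≮j
      ... | true = refl
      ... | false = ⊥-elim (occurs⇒multiplicity≢0 κ′ (toℕ c) c-occurs μc≡0)
        where
        c = lookup κ i
        κ′i≡c : lookup κ′ i ≡ toℕ c
        κ′i≡c = Vecₚ.lookup-map i toℕ κ
        c-occurs : occurs (toℕ c) κ′ ≡ true
        c-occurs = subst (λ z → occurs z κ′ ≡ true) κ′i≡c (occurs-lookup κ′ i)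
        μc≡0 : multiplicity κ′ (toℕ c) ≡ 0
        μc≡0 = trans (sym (lookup-multiplicities κ c))
                     (≡ᵇ⇒≡′ (trans (cong (λ b → if b then not (lookup μ c ≡ᵇ 0) else (lookup μ c ≡ᵇ 0))
                                         (sym (trans (cong (_<ᵇ j) (sym κ′i≡c)) κi≮j)))
                                   (ok c)))
      used : ∀ x → elemℕ x (upTo j) ≡ true → occurs x κ′ ≡ true
      used x x∈ with occurs x κ′ in x∉
      ... | true = refl
      ... | false = ⊥-elim (true≢false (trans (sym (ok c)) not-ok))
        where
        x<j : x < j
        x<j = <ᵇ⇒<′ (trans (sym (elemℕ-upTo x j)) x∈)
        c = fromℕ< (<-≤-trans x<j j≤m)
        c≡x : toℕ c ≡ x
        c≡x = Finₚ.toℕ-fromℕ< (<-≤-trans x<j j≤m)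
        μc≡0 : lookup μ c ≡ 0
        μc≡0 = trans (lookup-multiplicities κ c) (trans (cong (multiplicity κ′) c≡x) (¬occurs⇒multiplicity≡0 κ′ x x∉))
        not-ok : supportOK c ≡ false
        not-ok = trans (cong (λ b → if b then not (lookup μ c ≡ᵇ 0) else (lookup μ c ≡ᵇ 0))
                             (<⇒<ᵇ′ (subst (_< j) (sym c≡x) x<j)))
                       (cong (λ n → not (n ≡ᵇ 0)) μc≡0)

    usesExactly⇒exactSupport : usesExactly j κ′ ≡ true → exactSupport j m μ ≡ true
    usesExactly⇒exactSupport e = and-allFin⁻ supportOK ok
      where
      ok : ∀ c → supportOK c ≡ true
      ok c rewrite lookup-multiplicities κ c with toℕ c <ᵇ j in c<j
      ... | true with multiplicity κ′ (toℕ c) in μc≡0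
      ...   | zero = ⊥-elim (occurs⇒multiplicity≢0 κ′ (toℕ c)
                       (usesAll⇒occurs (upTo j) κ′ (∧-trueʳ {allᵥ (_<ᵇ j) κ′} e) (toℕ c)
                                       (trans (elemℕ-upTo (toℕ c) j) c<j)) μc≡0)
      ...   | suc _ = refl
      ok c | false with occurs (toℕ c) κ′ in c-occurs
      ...   | false rewrite ¬occurs⇒multiplicity≡0 κ′ (toℕ c) c-occurs = refl
      ...   | true with i , κi≡c ← occurs⇒lookup κ′ (toℕ c) c-occurs =
        ⊥-elim (true≢false (trans (sym (subst (λ z → (z <ᵇ j) ≡ true) κi≡c (allᵥ⇒lookup _ κ′ (∧-trueˡ e) i))) c<j))

    exactSupport≡usesExactly : exactSupport j m μ ≡ usesExactly j κ′
    exactSupport≡usesExactly = bool-ext exactSupport⇒usesExactly usesExactly⇒exactSupport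

  exponents : (m N j : ℕ) → List (Fin m → ℕ)
  exponents m N j = map lookup (filterᵇ (exactSupport j m) (colourings m (upTo (suc N))))

  multIs≡eqb : ∀ {N m} (κ : Vec (Fin m) N) (w : Vec ℕ m) → multIs κ (lookup w) ≡ eqb _≟ᵥ_ w (multiplicities κ)
  multIs≡eqb {N} {m} κ w = bool-ext
    (λ e → ≡⇒eqb _≟ᵥ_ (trans (sym (Vecₚ.tabulate∘lookup w))
                             (Vecₚ.tabulate-cong λ c → sym (≡ᵇ⇒≡′ (and-allFin (λ c → mult κ c ≡ᵇ lookup w c) e c)))))
    (λ e → and-allFin⁻ (λ c → mult κ c ≡ᵇ lookup w c) λ c →
      trans (cong (mult κ c ≡ᵇ_) (trans (cong (λ z → lookup z c) (eqb⇒≡ _≟ᵥ_ {w} {multiplicities κ} e))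
                                       (Vecₚ.lookup∘tabulate (mult κ) c)))
            (≡ᵇ-refl (mult κ c)))

  multiplicities-bounded : ∀ {N m} (κ : Vec (Fin m) N) → allᵥ (λ z → elemℕ z (upTo (suc N))) (multiplicities κ) ≡ true
  multiplicities-bounded {N} κ = lookup⇒allᵥ _ (multiplicities κ) λ c →
    trans (elemℕ-upTo (lookup (multiplicities κ) c) (suc N))
          (<⇒<ᵇ′ (s≤s (subst (_≤ N) (sym (lookup-multiplicities κ c)) (multiplicity≤ (mapᵥ toℕ κ) (toℕ c)))))

  ∑-coeffX-exponents : ∀ N m (ad : Fin N → Fin N → Bool) j → j ≤ m →
    ∑ (exponents m N j) (coeffX N m ad) ≡ ontoCount ad j
  ∑-coeffX-exponents N m ad j j≤m = begin
    ∑ (exponents m N j) (coeffX N m ad)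
      ≡⟨ ∑-map (filterᵇ S (colourings m U)) lookup (coeffX N m ad) ⟩
    ∑ (filterᵇ S (colourings m U)) (λ w → coeffX N m ad (lookup w))
      ≡⟨ ∑-filterᵇ (colourings m U) S _ ⟩
    ∑ (colourings m U) (λ w → ⟦ S w ⟧ * coeffX N m ad (lookup w))
      ≡⟨ ∑-ext (colourings m U) (λ w → trans (cong (⟦ S w ⟧ *_) (length-filterᵇ (allVecs N m) _))
           (trans (sym (∑-*ˡ (allVecs N m) ⟦ S w ⟧ _))
                  (∑-ext (allVecs N m) λ κ → trans (cong (λ b → ⟦ S w ⟧ * ⟦ proper ad κ ∧ b ⟧) (multIs≡eqb κ w))
                                                   (rearrange (S w) (proper ad κ) _)))) ⟩
    ∑ (colourings m U) (λ w → ∑ (allVecs N m) (λ κ → ⟦ proper ad κ ⟧ * (⟦ eqb _≟ᵥ_ w (multiplicities κ) ⟧ * ⟦ S w ⟧)))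
      ≡⟨ ∑-comm (colourings m U) (allVecs N m) _ ⟩
    ∑ (allVecs N m) (λ κ → ∑ (colourings m U) (λ w → ⟦ proper ad κ ⟧ * (⟦ eqb _≟ᵥ_ w (multiplicities κ) ⟧ * ⟦ S w ⟧)))
      ≡⟨ ∑-ext (allVecs N m) (λ κ → trans (∑-*ˡ (colourings m U) ⟦ proper ad κ ⟧ _)
           (cong (⟦ proper ad κ ⟧ *_) (trans (∑-select _≟ᵥ_ (colourings m U) _ enumU (multiplicities κ) (λ w → ⟦ S w ⟧))
             (trans (cong (λ b → ⟦ b ⟧ * ⟦ S (multiplicities κ) ⟧) (multiplicities-bounded κ)) (+-identityʳ _))))) ⟩
    ∑ (allVecs N m) (λ κ → ⟦ proper ad κ ⟧ * ⟦ S (multiplicities κ) ⟧)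
      ≡⟨ ∑-ext (allVecs N m) (λ κ → cong₂ (λ a b → ⟦ a ⟧ * ⟦ b ⟧) (proper≡properℕ ad κ)
                                                                  (exactSupport≡usesExactly j j≤m κ)) ⟩
    ∑ (allVecs N m) (λ κ → ⟦ properℕ ad (mapᵥ toℕ κ) ⟧ * ⟦ usesExactly j (mapᵥ toℕ κ) ⟧)
      ≡⟨ ∑-allVecs N m (λ κ′ → ⟦ properℕ ad κ′ ⟧ * ⟦ usesExactly j κ′ ⟧) ⟩
    ∑ (colourings N (upTo m)) (λ κ′ → ⟦ properℕ ad κ′ ⟧ * ⟦ usesExactly j κ′ ⟧)
      ≡⟨ ∑-ext (colourings N (upTo m)) (λ κ′ → rearrange′ (properℕ ad κ′) (allᵥ (_<ᵇ j) κ′) _) ⟩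
    ∑ (colourings N (upTo m)) (λ κ′ → ⟦ allᵥ (_<ᵇ j) κ′ ⟧ * ⟦ properℕ ad κ′ ∧ usesAll (upTo j) κ′ ⟧)
      ≡⟨ ∑-colourings-restrict N (upTo m) _ _ ⟩
    ∑ (colourings N (filterᵇ (_<ᵇ j) (upTo m))) (λ κ′ → ⟦ properℕ ad κ′ ∧ usesAll (upTo j) κ′ ⟧)
      ≡⟨ cong (λ L → ∑ (colourings N L) (λ κ′ → ⟦ properℕ ad κ′ ∧ usesAll (upTo j) κ′ ⟧)) (filterᵇ-<-upTo j m j≤m) ⟩
    ontoCount ad j ∎
    where
    open ≡-Reasoning
    U = upTo (suc N)
    S = exactSupport j m
    enumU : Enumerates _≟ᵥ_ (colourings m U) (allᵥ (λ z → elemℕ z U))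
    enumU = colourings-enumerates m U _ (Distinct-enumerates U (Distinct-upTo (suc N)))
    rearrange : ∀ s p e → ⟦ s ⟧ * ⟦ p ∧ e ⟧ ≡ ⟦ p ⟧ * (⟦ e ⟧ * ⟦ s ⟧)
    rearrange true true true = refl
    rearrange true true false = refl
    rearrange true false e = refl
    rearrange false true true = refl
    rearrange false true false = refl
    rearrange false false e = refl
    rearrange′ : ∀ p a u → ⟦ p ⟧ * ⟦ a ∧ u ⟧ ≡ ⟦ a ⟧ * ⟦ p ∧ u ⟧
    rearrange′ true true true = refl
    rearrange′ true true false = refl
    rearrange′ true false u = refl
    rearrange′ false true true = refl
    rearrange′ false true false = refl
    rearrange′ false false u = refl

  -- Path forests

  chainAdj : ∀ {N} → (ℕ → Bool) → Fin N → Fin N → Bool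
  chainAdj B i j = ((toℕ j ≡ᵇ suc (toℕ i)) ∧ B (toℕ i)) ∨ ((toℕ i ≡ᵇ suc (toℕ j)) ∧ B (toℕ j))

  chainProper : ∀ {N} → (ℕ → Bool) → ℕ → Vec ℕ N → Bool
  chainProper B o []ᵥ = true
  chainProper B o (d ∷ᵥ []ᵥ) = true
  chainProper B o (d ∷ᵥ e ∷ᵥ κ) = (not (B o) ∨ not (d ≡ᵇ e)) ∧ chainProper B (suc o) (e ∷ᵥ κ)

  ChainProper : ∀ {N} → (ℕ → Bool) → ℕ → Vec ℕ N → Set
  ChainProper {N} B o κ = ∀ (i j : Fin N) → toℕ j ≡ suc (toℕ i) → B (o + toℕ i) ≡ true → lookup κ i ≢ lookup κ j

  chainProper⇒ChainProper : ∀ {N} B o (κ : Vec ℕ N) → chainProper B o κ ≡ true → ChainProper B o κ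
  chainProper⇒ChainProper B o (d ∷ᵥ []ᵥ) e Fin.zero Fin.zero () b
  chainProper⇒ChainProper B o (d ∷ᵥ e′ ∷ᵥ κ) e Fin.zero (Fin.suc Fin.zero) _ b d≡e′ =
    true≢false (trans (sym (∧-trueˡ e)) clash)
    where
    clash : (not (B o) ∨ not (d ≡ᵇ e′)) ≡ false
    clash rewrite subst (λ z → B z ≡ true) (+-identityʳ o) b | d≡e′ | ≡ᵇ-refl e′ = refl
  chainProper⇒ChainProper B o (d ∷ᵥ e′ ∷ᵥ κ) e (Fin.suc i) (Fin.suc j) j≡1+i b =
    chainProper⇒ChainProper B (suc o) (e′ ∷ᵥ κ) (∧-trueʳ {not (B o) ∨ not (d ≡ᵇ e′)} e) i j (suc-injective j≡1+i)
      (subst (λ z → B z ≡ true) (+-suc o (toℕ i)) b)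

  ChainProper⇒chainProper : ∀ {N} B o (κ : Vec ℕ N) → ChainProper B o κ → chainProper B o κ ≡ true
  ChainProper⇒chainProper B o []ᵥ h = refl
  ChainProper⇒chainProper B o (d ∷ᵥ []ᵥ) h = refl
  ChainProper⇒chainProper B o (d ∷ᵥ e′ ∷ᵥ κ) h = ∧-true first
    (ChainProper⇒chainProper B (suc o) (e′ ∷ᵥ κ) λ i j j≡1+i b →
      h (Fin.suc i) (Fin.suc j) (cong suc j≡1+i) (subst (λ z → B z ≡ true) (sym (+-suc o (toℕ i))) b))
    where
    first : (not (B o) ∨ not (d ≡ᵇ e′)) ≡ true
    first with B o in Bo
    ... | false = refl
    ... | true rewrite ≢⇒≡ᵇ-false (h Fin.zero (Fin.suc Fin.zero) refl (subst (λ z → B z ≡ true) (sym (+-identityʳ o)) Bo)) = refl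

  properℕ-chainAdj : ∀ {N} B (κ : Vec ℕ N) → properℕ (chainAdj B) κ ≡ chainProper B 0 κ
  properℕ-chainAdj B κ = bool-ext
    (λ e → ChainProper⇒chainProper B 0 κ λ i j j≡1+i b → properℕ⇒Proper (chainAdj B) κ e i j (linked i j j≡1+i b))
    (λ e → Proper⇒properℕ (chainAdj B) κ λ i j a → cases i j (∨-true⇒⊎ a) (chainProper⇒ChainProper B 0 κ e))
    where
    linked : ∀ i j → toℕ j ≡ suc (toℕ i) → B (toℕ i) ≡ true → chainAdj B i j ≡ true
    linked i j j≡1+i b rewrite j≡1+i | ≡ᵇ-refl (suc (toℕ i)) | b = refl
    cases : ∀ i j → ((toℕ j ≡ᵇ suc (toℕ i)) ∧ B (toℕ i)) ≡ true ⊎ ((toℕ i ≡ᵇ suc (toℕ j)) ∧ B (toℕ j)) ≡ true →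
      ChainProper B 0 κ → lookup κ i ≢ lookup κ j
    cases i j (inj₁ x) c = c i j (≡ᵇ⇒≡′ (∧-trueˡ x)) (∧-trueʳ {toℕ j ≡ᵇ suc (toℕ i)} x)
    cases i j (inj₂ y) c = λ κi≡κj → c j i (≡ᵇ⇒≡′ (∧-trueˡ y)) (∧-trueʳ {toℕ i ≡ᵇ suc (toℕ j)} y) (sym κi≡κj)

  module ChainCount (t : ℕ) where

    linkWeight : Bool → ℕ
    linkWeight b = if b then t ∸ 1 else t

    linkProduct : (ℕ → Bool) → ℕ → ℕ → ℕ
    linkProduct B o zero = 1
    linkProduct B o (suc K) = linkWeight (B o) * linkProduct B (suc o) K

    ∑-next-colour : ∀ e → e < t → ∀ b → ∑ (upTo t) (λ d → ⟦ not b ∨ not (e ≡ᵇ d) ⟧) ≡ linkWeight b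
    ∑-next-colour e e<t false = trans (∑-1 (upTo t)) (Listₚ.length-upTo t)
    ∑-next-colour e e<t true = begin
      ∑ (upTo t) (λ d → ⟦ not (e ≡ᵇ d) ⟧)
        ≡⟨ sym (m+n∸n≡m _ 1) ⟩
      ∑ (upTo t) (λ d → ⟦ not (e ≡ᵇ d) ⟧) + 1 ∸ 1
        ≡⟨ cong (λ z → ∑ (upTo t) (λ d → ⟦ not (e ≡ᵇ d) ⟧) + z ∸ 1) (sym once) ⟩
      ∑ (upTo t) (λ d → ⟦ not (e ≡ᵇ d) ⟧) + ∑ (upTo t) (λ d → ⟦ e ≡ᵇ d ⟧) ∸ 1
        ≡⟨ cong (_∸ 1) (sym (∑-+ (upTo t) _ _)) ⟩
      ∑ (upTo t) (λ d → ⟦ not (e ≡ᵇ d) ⟧ + ⟦ e ≡ᵇ d ⟧) ∸ 1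
        ≡⟨ cong (_∸ 1) (trans (∑-ext (upTo t) (λ d → complement (e ≡ᵇ d))) (trans (∑-1 (upTo t)) (Listₚ.length-upTo t))) ⟩
      t ∸ 1 ∎
      where
      open ≡-Reasoning
      complement : ∀ b → ⟦ not b ⟧ + ⟦ b ⟧ ≡ 1
      complement true = refl
      complement false = refl
      once : ∑ (upTo t) (λ d → ⟦ e ≡ᵇ d ⟧) ≡ 1
      once = trans (∑-ext (upTo t) (λ d → cong ⟦_⟧ (≡ᵇ-sym e d)))
                   (trans (Distinct-enumerates (upTo t) (Distinct-upTo t) e)
                          (cong ⟦_⟧ (trans (elemℕ-upTo e t) (<⇒<ᵇ′ e<t))))

    ∑-chainProper-from : ∀ N B o e → e < t →
      ∑ (colourings N (upTo t)) (λ κ → ⟦ chainProper B o (e ∷ᵥ κ) ⟧) ≡ linkProduct B o N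
    ∑-chainProper-from zero B o e e<t = refl
    ∑-chainProper-from (suc N) B o e e<t = begin
      ∑ (colourings (suc N) (upTo t)) (λ κ → ⟦ chainProper B o (e ∷ᵥ κ) ⟧)
        ≡⟨ ∑-colourings-suc N (upTo t) _ ⟩
      ∑ (upTo t) (λ d → ∑ (colourings N (upTo t)) (λ κ → ⟦ (not (B o) ∨ not (e ≡ᵇ d)) ∧ chainProper B (suc o) (d ∷ᵥ κ) ⟧))
        ≡⟨ ∑-cong (upTo t) (λ d d∈ → trans (∑-ext (colourings N (upTo t)) (λ κ → ⟦∧⟧ (not (B o) ∨ not (e ≡ᵇ d)) _))
             (trans (∑-*ˡ (colourings N (upTo t)) ⟦ not (B o) ∨ not (e ≡ᵇ d) ⟧ _)
                    (cong (⟦ not (B o) ∨ not (e ≡ᵇ d) ⟧ *_) (∑-chainProper-from N B (suc o) d (∈-upTo⇒< d∈))))) ⟩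
      ∑ (upTo t) (λ d → ⟦ not (B o) ∨ not (e ≡ᵇ d) ⟧ * linkProduct B (suc o) N)
        ≡⟨ ∑-*ʳ (upTo t) _ _ ⟩
      ∑ (upTo t) (λ d → ⟦ not (B o) ∨ not (e ≡ᵇ d) ⟧) * linkProduct B (suc o) N
        ≡⟨ cong (_* linkProduct B (suc o) N) (∑-next-colour e e<t (B o)) ⟩
      linkProduct B o (suc N) ∎
      where open ≡-Reasoning

    ∑-chainProper : ∀ N B o → ∑ (colourings (suc N) (upTo t)) (λ κ → ⟦ chainProper B o κ ⟧) ≡ t * linkProduct B o N
    ∑-chainProper N B o =
      trans (∑-colourings-suc N (upTo t) _)
            (trans (∑-cong (upTo t) (λ e e∈ → ∑-chainProper-from N B o e (∈-upTo⇒< e∈)))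
                   (trans (∑-const (upTo t) (linkProduct B o N)) (cong (_* linkProduct B o N) (Listₚ.length-upTo t))))

    linkProduct-+ : ∀ B o a b → linkProduct B o (a + b) ≡ linkProduct B o a * linkProduct B (o + a) b
    linkProduct-+ B o zero b rewrite +-identityʳ o = sym (+-identityʳ _)
    linkProduct-+ B o (suc a) b rewrite linkProduct-+ B (suc o) a b | +-suc o a = sym (*-assoc (linkWeight (B o)) _ _)

    linkProduct-linked : ∀ B o K → (∀ k → k < K → B (o + k) ≡ true) → linkProduct B o K ≡ (t ∸ 1) ^ K
    linkProduct-linked B o zero h = refl
    linkProduct-linked B o (suc K) h rewrite subst (λ z → B z ≡ true) (+-identityʳ o) (h 0 (s≤s z≤n)) =
      cong ((t ∸ 1) *_) (linkProduct-linked B (suc o) K (λ k k<K → subst (λ z → B z ≡ true) (+-suc o k) (h (suc k) (s≤s k<K))))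

    linkProduct-cong : ∀ B B′ o K → (∀ k → k < K → B (o + k) ≡ B′ (o + k)) → linkProduct B o K ≡ linkProduct B′ o K
    linkProduct-cong B B′ o zero h = refl
    linkProduct-cong B B′ o (suc K) h rewrite subst (λ z → B z ≡ B′ z) (+-identityʳ o) (h 0 (s≤s z≤n)) =
      cong (linkWeight (B′ o) *_) (linkProduct-cong B B′ (suc o) K (λ k k<K → subst (λ z → B z ≡ B′ z) (+-suc o k) (h (suc k) (s≤s k<K))))

  AllPositive : List ℕ → Set
  AllPositive [] = ⊤
  AllPositive (zero ∷ ps) = ⊥
  AllPositive (suc p ∷ ps) = AllPositive ps

  length≤sum : ∀ λs → AllPositive λs → length λs ≤ sum λs
  length≤sum [] _ = z≤n
  length≤sum (suc p ∷ ps) pos = s≤s (≤-trans (length≤sum ps pos) (m≤n+m (sum ps) p))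

  elemℕ-prefixSums-< : ∀ x s ps → x < s → elemℕ x (prefixSums s ps) ≡ false
  elemℕ-prefixSums-< x s [] x<s = refl
  elemℕ-prefixSums-< x s (q ∷ qs) x<s = ∨-false (≢⇒≡ᵇ-false (λ x≡ → <-irrefl x≡ x<s+q)) (elemℕ-prefixSums-< x (s + q) qs x<s+q)
    where x<s+q = <-≤-trans x<s (m≤m+n s q)

  suc-+-< : ∀ s {k p} → k < p → suc (s + k) < s + suc p
  suc-+-< s {k} {p} k<p = subst (suc (s + k) <_) (sym (+-suc s p)) (s≤s (+-monoʳ-< s k<p))

  joined : ℕ → List ℕ → ℕ → Bool
  joined s λs i = not (elemℕ (suc i) (prefixSums s λs))

  module _ (t : ℕ) where
    open ChainCount t

    linkProduct-pathForest : ∀ s p ps → AllPositive ps →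
      t * linkProduct (joined s (suc p ∷ ps)) s (p + sum ps) ≡ t ^ suc (length ps) * (t ∸ 1) ^ (p + sum ps ∸ length ps)
    linkProduct-pathForest s p ps pos = begin
      t * linkProduct B s (p + sum ps)
        ≡⟨ cong (t *_) (linkProduct-+ B s p (sum ps)) ⟩
      t * (linkProduct B s p * linkProduct B (s + p) (sum ps))
        ≡⟨ cong (λ z → t * (z * linkProduct B (s + p) (sum ps))) (linkProduct-linked B s p inside-block) ⟩
      t * ((t ∸ 1) ^ p * linkProduct B (s + p) (sum ps))
        ≡⟨ later-blocks ps pos ⟩
      t ^ suc (length ps) * (t ∸ 1) ^ (p + sum ps ∸ length ps) ∎
      where
      open ≡-Reasoning
      B = joined s (suc p ∷ ps)
      inside-block : ∀ k → k < p → B (s + k) ≡ true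
      inside-block k k<p rewrite ≢⇒≡ᵇ-false {suc (s + k)} {s + suc p} (λ e → <-irrefl e (suc-+-< s k<p))
                               | elemℕ-prefixSums-< (suc (s + k)) (s + suc p) ps (suc-+-< s k<p) = refl
      later-blocks : ∀ ps → AllPositive ps →
        t * ((t ∸ 1) ^ p * linkProduct (joined s (suc p ∷ ps)) (s + p) (sum ps))
        ≡ t ^ suc (length ps) * (t ∸ 1) ^ (p + sum ps ∸ length ps)
      later-blocks [] _ rewrite +-identityʳ p | *-identityʳ ((t ∸ 1) ^ p) | *-identityʳ t = refl
      later-blocks (suc q ∷ qs) pos′ = begin
        t * ((t ∸ 1) ^ p * (linkWeight (B′ (s + p)) * linkProduct B′ (suc (s + p)) K))
          ≡⟨ cong (λ z → t * ((t ∸ 1) ^ p * (linkWeight z * linkProduct B′ (suc (s + p)) K))) block-end ⟩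
        t * ((t ∸ 1) ^ p * (t * linkProduct B′ (suc (s + p)) K))
          ≡⟨ cong (λ z → t * ((t ∸ 1) ^ p * (t * z)))
                  (trans (cong (λ o → linkProduct B′ o K) (sym (+-suc s p))) (linkProduct-cong B′ B″ (s + suc p) K shift)) ⟩
        t * ((t ∸ 1) ^ p * (t * linkProduct B″ (s + suc p) K))
          ≡⟨ cong (λ z → t * ((t ∸ 1) ^ p * z)) (linkProduct-pathForest (s + suc p) q qs pos′) ⟩
        t * ((t ∸ 1) ^ p * (t ^ suc ℓ * (t ∸ 1) ^ (K ∸ ℓ)))
          ≡⟨ solve 4 (λ T A X C → T :* (A :* (X :* C)) := T :* X :* (A :* C)) refl t ((t ∸ 1) ^ p) (t ^ suc ℓ) ((t ∸ 1) ^ (K ∸ ℓ)) ⟩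
        t * t ^ suc ℓ * ((t ∸ 1) ^ p * (t ∸ 1) ^ (K ∸ ℓ))
          ≡⟨ cong (t * t ^ suc ℓ *_) (sym (^-distribˡ-+-* (t ∸ 1) p (K ∸ ℓ))) ⟩
        t * t ^ suc ℓ * (t ∸ 1) ^ (p + (K ∸ ℓ))
          ≡⟨ cong (λ z → t * t ^ suc ℓ * (t ∸ 1) ^ z) (sym (trans (cong (_∸ suc ℓ) (+-suc p K)) (+-∸-assoc p ℓ≤K))) ⟩
        t ^ suc (suc ℓ) * (t ∸ 1) ^ (p + suc K ∸ suc ℓ) ∎
        where
        open +-*-Solver
        K = q + sum qs
        ℓ = length qs
        ℓ≤K : ℓ ≤ K
        ℓ≤K = ≤-trans (length≤sum qs pos′) (m≤n+m (sum qs) q)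
        B′ = joined s (suc p ∷ suc q ∷ qs)
        B″ = joined (s + suc p) (suc q ∷ qs)
        block-end : B′ (s + p) ≡ false
        block-end rewrite sym (+-suc s p) | ≡ᵇ-refl (s + suc p) = refl
        shift : ∀ k → k < K → B′ (s + suc p + k) ≡ B″ (s + suc p + k)
        shift k _ rewrite ≢⇒≡ᵇ-false {suc (s + suc p + k)} {s + suc p}
                            (λ e → <-irrefl (sym e) (s≤s (m≤m+n (s + suc p) k))) = refl

  χ-pathForest : ∀ λs → AllPositive λs → ∀ t → χ (pathAdj λs) t ≡ t ^ length λs * (t ∸ 1) ^ (sum λs ∸ length λs)
  χ-pathForest [] pos t = refl
  χ-pathForest (suc p ∷ ps) pos t = begin
    χ (pathAdj (suc p ∷ ps)) t
      ≡⟨ ∑-ext (colourings (suc (p + sum ps)) (upTo t)) (λ κ → cong ⟦_⟧ (properℕ-chainAdj B κ)) ⟩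
    ∑ (colourings (suc (p + sum ps)) (upTo t)) (λ κ → ⟦ chainProper B 0 κ ⟧)
      ≡⟨ ChainCount.∑-chainProper t (p + sum ps) B 0 ⟩
    t * ChainCount.linkProduct t B 0 (p + sum ps)
      ≡⟨ linkProduct-pathForest t 0 p ps pos ⟩
    t ^ suc (length ps) * (t ∸ 1) ^ (p + sum ps ∸ length ps) ∎
    where
    open ≡-Reasoning
    B = joined 0 (suc p ∷ ps)

  -- Gluing along a clique

  swap : ℕ → ℕ → ℕ → ℕ
  swap a b z = if z ≡ᵇ a then b else (if z ≡ᵇ b then a else z)

  swap-sends : ∀ a b → swap a b a ≡ b
  swap-sends a b rewrite ≡ᵇ-refl a = refl

  swap-sends⁻¹ : ∀ a b → b ≢ a → swap a b b ≡ a
  swap-sends⁻¹ a b b≢a rewrite ≢⇒≡ᵇ-false b≢a | ≡ᵇ-refl b = refl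

  swap-fixes : ∀ a b z → z ≢ a → z ≢ b → swap a b z ≡ z
  swap-fixes a b z z≢a z≢b rewrite ≢⇒≡ᵇ-false z≢a | ≢⇒≡ᵇ-false z≢b = refl

  swap-cases : ∀ a b z → swap a b z ≡ b ⊎ swap a b z ≡ a ⊎ swap a b z ≡ z
  swap-cases a b z with z ≡ᵇ a
  ... | true = inj₁ refl
  ... | false with z ≡ᵇ b
  ...   | true = inj₂ (inj₁ refl)
  ...   | false = inj₂ (inj₂ refl)

  swap-involutive : ∀ a b z → swap a b (swap a b z) ≡ z
  swap-involutive a b z with z ≡ᵇ a in z≡a
  ... | true with b ≡ᵇ a in b≡a
  ...   | true = trans (≡ᵇ⇒≡′ b≡a) (sym (≡ᵇ⇒≡′ z≡a))
  ...   | false rewrite ≡ᵇ-refl b = sym (≡ᵇ⇒≡′ z≡a)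
  swap-involutive a b z | false with z ≡ᵇ b in z≡b
  ... | true rewrite ≡ᵇ-refl a = sym (≡ᵇ⇒≡′ z≡b)
  ... | false rewrite z≡a | z≡b = refl

  swap-injective : ∀ a b {x y} → swap a b x ≡ swap a b y → x ≡ y
  swap-injective a b {x} {y} e = trans (sym (swap-involutive a b x)) (trans (cong (swap a b) e) (swap-involutive a b y))

  map-swap-involutive : ∀ {n} a b (κ : Vec ℕ n) → mapᵥ (swap a b) (mapᵥ (swap a b) κ) ≡ κ
  map-swap-involutive a b []ᵥ = refl
  map-swap-involutive a b (x ∷ᵥ κ) = cong₂ _∷ᵥ_ (swap-involutive a b x) (map-swap-involutive a b κ)

  Injectiveᵥ : ∀ {k} → Vec ℕ k → Set
  Injectiveᵥ {k} c = ∀ (i j : Fin k) → i ≢ j → lookup c i ≢ lookup c j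

  Within : ∀ {k} → (ℕ → Bool) → Vec ℕ k → Set
  Within V c = ∀ i → V (lookup c i) ≡ true

  Avoids : ∀ {k} → List ℕ → Vec ℕ k → Set
  Avoids S c = ∀ i → elemℕ (lookup c i) S ≡ false

  private
    ∉-∷⇒≢ : ∀ {a y} S → elemℕ a (y ∷ S) ≡ false → y ≢ a
    ∉-∷⇒≢ {a} S a∉ refl = true≢false (trans (sym (cong (_∨ elemℕ a S) (≡ᵇ-refl a))) a∉)

  -- S holds the colours already placed; swaps may only move colours outside S.
  swap-invariant⇒constant : ∀ k (V : ℕ → Bool) (S : List ℕ) (F : Vec ℕ k → ℕ) →
    (∀ a b (c : Vec ℕ k) → V a ≡ true → V b ≡ true → elemℕ a S ≡ false → elemℕ b S ≡ false →
       F (mapᵥ (swap a b) c) ≡ F c) →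
    ∀ c c′ → Within V c → Within V c′ → Injectiveᵥ c → Injectiveᵥ c′ → Avoids S c → Avoids S c′ → F c ≡ F c′
  swap-invariant⇒constant zero V S F inv []ᵥ []ᵥ _ _ _ _ _ _ = refl
  swap-invariant⇒constant (suc k) V S F inv (x ∷ᵥ cs) (y ∷ᵥ cs′) vc vc′ ic ic′ ac ac′ = begin
    F (x ∷ᵥ cs)
      ≡⟨ sym (inv x y (x ∷ᵥ cs) (vc Fin.zero) (vc′ Fin.zero) (ac Fin.zero) (ac′ Fin.zero)) ⟩
    F (swap x y x ∷ᵥ mapᵥ τ cs)
      ≡⟨ cong (λ z → F (z ∷ᵥ mapᵥ τ cs)) (swap-sends x y) ⟩
    F (y ∷ᵥ mapᵥ τ cs)
      ≡⟨ swap-invariant⇒constant k V (y ∷ S) (λ v → F (y ∷ᵥ v)) inv-tail (mapᵥ τ cs) cs′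
           vτ (λ i → vc′ (Fin.suc i)) iτ (λ i j i≢j → ic′ (Fin.suc i) (Fin.suc j) (λ e → i≢j (Finₚ.suc-injective e)))
           aτ ac′-tail ⟩
    F (y ∷ᵥ cs′) ∎
    where
    open ≡-Reasoning
    τ = swap x y
    inv-tail : ∀ a b (v : Vec ℕ k) → V a ≡ true → V b ≡ true → elemℕ a (y ∷ S) ≡ false → elemℕ b (y ∷ S) ≡ false →
      F (y ∷ᵥ mapᵥ (swap a b) v) ≡ F (y ∷ᵥ v)
    inv-tail a b v va vb a∉ b∉ =
      trans (cong (λ z → F (z ∷ᵥ mapᵥ (swap a b) v)) (sym (swap-fixes a b y (∉-∷⇒≢ S a∉) (∉-∷⇒≢ S b∉))))
            (inv a b (y ∷ᵥ v) va vb (∨-falseʳ {a ≡ᵇ y} a∉) (∨-falseʳ {b ≡ᵇ y} b∉))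
    lookup-τ : ∀ i → lookup (mapᵥ τ cs) i ≡ τ (lookup cs i)
    lookup-τ i = Vecₚ.lookup-map i τ cs
    vτ : Within V (mapᵥ τ cs)
    vτ i rewrite lookup-τ i with swap-cases x y (lookup cs i)
    ... | inj₁ e rewrite e = vc′ Fin.zero
    ... | inj₂ (inj₁ e) rewrite e = vc Fin.zero
    ... | inj₂ (inj₂ e) rewrite e = vc (Fin.suc i)
    iτ : Injectiveᵥ (mapᵥ τ cs)
    iτ i j i≢j e = ic (Fin.suc i) (Fin.suc j) (λ e′ → i≢j (Finₚ.suc-injective e′))
      (swap-injective x y (trans (sym (lookup-τ i)) (trans e (lookup-τ j))))
    τ-avoids : ∀ z → z ≢ x → elemℕ z S ≡ false → elemℕ (swap x y z) (y ∷ S) ≡ false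
    τ-avoids z z≢x z∉S with z ≟ y
    ... | yes refl rewrite swap-sends⁻¹ x z z≢x = ∨-false (≢⇒≡ᵇ-false (λ e → z≢x (sym e))) (ac Fin.zero)
    ... | no z≢y rewrite swap-fixes x y z z≢x z≢y = ∨-false (≢⇒≡ᵇ-false z≢y) z∉S
    aτ : Avoids (y ∷ S) (mapᵥ τ cs)
    aτ i rewrite lookup-τ i = τ-avoids (lookup cs i) (λ e → ic Fin.zero (Fin.suc i) (λ ()) (sym e)) (ac (Fin.suc i))
    ac′-tail : Avoids (y ∷ S) cs′
    ac′-tail i = ∨-false (≢⇒≡ᵇ-false (λ e → ic′ Fin.zero (Fin.suc i) (λ ()) (sym e))) (ac′ (Fin.suc i))

  restrict : ∀ {k n} → (Fin k → Fin n) → Vec ℕ n → Vec ℕ k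
  restrict φ κ = tabulate (λ i → lookup κ (φ i))

  lookup-restrict : ∀ {k n} (φ : Fin k → Fin n) κ i → lookup (restrict φ κ) i ≡ lookup κ (φ i)
  lookup-restrict φ κ i = Vecₚ.lookup∘tabulate _ i

  restrict-map : ∀ {k n} (φ : Fin k → Fin n) (σ : ℕ → ℕ) κ → restrict φ (mapᵥ σ κ) ≡ mapᵥ σ (restrict φ κ)
  restrict-map φ σ κ = trans (Vecₚ.tabulate-cong (λ i → Vecₚ.lookup-map (φ i) σ κ)) (Vecₚ.tabulate-∘ σ (λ i → lookup κ (φ i)))

  restrict-proper : ∀ {k n} (adK : Fin k → Fin k → Bool) (ad : Fin n → Fin n → Bool) (φ : Fin k → Fin n) →
    (∀ i j → adK i j ≡ true → ad (φ i) (φ j) ≡ true) →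
    ∀ κ → properℕ ad κ ≡ true → properℕ adK (restrict φ κ) ≡ true
  restrict-proper adK ad φ φ-edges κ e = Proper⇒properℕ adK (restrict φ κ) λ i j a κi≡κj →
    properℕ⇒Proper ad κ e (φ i) (φ j) (φ-edges i j a)
      (trans (sym (lookup-restrict φ κ i)) (trans κi≡κj (lookup-restrict φ κ j)))

  module Extensions (t : ℕ) where

    inPalette : ℕ → Bool
    inPalette z = elemℕ z (upTo t)

    colourings-enum : ∀ n → Enumerates _≟ᵥ_ (colourings n (upTo t)) (allᵥ inPalette)
    colourings-enum n = colourings-enumerates n (upTo t) inPalette (Distinct-enumerates (upTo t) (Distinct-upTo t))

    colourings-inPalette : ∀ {n} (κ : Vec ℕ n) → κ ∈ colourings n (upTo t) → allᵥ inPalette κ ≡ true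
    colourings-inPalette {n} = enumerated-valid _≟ᵥ_ (colourings n (upTo t)) (allᵥ inPalette) (colourings-enum n)

    restrict-inPalette : ∀ {k n} (φ : Fin k → Fin n) κ → allᵥ inPalette κ ≡ true → allᵥ inPalette (restrict φ κ) ≡ true
    restrict-inPalette φ κ κ∈ = lookup⇒allᵥ inPalette (restrict φ κ) λ i →
      trans (cong inPalette (lookup-restrict φ κ i)) (allᵥ⇒lookup inPalette κ κ∈ (φ i))

    extending : ∀ {k n} → (Fin n → Fin n → Bool) → (Fin k → Fin n) → Vec ℕ k → Vec ℕ n → Bool
    extending ad φ c κ = properℕ ad κ ∧ eqb _≟ᵥ_ (restrict φ κ) c

    extensions : ∀ {k n} → (Fin n → Fin n → Bool) → (Fin k → Fin n) → Vec ℕ k → ℕ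
    extensions {n = n} ad φ c = ∑ (colourings n (upTo t)) (λ κ → ⟦ extending ad φ c κ ⟧)

    χ-fibres : ∀ {k n} (adK : Fin k → Fin k → Bool) (ad : Fin n → Fin n → Bool) (φ : Fin k → Fin n) →
      (∀ κ → properℕ ad κ ≡ true → properℕ adK (restrict φ κ) ≡ true) →
      χ ad t ≡ ∑ (colourings k (upTo t)) (λ c → ⟦ properℕ adK c ⟧ * extensions ad φ c)
    χ-fibres {k} {n} adK ad φ restrict-proper′ = begin
      ∑ Cₙ (λ κ → ⟦ properℕ ad κ ⟧)
        ≡⟨ ∑-cong Cₙ (λ κ κ∈ → sym (trans (cong (⟦ properℕ ad κ ⟧ *_) (one-restriction κ κ∈)) (*-identityʳ _))) ⟩
      ∑ Cₙ (λ κ → ⟦ properℕ ad κ ⟧ * ∑ Cₖ (λ c → ⟦ eqb _≟ᵥ_ c (restrict φ κ) ⟧))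
        ≡⟨ ∑-ext Cₙ (λ κ → sym (∑-*ˡ Cₖ ⟦ properℕ ad κ ⟧ _)) ⟩
      ∑ Cₙ (λ κ → ∑ Cₖ (λ c → ⟦ properℕ ad κ ⟧ * ⟦ eqb _≟ᵥ_ c (restrict φ κ) ⟧))
        ≡⟨ ∑-comm Cₙ Cₖ _ ⟩
      ∑ Cₖ (λ c → ∑ Cₙ (λ κ → ⟦ properℕ ad κ ⟧ * ⟦ eqb _≟ᵥ_ c (restrict φ κ) ⟧))
        ≡⟨ ∑-ext Cₖ (λ c → trans (∑-ext Cₙ (regroup c)) (∑-*ˡ Cₙ ⟦ properℕ adK c ⟧ _)) ⟩
      ∑ Cₖ (λ c → ⟦ properℕ adK c ⟧ * extensions ad φ c) ∎
      where
      open ≡-Reasoning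
      Cₙ = colourings n (upTo t)
      Cₖ = colourings k (upTo t)
      one-restriction : ∀ κ → κ ∈ Cₙ → ∑ Cₖ (λ c → ⟦ eqb _≟ᵥ_ c (restrict φ κ) ⟧) ≡ 1
      one-restriction κ κ∈ = trans (colourings-enum k (restrict φ κ))
                                   (cong ⟦_⟧ (restrict-inPalette φ κ (colourings-inPalette κ κ∈)))
      regroup : ∀ c κ → ⟦ properℕ ad κ ⟧ * ⟦ eqb _≟ᵥ_ c (restrict φ κ) ⟧
                        ≡ ⟦ properℕ adK c ⟧ * ⟦ properℕ ad κ ∧ eqb _≟ᵥ_ (restrict φ κ) c ⟧
      regroup c κ rewrite eqb-sym _≟ᵥ_ c (restrict φ κ) with properℕ ad κ in κ-proper
      ... | false = sym (*-zeroʳ ⟦ properℕ adK c ⟧)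
      ... | true with eqb _≟ᵥ_ (restrict φ κ) c in κ↾≡c
      ...   | false = sym (*-zeroʳ ⟦ properℕ adK c ⟧)
      ...   | true = cong (λ b → ⟦ b ⟧ * 1) (sym (subst (λ c′ → properℕ adK c′ ≡ true)
                                                    (eqb⇒≡ _≟ᵥ_ {restrict φ κ} {c} κ↾≡c)
                                                    (restrict-proper′ κ κ-proper)))

    private
      swap-inPalette : ∀ a b z → inPalette a ≡ true → inPalette b ≡ true → inPalette z ≡ true → inPalette (swap a b z) ≡ true
      swap-inPalette a b z a∈ b∈ z∈ with swap-cases a b z
      ... | inj₁ e rewrite e = b∈
      ... | inj₂ (inj₁ e) rewrite e = a∈
      ... | inj₂ (inj₂ e) rewrite e = z∈

    extensions-swap : ∀ {k n} (ad : Fin n → Fin n → Bool) (φ : Fin k → Fin n) a b (c : Vec ℕ k) →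
      inPalette a ≡ true → inPalette b ≡ true → extensions ad φ (mapᵥ (swap a b) c) ≡ extensions ad φ c
    extensions-swap {k} {n} ad φ a b c a∈ b∈ = sym (count-bijection _≟ᵥ_ _≟ᵥ_ (colourings n (upTo t)) (colourings n (upTo t))
        (colourings-enum n) (colourings-enum n) bij)
      where
      τ = swap a b
      proper-τ : ∀ κ → properℕ ad (mapᵥ τ κ) ≡ properℕ ad κ
      proper-τ κ = properℕ-map ad τ κ (λ i j e → swap-injective a b e)
      τ-inPalette : ∀ κ → allᵥ inPalette κ ≡ true → allᵥ inPalette (mapᵥ τ κ) ≡ true
      τ-inPalette κ κ∈ = allᵥ-map τ κ (λ x x∈ → swap-inPalette a b x a∈ b∈ x∈) κ∈
      τ-extending : ∀ c′ κ → extending ad φ c′ κ ≡ true → extending ad φ (mapᵥ τ c′) (mapᵥ τ κ) ≡ true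
      τ-extending c′ κ e = ∧-true (trans (proper-τ κ) (∧-trueˡ e))
        (≡⇒eqb _≟ᵥ_ (trans (restrict-map φ τ κ) (cong (mapᵥ τ) (eqb⇒≡ _≟ᵥ_ (∧-trueʳ {properℕ ad κ} e)))))
      bij : Bijection (allᵥ inPalette) (allᵥ inPalette) (extending ad φ c) (extending ad φ (mapᵥ τ c))
      bij = record
        { to = mapᵥ τ
        ; from = mapᵥ τ
        ; to-valid = λ κ κ∈ _ → τ-inPalette κ κ∈
        ; to-pred = λ κ _ e → τ-extending c κ e
        ; from-valid = λ κ κ∈ _ → τ-inPalette κ κ∈
        ; from-pred = λ κ _ e → subst (λ c′ → extending ad φ c′ (mapᵥ τ κ) ≡ true)
                                      (map-swap-involutive a b c) (τ-extending (mapᵥ τ c) κ e)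
        ; to∘from = λ κ _ _ → map-swap-involutive a b κ
        ; from∘to = λ κ _ _ → map-swap-involutive a b κ
        }

    extensions-constant : ∀ {k n} (ad : Fin n → Fin n → Bool) (φ : Fin k → Fin n) (c c′ : Vec ℕ k) →
      allᵥ inPalette c ≡ true → allᵥ inPalette c′ ≡ true → Injectiveᵥ c → Injectiveᵥ c′ →
      extensions ad φ c ≡ extensions ad φ c′
    extensions-constant {k} ad φ c c′ c∈ c′∈ c-inj c′-inj =
      swap-invariant⇒constant k inPalette [] (extensions ad φ) (λ a b c₀ a∈ b∈ _ _ → extensions-swap ad φ a b c₀ a∈ b∈)
        c c′ (allᵥ⇒lookup inPalette c c∈) (allᵥ⇒lookup inPalette c′ c′∈) c-inj c′-inj (λ _ → refl) (λ _ → refl)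

  adjK : ∀ k → Fin k → Fin k → Bool
  adjK k = adj (completeGraph k)

  adjK⇒≢ : ∀ {k} (i j : Fin k) → adjK k i j ≡ true → i ≢ j
  adjK⇒≢ i .i e refl = true≢false (trans (sym e) (cong not (≡ᵇ-refl (toℕ i))))

  properK⇒Injectiveᵥ : ∀ {k} (c : Vec ℕ k) → properℕ (adjK k) c ≡ true → Injectiveᵥ c
  properK⇒Injectiveᵥ {k} c e i j i≢j =
    properℕ⇒Proper (adjK k) c e i j (cong not (≢⇒≡ᵇ-false (λ e → i≢j (Finₚ.toℕ-injective e))))

  clique-edges : ∀ {k n} (ad : Fin n → Fin n → Bool) (φ : Fin k → Fin n) →
    (∀ i j → i ≢ j → ad (φ i) (φ j) ≡ true) → ∀ i j → adjK k i j ≡ true → ad (φ i) (φ j) ≡ true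
  clique-edges ad φ adjacent i j e = adjacent i j (adjK⇒≢ i j e)

  module Gluing {G₁ G₂ : Graph} {k : ℕ} {u : Fin k → Fin (size G₁)} {v : Fin k → Fin (size G₂)}
    (cl₁ : IsClique G₁ k u) (cl₂ : IsClique G₂ k v)
    {H : Graph} {f₁ : Fin (size G₁) → Fin (size H)} {f₂ : Fin (size G₂) → Fin (size H)}
    (gl : IsGluing G₁ G₂ k u v H f₁ f₂) (t : ℕ) where

    open Extensions t
    open IsGluing gl renaming (inj₁ to f₁-injective; inj₂ to f₂-injective)

    private
      n₁ = size G₁
      n₂ = size G₂
      nH = size H
      w : Fin k → Fin nH
      w i = f₁ (u i)

    from-side : Vec ℕ n₁ → Vec ℕ n₂ → (z : Fin nH) → (∃ λ x → f₁ x ≡ z) ⊎ (∃ λ y → f₂ y ≡ z) → ℕ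
    from-side a b z (inj₁ (x , _)) = lookup a x
    from-side a b z (inj₂ (y , _)) = lookup b y

    glue : Vec ℕ n₁ → Vec ℕ n₂ → Vec ℕ nH
    glue a b = tabulate (λ z → from-side a b z (cover z))

    module _ (a : Vec ℕ n₁) (b : Vec ℕ n₂) (agree : restrict u a ≡ restrict v b) where

      glue-f₁ : ∀ x → lookup (glue a b) (f₁ x) ≡ lookup a x
      glue-f₁ x = trans (Vecₚ.lookup∘tabulate _ (f₁ x)) (side (cover (f₁ x)))
        where
        side : ∀ s → from-side a b (f₁ x) s ≡ lookup a x
        side (inj₁ (x′ , e)) = cong (lookup a) (f₁-injective e)
        side (inj₂ (y , e)) with onlyGlue x y (sym e)
        ... | i , refl , refl = trans (sym (lookup-restrict v b i))
                                      (trans (cong (λ z → lookup z i) (sym agree)) (lookup-restrict u a i))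

      glue-f₂ : ∀ y → lookup (glue a b) (f₂ y) ≡ lookup b y
      glue-f₂ y = trans (Vecₚ.lookup∘tabulate _ (f₂ y)) (side (cover (f₂ y)))
        where
        side : ∀ s → from-side a b (f₂ y) s ≡ lookup b y
        side (inj₂ (y′ , e)) = cong (lookup b) (f₂-injective e)
        side (inj₁ (x , e)) with onlyGlue x y e
        ... | i , refl , refl = trans (sym (lookup-restrict u a i))
                                      (trans (cong (λ z → lookup z i) agree) (lookup-restrict v b i))

      glue-proper : properℕ (adj G₁) a ≡ true → properℕ (adj G₂) b ≡ true → properℕ (adj H) (glue a b) ≡ true
      glue-proper a-proper b-proper = Proper⇒properℕ (adj H) (glue a b) λ z z′ e → edge z z′ (edges→ z z′ e)
        where
        edge : ∀ z z′ → (∃ λ x → ∃ λ y → f₁ x ≡ z × f₁ y ≡ z′ × adj G₁ x y ≡ true)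
                      ⊎ (∃ λ x → ∃ λ y → f₂ x ≡ z × f₂ y ≡ z′ × adj G₂ x y ≡ true) →
               lookup (glue a b) z ≢ lookup (glue a b) z′
        edge .(f₁ x) .(f₁ y) (inj₁ (x , y , refl , refl , xy)) eq =
          properℕ⇒Proper (adj G₁) a a-proper x y xy (trans (sym (glue-f₁ x)) (trans eq (glue-f₁ y)))
        edge .(f₂ x) .(f₂ y) (inj₂ (x , y , refl , refl , xy)) eq =
          properℕ⇒Proper (adj G₂) b b-proper x y xy (trans (sym (glue-f₂ x)) (trans eq (glue-f₂ y)))

      restrict-glue : restrict w (glue a b) ≡ restrict u a
      restrict-glue = Vecₚ.tabulate-cong λ i → glue-f₁ (u i)

      sides-glue : (restrict f₁ (glue a b) , restrict f₂ (glue a b)) ≡ (a , b)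
      sides-glue = cong₂ _,_ (trans (Vecₚ.tabulate-cong glue-f₁) (Vecₚ.tabulate∘lookup a))
                             (trans (Vecₚ.tabulate-cong glue-f₂) (Vecₚ.tabulate∘lookup b))

    glue-sides : ∀ κ → glue (restrict f₁ κ) (restrict f₂ κ) ≡ κ
    glue-sides κ = trans (Vecₚ.tabulate-cong (λ z → side z (cover z))) (Vecₚ.tabulate∘lookup κ)
      where
      side : ∀ z s → from-side (restrict f₁ κ) (restrict f₂ κ) z s ≡ lookup κ z
      side z (inj₁ (x , e)) = trans (lookup-restrict f₁ κ x) (cong (lookup κ) e)
      side z (inj₂ (y , e)) = trans (lookup-restrict f₂ κ y) (cong (lookup κ) e)

    restrict-side₁ : ∀ κ → restrict u (restrict f₁ κ) ≡ restrict w κ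
    restrict-side₁ κ = Vecₚ.tabulate-cong λ i → lookup-restrict f₁ κ (u i)

    restrict-side₂ : ∀ κ → restrict v (restrict f₂ κ) ≡ restrict w κ
    restrict-side₂ κ = Vecₚ.tabulate-cong λ i → trans (lookup-restrict f₂ κ (v i)) (cong (lookup κ) (sym (identify i)))

    glue-inPalette : ∀ a b → allᵥ inPalette a ≡ true → allᵥ inPalette b ≡ true → allᵥ inPalette (glue a b) ≡ true
    glue-inPalette a b a∈ b∈ = lookup⇒allᵥ inPalette (glue a b) λ z →
      trans (cong inPalette (Vecₚ.lookup∘tabulate (λ z → from-side a b z (cover z)) z)) (side z (cover z))
      where
      side : ∀ z s → inPalette (from-side a b z s) ≡ true
      side z (inj₁ (x , _)) = allᵥ⇒lookup inPalette a a∈ x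
      side z (inj₂ (y , _)) = allᵥ⇒lookup inPalette b b∈ y

    extensions-glue : ∀ c → extensions (adj H) w c ≡ extensions (adj G₁) u c * extensions (adj G₂) v c
    extensions-glue c =
      trans (count-bijection _≟ᵥ_ (_≟×_ _≟ᵥ_ _≟ᵥ_) (colourings nH (upTo t)) pairs (colourings-enum nH)
               (cartesianProduct-enumerates _≟ᵥ_ _≟ᵥ_ (colourings n₁ (upTo t)) (colourings n₂ (upTo t))
                  (colourings-enum n₁) (colourings-enum n₂))
               bij)
     (trans (∑-cartesianProduct (colourings n₁ (upTo t)) (colourings n₂ (upTo t)) _)
     (trans (∑-ext (colourings n₁ (upTo t)) (λ a → trans (∑-ext (colourings n₂ (upTo t)) (λ b → ⟦∧⟧ (ext₁ a) (ext₂ b)))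
                                                         (∑-*ˡ (colourings n₂ (upTo t)) ⟦ ext₁ a ⟧ _)))
            (∑-*ʳ (colourings n₁ (upTo t)) _ _)))
      where
      pairs = cartesianProduct (colourings n₁ (upTo t)) (colourings n₂ (upTo t))
      ext₁ = extending (adj G₁) u c
      ext₂ = extending (adj G₂) v c
      restricts : ∀ {n} {ad : Fin n → Fin n → Bool} {φ : Fin k → Fin n} κ → extending ad φ c κ ≡ true → restrict φ κ ≡ c
      restricts {ad = ad} {φ} κ e = eqb⇒≡ _≟ᵥ_ {restrict φ κ} {c} (∧-trueʳ {properℕ ad κ} e)
      bij : Bijection (allᵥ inPalette) (λ (a , b) → allᵥ inPalette a ∧ allᵥ inPalette b)
                      (extending (adj H) w c) (λ (a , b) → ext₁ a ∧ ext₂ b)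
      bij = record
        { to = λ κ → restrict f₁ κ , restrict f₂ κ
        ; from = λ (a , b) → glue a b
        ; to-valid = λ κ κ∈ _ → ∧-true (restrict-inPalette f₁ κ κ∈) (restrict-inPalette f₂ κ κ∈)
        ; to-pred = λ κ _ e → let κ-proper = ∧-trueˡ e ; κ↾ = restricts κ e in
            ∧-true (∧-true (restrict-proper (adj G₁) (adj H) f₁ edges₁ κ κ-proper) (≡⇒eqb _≟ᵥ_ (trans (restrict-side₁ κ) κ↾)))
                   (∧-true (restrict-proper (adj G₂) (adj H) f₂ edges₂ κ κ-proper) (≡⇒eqb _≟ᵥ_ (trans (restrict-side₂ κ) κ↾)))
        ; from-valid = λ (a , b) ab∈ _ → glue-inPalette a b (∧-trueˡ ab∈) (∧-trueʳ {allᵥ inPalette a} ab∈)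
        ; from-pred = λ (a , b) _ e → let ea = ∧-trueˡ e ; eb = ∧-trueʳ {ext₁ a} e
                                          agree = trans (restricts a ea) (sym (restricts b eb)) in
            ∧-true (glue-proper a b agree (∧-trueˡ ea) (∧-trueˡ eb)) (≡⇒eqb _≟ᵥ_ (trans (restrict-glue a b agree) (restricts a ea)))
        ; to∘from = λ (a , b) _ e → let ea = ∧-trueˡ e ; eb = ∧-trueʳ {ext₁ a} e in
            sides-glue a b (trans (restricts a ea) (sym (restricts b eb)))
        ; from∘to = λ κ _ _ → glue-sides κ
        }

    χ-gluing : χ (adj H) t * χ (adjK k) t ≡ χ (adj G₁) t * χ (adj G₂) t
    χ-gluing = begin
      χ (adj H) t * χ (adjK k) t
        ≡⟨ cong (_* χ (adjK k) t) fibresH ⟩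
      ∑ Cₖ (λ c → ⟦ K c ⟧ * Eₕ c) * ∑ Cₖ (λ c′ → ⟦ K c′ ⟧)
        ≡⟨ ∑-*-∑ Cₖ Cₖ _ _ ⟩
      ∑ Cₖ (λ c → ∑ Cₖ (λ c′ → (⟦ K c ⟧ * Eₕ c) * ⟦ K c′ ⟧))
        ≡⟨ ∑-cong Cₖ (λ c c∈ → ∑-cong Cₖ (λ c′ c′∈ →
             split c c′ (colourings-inPalette c c∈) (colourings-inPalette c′ c′∈))) ⟩
      ∑ Cₖ (λ c → ∑ Cₖ (λ c′ → (⟦ K c ⟧ * E₁ c) * (⟦ K c′ ⟧ * E₂ c′)))
        ≡⟨ sym (∑-*-∑ Cₖ Cₖ _ _) ⟩
      ∑ Cₖ (λ c → ⟦ K c ⟧ * E₁ c) * ∑ Cₖ (λ c′ → ⟦ K c′ ⟧ * E₂ c′)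
        ≡⟨ sym (cong₂ _*_ fibres₁ fibres₂) ⟩
      χ (adj G₁) t * χ (adj G₂) t ∎
      where
      open ≡-Reasoning
      Cₖ = colourings k (upTo t)
      K = properℕ (adjK k)
      E₁ = extensions (adj G₁) u
      E₂ = extensions (adj G₂) v
      Eₕ = extensions (adj H) w
      fibres₁ : χ (adj G₁) t ≡ ∑ Cₖ (λ c → ⟦ K c ⟧ * E₁ c)
      fibres₁ = χ-fibres (adjK k) (adj G₁) u
        (restrict-proper (adjK k) (adj G₁) u (clique-edges (adj G₁) u (IsClique.adjacent cl₁)))
      fibres₂ : χ (adj G₂) t ≡ ∑ Cₖ (λ c → ⟦ K c ⟧ * E₂ c)
      fibres₂ = χ-fibres (adjK k) (adj G₂) v
        (restrict-proper (adjK k) (adj G₂) v (clique-edges (adj G₂) v (IsClique.adjacent cl₂)))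
      fibresH : χ (adj H) t ≡ ∑ Cₖ (λ c → ⟦ K c ⟧ * Eₕ c)
      fibresH = χ-fibres (adjK k) (adj H) w
        (restrict-proper (adjK k) (adj H) w (clique-edges (adj H) w (λ i j i≢j → edges₁ (u i) (u j) (IsClique.adjacent cl₁ i j i≢j))))
      -- E₂ takes the same value on all proper colourings of the clique, so E₂ c may be traded for E₂ c′.
      split : ∀ c c′ → allᵥ inPalette c ≡ true → allᵥ inPalette c′ ≡ true →
        (⟦ K c ⟧ * Eₕ c) * ⟦ K c′ ⟧ ≡ (⟦ K c ⟧ * E₁ c) * (⟦ K c′ ⟧ * E₂ c′)
      split c c′ c∈ c′∈ rewrite extensions-glue c with K c in Kc | K c′ in Kc′
      ... | false | _ = refl
      ... | true | false rewrite *-zeroʳ (E₁ c * E₂ c + 0) | *-zeroʳ (E₁ c + 0) = refl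
      ... | true | true rewrite extensions-constant (adj G₂) v c c′ c∈ c′∈ (properK⇒Injectiveᵥ c Kc) (properK⇒Injectiveᵥ c′ Kc′) =
            solve 2 (λ X Y → (X :* Y :+ con 0) :* con 1 := (X :+ con 0) :* (Y :+ con 0)) refl (E₁ c) (E₂ c′)
        where open +-*-Solver

  ∑-allFin-eqb : ∀ N (z : Fin N) → ∑ (allFin N) (λ x → ⟦ eqb Finₚ._≟_ x z ⟧) ≡ 1
  ∑-allFin-eqb N z = ∑-eqb-unique Finₚ._≟_ (allFin N) (allFin⁺ N) (∈-allFin z)

  module _ {N M : ℕ} (h : Fin N → Fin M) where

    preimages : Fin M → ℕ
    preimages z = ∑ (allFin N) (λ x → ⟦ eqb Finₚ._≟_ (h x) z ⟧)

    preimages-image : Injective _≡_ _≡_ h → ∀ {x₀ z} → h x₀ ≡ z → preimages z ≡ 1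
    preimages-image h-injective {x₀} {z} hx₀≡z = trans (∑-ext (allFin N) only-x₀) (∑-allFin-eqb N x₀)
      where
      only-x₀ : ∀ x → ⟦ eqb Finₚ._≟_ (h x) z ⟧ ≡ ⟦ eqb Finₚ._≟_ x x₀ ⟧
      only-x₀ x with x Finₚ.≟ x₀
      ... | yes refl = cong ⟦_⟧ (≡⇒eqb Finₚ._≟_ hx₀≡z)
      ... | no x≢x₀ = cong ⟦_⟧ (≢⇒eqb Finₚ._≟_ (λ hx≡z → x≢x₀ (h-injective (trans hx≡z (sym hx₀≡z)))))

    preimages-∉ : ∀ {z} → (∀ x → h x ≢ z) → preimages z ≡ 0
    preimages-∉ z∉ = ∑-zero (allFin N) (λ x _ → cong ⟦_⟧ (≢⇒eqb Finₚ._≟_ (z∉ x)))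

    ∑-preimages : ∑ (allFin M) preimages ≡ N
    ∑-preimages = trans (∑-comm (allFin M) (allFin N) _)
      (trans (∑-ext (allFin N) (λ x → trans (∑-ext (allFin M) (λ z → cong ⟦_⟧ (eqb-sym Finₚ._≟_ (h x) z))) (∑-allFin-eqb M (h x))))
             (trans (∑-1 (allFin N)) (Listₚ.length-tabulate (λ i → i))))

  size-gluing : ∀ {G₁ G₂ : Graph} {k : ℕ} {u : Fin k → Fin (size G₁)} {v : Fin k → Fin (size G₂)} →
    IsClique G₁ k u → {H : Graph} {f₁ : Fin (size G₁) → Fin (size H)} {f₂ : Fin (size G₂) → Fin (size H)} →
    IsGluing G₁ G₂ k u v H f₁ f₂ → size H + k ≡ size G₁ + size G₂
  size-gluing {G₁} {G₂} {k} {u} {v} cl₁ {H} {f₁} {f₂} gl = begin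
    size H + k
      ≡⟨ sym (cong₂ _+_ (trans (∑-1 (allFin (size H))) (Listₚ.length-tabulate (λ i → i))) (∑-preimages w)) ⟩
    ∑ (allFin (size H)) (λ _ → 1) + ∑ (allFin (size H)) (preimages w)
      ≡⟨ sym (∑-+ (allFin (size H)) _ _) ⟩
    ∑ (allFin (size H)) (λ z → 1 + preimages w z)
      ≡⟨ sym (∑-ext (allFin (size H)) inclusion–exclusion) ⟩
    ∑ (allFin (size H)) (λ z → preimages f₁ z + preimages f₂ z)
      ≡⟨ ∑-+ (allFin (size H)) _ _ ⟩
    ∑ (allFin (size H)) (preimages f₁) + ∑ (allFin (size H)) (preimages f₂)
      ≡⟨ cong₂ _+_ (∑-preimages f₁) (∑-preimages f₂) ⟩
    size G₁ + size G₂ ∎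
    where
    open ≡-Reasoning
    open IsGluing gl renaming (inj₁ to f₁-injective; inj₂ to f₂-injective)
    w : Fin k → Fin (size H)
    w i = f₁ (u i)
    w-injective : Injective _≡_ _≡_ w
    w-injective e = IsClique.inj cl₁ (f₁-injective e)
    inclusion–exclusion : ∀ z → preimages f₁ z + preimages f₂ z ≡ 1 + preimages w z
    inclusion–exclusion z with cover z
    ... | inj₁ (x₀ , f₁x₀≡z) with Finₚ.any? (λ y → f₂ y Finₚ.≟ z)
    ...   | yes (y₀ , f₂y₀≡z) with onlyGlue x₀ y₀ (trans f₁x₀≡z (sym f₂y₀≡z))
    ...     | i , refl , refl rewrite preimages-image f₁ f₁-injective f₁x₀≡z | preimages-image f₂ f₂-injective f₂y₀≡z
                                    | preimages-image w w-injective {i} f₁x₀≡z = refl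
    inclusion–exclusion z | inj₁ (x₀ , f₁x₀≡z) | no z∉f₂
      rewrite preimages-image f₁ f₁-injective f₁x₀≡z | preimages-∉ f₂ (λ y e → z∉f₂ (y , e))
            | preimages-∉ w (λ i e → z∉f₂ (v i , trans (sym (identify i)) e)) = refl
    inclusion–exclusion z | inj₂ (y₀ , f₂y₀≡z) with Finₚ.any? (λ x → f₁ x Finₚ.≟ z)
    ...   | yes (x₀ , f₁x₀≡z) with onlyGlue x₀ y₀ (trans f₁x₀≡z (sym f₂y₀≡z))
    ...     | i , refl , refl rewrite preimages-image f₁ f₁-injective f₁x₀≡z | preimages-image f₂ f₂-injective f₂y₀≡z
                                    | preimages-image w w-injective {i} f₁x₀≡z = refl
    inclusion–exclusion z | inj₂ (y₀ , f₂y₀≡z) | no z∉f₁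
      rewrite preimages-∉ f₁ (λ x e → z∉f₁ (x , e)) | preimages-image f₂ f₂-injective f₂y₀≡z
            | preimages-∉ w (λ i e → z∉f₁ (u i , e)) = refl

module Polynomials where

  open import Data.Nat as ℕ using (_≤_; _<_; z≤n; s≤s; _∸_)
  import Data.Nat.Properties as ℕₚ
  import Data.Nat.Coprimality as Coprimality
  import Data.Integer as ℤ
  import Data.Integer.Properties as ℤₚ
  open import Data.Rational using (ℚ; mkℚ; 0ℚ; 1ℚ; _+_; _*_; _-_; -_; 1/_; NonZero; ≢-nonZero; toℚᵘ; ↥_)
  import Data.List.Relation.Unary.Unique.Propositional.Properties as Uniqueₚ
  open import Data.Rational.Properties
  import Data.Rational.Unnormalised as ℚᵘ
  import Data.Rational.Unnormalised.Properties as ℚᵘₚ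
  open import Data.Rational.Solver using (module +-*-Solver)
  open import Algebra.Bundles using (CommutativeRing)
  open import Algebra.Properties.CommutativeSemiring.Exp (CommutativeRing.commutativeSemiring +-*-commutativeRing)
    using (_^_; ^-homo-*; ^-distrib-*) public
  open +-*-Solver
  open Colourings using (∑)

  ℕtoℚ≡mkℚ : ∀ n → ℕtoℚ n ≡ mkℚ (ℤ.+ n) 0 (Coprimality.sym (Coprimality.1-coprimeTo n))
  ℕtoℚ≡mkℚ n = normalize-coprime (Coprimality.sym (Coprimality.1-coprimeTo n))

  toℚᵘ-ℕtoℚ : ∀ n → toℚᵘ (ℕtoℚ n) ≡ ℚᵘ.mkℚᵘ (ℤ.+ n) 0
  toℚᵘ-ℕtoℚ n = cong toℚᵘ (ℕtoℚ≡mkℚ n)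

  ℕtoℚ-+ : ∀ a b → ℕtoℚ (a ℕ.+ b) ≡ ℕtoℚ a + ℕtoℚ b
  ℕtoℚ-+ a b = toℚᵘ-injective (begin
    toℚᵘ (ℕtoℚ (a ℕ.+ b))                    ≈⟨ ℚᵘₚ.≃-reflexive (toℚᵘ-ℕtoℚ (a ℕ.+ b)) ⟩
    ℚᵘ.mkℚᵘ (ℤ.+ (a ℕ.+ b)) 0                 ≈⟨ ℚᵘ.*≡* (trans (ℤₚ.*-identityʳ _) (trans (ℤₚ.pos-+ a b)
                                                  (sym (trans (ℤₚ.*-identityʳ _)
                                                       (cong₂ ℤ._+_ (ℤₚ.*-identityʳ (ℤ.+ a)) (ℤₚ.*-identityʳ (ℤ.+ b))))))) ⟩
    ℚᵘ.mkℚᵘ (ℤ.+ a) 0 ℚᵘ.+ ℚᵘ.mkℚᵘ (ℤ.+ b) 0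
      ≈⟨ ℚᵘₚ.≃-reflexive (sym (cong₂ ℚᵘ._+_ (toℚᵘ-ℕtoℚ a) (toℚᵘ-ℕtoℚ b))) ⟩
    toℚᵘ (ℕtoℚ a) ℚᵘ.+ toℚᵘ (ℕtoℚ b)          ≈⟨ ℚᵘₚ.≃-sym (toℚᵘ-homo-+ (ℕtoℚ a) (ℕtoℚ b)) ⟩
    toℚᵘ (ℕtoℚ a + ℕtoℚ b)                   ∎)
    where open ℚᵘₚ.≃-Reasoning

  ℕtoℚ-* : ∀ a b → ℕtoℚ (a ℕ.* b) ≡ ℕtoℚ a * ℕtoℚ b
  ℕtoℚ-* a b = toℚᵘ-injective (begin
    toℚᵘ (ℕtoℚ (a ℕ.* b))                    ≈⟨ ℚᵘₚ.≃-reflexive (toℚᵘ-ℕtoℚ (a ℕ.* b)) ⟩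
    ℚᵘ.mkℚᵘ (ℤ.+ (a ℕ.* b)) 0                 ≈⟨ ℚᵘ.*≡* (cong (ℤ._* ℤ.+ 1) (ℤₚ.pos-* a b)) ⟩
    ℚᵘ.mkℚᵘ (ℤ.+ a) 0 ℚᵘ.* ℚᵘ.mkℚᵘ (ℤ.+ b) 0
      ≈⟨ ℚᵘₚ.≃-reflexive (sym (cong₂ ℚᵘ._*_ (toℚᵘ-ℕtoℚ a) (toℚᵘ-ℕtoℚ b))) ⟩
    toℚᵘ (ℕtoℚ a) ℚᵘ.* toℚᵘ (ℕtoℚ b)          ≈⟨ ℚᵘₚ.≃-sym (toℚᵘ-homo-* (ℕtoℚ a) (ℕtoℚ b)) ⟩
    toℚᵘ (ℕtoℚ a * ℕtoℚ b)                   ∎)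
    where open ℚᵘₚ.≃-Reasoning

  ℕtoℚ-^ : ∀ a n → ℕtoℚ (a ℕ.^ n) ≡ ℕtoℚ a ^ n
  ℕtoℚ-^ a zero = refl
  ℕtoℚ-^ a (suc n) = trans (ℕtoℚ-* a (a ℕ.^ n)) (cong (ℕtoℚ a *_) (ℕtoℚ-^ a n))

  ℕtoℚ-injective : ∀ {a b} → ℕtoℚ a ≡ ℕtoℚ b → a ≡ b
  ℕtoℚ-injective {a} {b} e = ℤₚ.+-injective (cong ↥_ (trans (sym (ℕtoℚ≡mkℚ a)) (trans e (ℕtoℚ≡mkℚ b))))

  *-cancelˡ-≡ : ∀ x {a b} → x ≢ 0ℚ → x * a ≡ x * b → a ≡ b
  *-cancelˡ-≡ x {a} {b} x≢0 e = begin
    a                 ≡⟨ solve 1 (λ a → a := con 1ℚ :* a) refl a ⟩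
    1ℚ * a            ≡⟨ cong (_* a) (sym (*-inverseˡ x)) ⟩
    (1/ x) * x * a    ≡⟨ *-assoc (1/ x) x a ⟩
    (1/ x) * (x * a)  ≡⟨ cong ((1/ x) *_) e ⟩
    (1/ x) * (x * b)  ≡⟨ sym (*-assoc (1/ x) x b) ⟩
    (1/ x) * x * b    ≡⟨ cong (_* b) (*-inverseˡ x) ⟩
    1ℚ * b            ≡⟨ *-identityˡ b ⟩
    b                 ∎
    where
    open ≡-Reasoning
    instance
      x-nonZero : NonZero x
      x-nonZero = ≢-nonZero x≢0

  ∑ℚ : {A : Set} → List A → (A → ℚ) → ℚ
  ∑ℚ xs f = sumℚ (map f xs)

  module _ {A : Set} where

    ∑ℚ-cong : (xs : List A) {f g : A → ℚ} → (∀ x → x ∈ xs → f x ≡ g x) → ∑ℚ xs f ≡ ∑ℚ xs g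
    ∑ℚ-cong [] h = refl
    ∑ℚ-cong (x ∷ xs) h = cong₂ _+_ (h x (here refl)) (∑ℚ-cong xs (λ y m → h y (there m)))

    ∑ℚ-ext : (xs : List A) {f g : A → ℚ} → (∀ x → f x ≡ g x) → ∑ℚ xs f ≡ ∑ℚ xs g
    ∑ℚ-ext xs h = ∑ℚ-cong xs (λ x _ → h x)

    ∑ℚ-zero : (xs : List A) {f : A → ℚ} → (∀ x → x ∈ xs → f x ≡ 0ℚ) → ∑ℚ xs f ≡ 0ℚ
    ∑ℚ-zero [] h = refl
    ∑ℚ-zero (x ∷ xs) h = trans (cong₂ _+_ (h x (here refl)) (∑ℚ-zero xs (λ y m → h y (there m)))) (+-identityˡ 0ℚ)

    ∑ℚ-+ : (xs : List A) (f g : A → ℚ) → ∑ℚ xs (λ x → f x + g x) ≡ ∑ℚ xs f + ∑ℚ xs g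
    ∑ℚ-+ [] f g = sym (+-identityˡ 0ℚ)
    ∑ℚ-+ (x ∷ xs) f g = trans (cong (f x + g x +_) (∑ℚ-+ xs f g))
      (solve 4 (λ a b c d → (a :+ b) :+ (c :+ d) := (a :+ c) :+ (b :+ d)) refl (f x) (g x) (∑ℚ xs f) (∑ℚ xs g))

    ∑ℚ-*ˡ : (xs : List A) (c : ℚ) (f : A → ℚ) → ∑ℚ xs (λ x → c * f x) ≡ c * ∑ℚ xs f
    ∑ℚ-*ˡ [] c f = sym (*-zeroʳ c)
    ∑ℚ-*ˡ (x ∷ xs) c f = trans (cong (c * f x +_) (∑ℚ-*ˡ xs c f)) (sym (*-distribˡ-+ c (f x) (∑ℚ xs f)))

    ∑ℚ-*ʳ : (xs : List A) (c : ℚ) (f : A → ℚ) → ∑ℚ xs (λ x → f x * c) ≡ ∑ℚ xs f * c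
    ∑ℚ-*ʳ xs c f = trans (∑ℚ-ext xs (λ x → *-comm (f x) c)) (trans (∑ℚ-*ˡ xs c f) (*-comm c _))

    ∑ℚ-++ : (xs ys : List A) (f : A → ℚ) → ∑ℚ (xs ++ ys) f ≡ ∑ℚ xs f + ∑ℚ ys f
    ∑ℚ-++ [] ys f = sym (+-identityˡ _)
    ∑ℚ-++ (x ∷ xs) ys f = trans (cong (f x +_) (∑ℚ-++ xs ys f)) (sym (+-assoc (f x) (∑ℚ xs f) (∑ℚ ys f)))

    ∑ℚ-filterᵇ : (xs : List A) (p : A → Bool) (f : A → ℚ) → ∑ℚ (filterᵇ p xs) f ≡ ∑ℚ xs (λ x → if p x then f x else 0ℚ)
    ∑ℚ-filterᵇ [] p f = refl
    ∑ℚ-filterᵇ (x ∷ xs) p f with p x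
    ... | true = cong (f x +_) (∑ℚ-filterᵇ xs p f)
    ... | false = trans (∑ℚ-filterᵇ xs p f) (sym (+-identityˡ _))

    ℕtoℚ-∑ : (xs : List A) (f : A → ℕ) → ℕtoℚ (∑ xs f) ≡ ∑ℚ xs (λ x → ℕtoℚ (f x))
    ℕtoℚ-∑ [] f = refl
    ℕtoℚ-∑ (x ∷ xs) f = trans (ℕtoℚ-+ (f x) (∑ xs f)) (cong (ℕtoℚ (f x) +_) (ℕtoℚ-∑ xs f))

  ∑ℚ-comm : {A B : Set} (xs : List A) (ys : List B) (h : A → B → ℚ) →
    ∑ℚ xs (λ x → ∑ℚ ys (h x)) ≡ ∑ℚ ys (λ y → ∑ℚ xs (λ x → h x y))
  ∑ℚ-comm [] ys h = sym (∑ℚ-zero ys (λ _ _ → refl))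
  ∑ℚ-comm (x ∷ xs) ys h = trans (cong (∑ℚ ys (h x) +_) (∑ℚ-comm xs ys h)) (sym (∑ℚ-+ ys (h x) _))

  ∑ℚ-map : {A B : Set} (xs : List A) (g : A → B) (f : B → ℚ) → ∑ℚ (map g xs) f ≡ ∑ℚ xs (λ x → f (g x))
  ∑ℚ-map xs g f = cong sumℚ (sym (Listₚ.map-∘ xs))

  DegreeAtMost : ℕ → (ℕ → ℚ) → Set
  DegreeAtMost n p = ∀ i → n < i → p i ≡ 0ℚ

  eval : (ℕ → ℚ) → ℕ → ℚ → ℚ
  eval c zero x = 0ℚ
  eval c (suc L) x = c 0 + x * eval (λ i → c (suc i)) L x

  eval-cong : ∀ L {f g : ℕ → ℚ} x → (∀ i → f i ≡ g i) → eval f L x ≡ eval g L x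
  eval-cong zero x h = refl
  eval-cong (suc L) x h = cong₂ (λ a b → a + x * b) (h 0) (eval-cong L x (λ i → h (suc i)))

  eval-zero : ∀ L (f : ℕ → ℚ) x → (∀ i → f i ≡ 0ℚ) → eval f L x ≡ 0ℚ
  eval-zero zero f x h = refl
  eval-zero (suc L) f x h rewrite h 0 | eval-zero L (λ i → f (suc i)) x (λ i → h (suc i)) | *-zeroʳ x = refl

  eval-pad : ∀ L d (f : ℕ → ℚ) x → (∀ i → L ≤ i → f i ≡ 0ℚ) → eval f (L ℕ.+ d) x ≡ eval f L x
  eval-pad zero d f x h = eval-zero d f x (λ i → h i z≤n)
  eval-pad (suc L) d f x h = cong (λ z → f 0 + x * z) (eval-pad L d (λ i → f (suc i)) x (λ i L≤i → h (suc i) (s≤s L≤i)))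

  eval-linear : ∀ L (a b : ℚ) (f g : ℕ → ℚ) x → eval (λ i → a * f i + b * g i) L x ≡ a * eval f L x + b * eval g L x
  eval-linear zero a b f g x = solve 2 (λ a b → con 0ℚ := a :* con 0ℚ :+ b :* con 0ℚ) refl a b
  eval-linear (suc L) a b f g x rewrite eval-linear L a b (λ i → f (suc i)) (λ i → g (suc i)) x =
    solve 7 (λ a b f0 g0 x F G → a :* f0 :+ b :* g0 :+ x :* (a :* F :+ b :* G) := a :* (f0 :+ x :* F) :+ b :* (g0 :+ x :* G))
      refl a b (f 0) (g 0) x (eval (λ i → f (suc i)) L x) (eval (λ i → g (suc i)) L x)

  eval-∑ : ∀ L c x → eval c L x ≡ ∑ℚ (upTo L) (λ j → c j * x ^ j)
  eval-∑ zero c x = refl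
  eval-∑ (suc L) c x = begin
    c 0 + x * eval (λ i → c (suc i)) L x
      ≡⟨ cong (λ z → c 0 + x * z) (eval-∑ L (λ i → c (suc i)) x) ⟩
    c 0 + x * ∑ℚ (upTo L) (λ j → c (suc j) * x ^ j)
      ≡⟨ cong₂ _+_ (sym (*-identityʳ (c 0))) (sym (∑ℚ-*ˡ (upTo L) x _)) ⟩
    c 0 * 1ℚ + ∑ℚ (upTo L) (λ j → x * (c (suc j) * x ^ j))
      ≡⟨ cong (c 0 * 1ℚ +_) (∑ℚ-ext (upTo L) (λ j → solve 3 (λ x a b → x :* (a :* b) := a :* (x :* b)) refl x (c (suc j)) (x ^ j))) ⟩
    c 0 * 1ℚ + ∑ℚ (upTo L) (λ j → c (suc j) * x ^ suc j)
      ≡⟨ cong (c 0 * 1ℚ +_) (sym (∑ℚ-map (upTo L) suc (λ j → c j * x ^ j))) ⟩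
    c 0 * 1ℚ + ∑ℚ (map suc (upTo L)) (λ j → c j * x ^ j)
      ≡⟨ cong (λ l → c 0 * 1ℚ + ∑ℚ l (λ j → c j * x ^ j)) (Listₚ.map-upTo suc L) ⟩
    ∑ℚ (upTo (suc L)) (λ j → c j * x ^ j) ∎
    where open ≡-Reasoning

  polyMul-suc : ∀ p q j → polyMul p q (suc j) ≡ p 0 * q (suc j) + polyMul (λ i → p (suc i)) q j
  polyMul-suc p q j = cong (p 0 * q (suc j) +_)
    (cong sumℚ (trans (Listₚ.map-applyUpTo suc (λ i → p i * q (suc j ∸ i)) (suc j))
                      (sym (Listₚ.map-upTo (λ i → p (suc i) * q (j ∸ i)) (suc j)))))

  eval-polyMul-suc : ∀ L p q x →
    eval (polyMul p q) (suc L) x ≡ p 0 * eval q (suc L) x + x * eval (polyMul (λ i → p (suc i)) q) L x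
  eval-polyMul-suc L p q x = begin
    polyMul p q 0 + x * eval (λ i → polyMul p q (suc i)) L x
      ≡⟨ cong₂ (λ a b → a + x * b) (+-identityʳ (p 0 * q 0))
               (eval-cong L x (λ i → trans (polyMul-suc p q i) (cong (p 0 * q (suc i) +_) (sym (*-identityˡ _))))) ⟩
    p 0 * q 0 + x * eval (λ i → p 0 * q (suc i) + 1ℚ * polyMul p′ q i) L x
      ≡⟨ cong (λ z → p 0 * q 0 + x * z) (eval-linear L (p 0) 1ℚ (λ i → q (suc i)) (polyMul p′ q) x) ⟩
    p 0 * q 0 + x * (p 0 * eval (λ i → q (suc i)) L x + 1ℚ * eval (polyMul p′ q) L x)
      ≡⟨ solve 5 (λ p0 q0 x Q M → p0 :* q0 :+ x :* (p0 :* Q :+ con 1ℚ :* M) := p0 :* (q0 :+ x :* Q) :+ x :* M) refl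
           (p 0) (q 0) x (eval (λ i → q (suc i)) L x) (eval (polyMul p′ q) L x) ⟩
    p 0 * eval q (suc L) x + x * eval (polyMul p′ q) L x ∎
    where
    open ≡-Reasoning
    p′ = λ i → p (suc i)

  polyMul-zeroˡ : ∀ (p q : ℕ → ℚ) → (∀ i → p i ≡ 0ℚ) → ∀ j → polyMul p q j ≡ 0ℚ
  polyMul-zeroˡ p q p≡0 j = ∑ℚ-zero (upTo (suc j)) (λ i _ → trans (cong (_* q (j ∸ i)) (p≡0 i)) (*-zeroˡ (q (j ∸ i))))

  eval-polyMul : ∀ n m (p q : ℕ → ℚ) x → DegreeAtMost n p → DegreeAtMost m q →
    eval (polyMul p q) (suc (n ℕ.+ m)) x ≡ eval p (suc n) x * eval q (suc m) x
  eval-polyMul zero m p q x p-deg q-deg = begin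
    eval (polyMul p q) (suc m) x
      ≡⟨ eval-polyMul-suc m p q x ⟩
    p 0 * eval q (suc m) x + x * eval (polyMul (λ i → p (suc i)) q) m x
      ≡⟨ cong (λ z → p 0 * eval q (suc m) x + x * z)
              (eval-zero m _ x (polyMul-zeroˡ _ q (λ i → p-deg (suc i) (s≤s z≤n)))) ⟩
    p 0 * eval q (suc m) x + x * 0ℚ
      ≡⟨ solve 3 (λ a b x → a :* b :+ x :* con 0ℚ := (a :+ x :* con 0ℚ) :* b) refl (p 0) (eval q (suc m) x) x ⟩
    eval p 1 x * eval q (suc m) x ∎
    where open ≡-Reasoning
  eval-polyMul (suc n) m p q x p-deg q-deg = begin
    eval (polyMul p q) (suc (suc n ℕ.+ m)) x
      ≡⟨ eval-polyMul-suc (suc n ℕ.+ m) p q x ⟩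
    p 0 * eval q (suc (suc n ℕ.+ m)) x + x * eval (polyMul (λ i → p (suc i)) q) (suc (n ℕ.+ m)) x
      ≡⟨ cong₂ (λ a b → p 0 * a + x * b) pad (eval-polyMul n m (λ i → p (suc i)) q x (λ i n<i → p-deg (suc i) (s≤s n<i)) q-deg) ⟩
    p 0 * eval q (suc m) x + x * (eval (λ i → p (suc i)) (suc n) x * eval q (suc m) x)
      ≡⟨ solve 4 (λ a Q x P → a :* Q :+ x :* (P :* Q) := (a :+ x :* P) :* Q) refl
                 (p 0) (eval q (suc m) x) x (eval (λ i → p (suc i)) (suc n) x) ⟩
    eval p (suc (suc n)) x * eval q (suc m) x ∎
    where
    open ≡-Reasoning
    pad : eval q (suc (suc n ℕ.+ m)) x ≡ eval q (suc m) x
    pad = trans (cong (λ L → eval q (suc L) x) (ℕₚ.+-comm (suc n) m)) (eval-pad (suc m) (suc n) q x q-deg)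

  polyMul-degree : ∀ n m (p q : ℕ → ℚ) → DegreeAtMost n p → DegreeAtMost m q → DegreeAtMost (n ℕ.+ m) (polyMul p q)
  polyMul-degree n m p q p-deg q-deg j n+m<j = ∑ℚ-zero (upTo (suc j)) (λ i _ → term i)
    where
    term : ∀ i → p i * q (j ∸ i) ≡ 0ℚ
    term i with ℕₚ.≤-<-connex i n
    ... | inj₁ i≤n = trans (cong (p i *_) (q-deg (j ∸ i) m<j∸i)) (*-zeroʳ (p i))
      where
      i≤j : i ≤ j
      i≤j = ℕₚ.≤-trans i≤n (ℕₚ.≤-trans (ℕₚ.m≤m+n n m) (ℕₚ.<⇒≤ n+m<j))
      m<j∸i : m < j ∸ i
      m<j∸i = ℕₚ.+-cancelˡ-< i m (j ∸ i)
        (ℕₚ.<-≤-trans (ℕₚ.≤-<-trans (ℕₚ.+-monoˡ-≤ m i≤n) n+m<j) (ℕₚ.≤-reflexive (sym (ℕₚ.m+[n∸m]≡n i≤j))))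
    ... | inj₂ n<i = trans (cong (_* q (j ∸ i)) (p-deg i n<i)) (*-zeroˡ (q (j ∸ i)))

  quotient : (ℕ → ℚ) → ℕ → ℚ → ℕ → ℚ
  quotient c zero r j = 0ℚ
  quotient c (suc L) r zero = eval (λ i → c (suc i)) (suc L) r
  quotient c (suc L) r (suc j) = quotient (λ i → c (suc i)) L r j

  eval-divide : ∀ L c r x → eval c (suc L) x ≡ eval c (suc L) r + (x - r) * eval (quotient c L r) L x
  eval-divide zero c r x = solve 3 (λ c0 x r → c0 :+ x :* con 0ℚ := (c0 :+ r :* con 0ℚ) :+ (x :- r) :* con 0ℚ) refl (c 0) x r
  eval-divide (suc L) c r x = begin
    c 0 + x * eval c′ (suc L) x
      ≡⟨ cong (λ z → c 0 + x * z) (eval-divide L c′ r x) ⟩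
    c 0 + x * (A + (x - r) * B)
      ≡⟨ solve 5 (λ c0 x r A B → c0 :+ x :* (A :+ (x :- r) :* B) := (c0 :+ r :* A) :+ (x :- r) :* (A :+ x :* B)) refl (c 0) x r A B ⟩
    (c 0 + r * A) + (x - r) * (A + x * B) ∎
    where
    open ≡-Reasoning
    c′ = λ i → c (suc i)
    A = eval c′ (suc L) r
    B = eval (quotient c′ L r) L x

  quotient-vanishes : ∀ L c r → (∀ j → j < L → quotient c L r j ≡ 0ℚ) → eval c (suc L) r ≡ 0ℚ →
    ∀ i → i < suc L → c i ≡ 0ℚ
  quotient-vanishes zero c r _ cr≡0 zero _ = trans (solve 2 (λ c0 r → c0 := c0 :+ r :* con 0ℚ) refl (c 0) r) cr≡0
  quotient-vanishes zero c r _ _ (suc i) (s≤s ())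
  quotient-vanishes (suc L) c r q≡0 cr≡0 zero _ = begin
    c 0                                     ≡⟨ solve 2 (λ c0 r → c0 := c0 :+ r :* con 0ℚ) refl (c 0) r ⟩
    c 0 + r * 0ℚ                            ≡⟨ cong (λ z → c 0 + r * z) (sym (q≡0 0 (s≤s z≤n))) ⟩
    c 0 + r * eval (λ i → c (suc i)) (suc L) r ≡⟨ cr≡0 ⟩
    0ℚ                                      ∎
    where open ≡-Reasoning
  quotient-vanishes (suc L) c r q≡0 _ (suc i) (s≤s i<1+L) =
    quotient-vanishes L (λ i → c (suc i)) r (λ j j<L → q≡0 (suc j) (s≤s j<L)) (q≡0 0 (s≤s z≤n)) i i<1+L

  x-y≡0⇒x≡y : ∀ {x y : ℚ} → x - y ≡ 0ℚ → x ≡ y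
  x-y≡0⇒x≡y {x} {y} x-y≡0 = begin
    x            ≡⟨ solve 2 (λ x y → x := (x :- y) :+ y) refl x y ⟩
    (x - y) + y  ≡⟨ cong (_+ y) x-y≡0 ⟩
    0ℚ + y       ≡⟨ +-identityˡ y ⟩
    y            ∎
    where open ≡-Reasoning

  x-y≢0 : ∀ {x y : ℚ} → x ≢ y → x - y ≢ 0ℚ
  x-y≢0 x≢y x-y≡0 = x≢y (x-y≡0⇒x≡y x-y≡0)

  roots⇒zero : ∀ L c (rs : List ℚ) → Unique rs → length rs ≡ L → (∀ r → r ∈ rs → eval c L r ≡ 0ℚ) →
    ∀ i → i < L → c i ≡ 0ℚ
  roots⇒zero (suc L) c (r ∷ rs) (r∉rs ∷ u) len roots =
    quotient-vanishes L c r (roots⇒zero L (quotient c L r) rs u (ℕₚ.suc-injective len) quotient-roots) (roots r (here refl))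
    where
    quotient-roots : ∀ r′ → r′ ∈ rs → eval (quotient c L r) L r′ ≡ 0ℚ
    quotient-roots r′ r′∈rs = *-cancelˡ-≡ (r′ - r) (x-y≢0 (λ r′≡r → All.lookup r∉rs r′∈rs (sym r′≡r))) (begin
      (r′ - r) * eval (quotient c L r) L r′                    ≡⟨ sym (+-identityˡ _) ⟩
      0ℚ + (r′ - r) * eval (quotient c L r) L r′               ≡⟨ cong (_+ (r′ - r) * eval (quotient c L r) L r′)
                                                                       (sym (roots r (here refl))) ⟩
      eval c (suc L) r + (r′ - r) * eval (quotient c L r) L r′ ≡⟨ sym (eval-divide L c r r′) ⟩
      eval c (suc L) r′                                        ≡⟨ roots r′ (there r′∈rs) ⟩
      0ℚ                                                       ≡⟨ sym (*-zeroʳ (r′ - r)) ⟩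
      (r′ - r) * 0ℚ                                            ∎)
      where open ≡-Reasoning

  coefficients-≡ : ∀ N (p q : ℕ → ℚ) → DegreeAtMost N p → DegreeAtMost N q →
    (pt : ℕ → ℚ) → Injective _≡_ _≡_ pt → (∀ m → eval p (suc N) (pt m) ≡ eval q (suc N) (pt m)) → ∀ j → p j ≡ q j
  coefficients-≡ N p q p-deg q-deg pt pt-injective agree j with j ℕₚ.<? suc N
  ... | yes j≤N = x-y≡0⇒x≡y (roots⇒zero (suc N) (λ i → p i - q i) (map pt (upTo (suc N)))
                                (Uniqueₚ.map⁺ pt-injective (upTo⁺ (suc N)))
                                (trans (Listₚ.length-map pt (upTo (suc N))) (Listₚ.length-upTo (suc N)))
                                difference-roots j j≤N)
    where
    difference-roots : ∀ r → r ∈ map pt (upTo (suc N)) → eval (λ i → p i - q i) (suc N) r ≡ 0ℚ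
    difference-roots r r∈ with m , _ , refl ← ∈-map⁻ pt r∈ = begin
      eval (λ i → p i - q i) (suc N) (pt m)
        ≡⟨ eval-cong (suc N) (pt m) (λ i → solve 2 (λ x y → x :- y := con 1ℚ :* x :+ (:- con 1ℚ) :* y) refl (p i) (q i)) ⟩
      eval (λ i → 1ℚ * p i + (- 1ℚ) * q i) (suc N) (pt m)
        ≡⟨ eval-linear (suc N) 1ℚ (- 1ℚ) p q (pt m) ⟩
      1ℚ * eval p (suc N) (pt m) + (- 1ℚ) * eval q (suc N) (pt m)
        ≡⟨ cong (λ z → 1ℚ * z + (- 1ℚ) * eval q (suc N) (pt m)) (agree m) ⟩
      1ℚ * eval q (suc N) (pt m) + (- 1ℚ) * eval q (suc N) (pt m)
        ≡⟨ solve 1 (λ y → con 1ℚ :* y :+ (:- con 1ℚ) :* y := con 0ℚ) refl (eval q (suc N) (pt m)) ⟩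
      0ℚ ∎
      where open ≡-Reasoning
  ... | no j≰N = trans (p-deg j N<j) (sym (q-deg j N<j))
    where
    N<j : N < j
    N<j = ℕₚ.≤-pred (ℕₚ.≰⇒> j≰N)

  ∑ℚ-upTo-select : ∀ K ℓ (A : ℚ) (g : ℕ → ℚ) → ℓ < K →
    ∑ℚ (upTo K) (λ j → (if ℓ ≡ᵇ j then A else 0ℚ) * g j) ≡ A * g ℓ
  ∑ℚ-upTo-select (suc K) ℓ A g ℓ<1+K = begin
    ∑ℚ (upTo (suc K)) F                  ≡⟨ cong (λ L → ∑ℚ L F) (sym (Listₚ.upTo-∷ʳ K)) ⟩
    ∑ℚ (upTo K Data.List.∷ʳ K) F         ≡⟨ ∑ℚ-++ (upTo K) [ K ] F ⟩
    ∑ℚ (upTo K) F + (F K + 0ℚ)           ≡⟨ last-or-earlier (ℕₚ.m≤n⇒m<n∨m≡n (ℕₚ.≤-pred ℓ<1+K)) ⟩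
    A * g ℓ                              ∎
    where
    open ≡-Reasoning
    F = λ j → (if ℓ ≡ᵇ j then A else 0ℚ) * g j
    F-≢ : ∀ {j} → ℓ ≢ j → F j ≡ 0ℚ
    F-≢ {j} ℓ≢j rewrite Colourings.≢⇒≡ᵇ-false ℓ≢j = *-zeroˡ (g j)
    last-or-earlier : ℓ < K ⊎ ℓ ≡ K → ∑ℚ (upTo K) F + (F K + 0ℚ) ≡ A * g ℓ
    last-or-earlier (inj₁ ℓ<K) =
      trans (cong₂ (λ X Y → X + (Y + 0ℚ)) (∑ℚ-upTo-select K ℓ A g ℓ<K) (F-≢ (λ ℓ≡K → ℕₚ.<-irrefl ℓ≡K ℓ<K)))
            (solve 1 (λ X → X :+ (con 0ℚ :+ con 0ℚ) := X) refl (A * g ℓ))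
    last-or-earlier (inj₂ refl) =
      trans (cong₂ (λ X Y → X + (Y + 0ℚ))
                   (∑ℚ-zero (upTo ℓ) (λ j j∈ → F-≢ (λ ℓ≡j → ℕₚ.<-irrefl (sym ℓ≡j) (Colourings.∈-upTo⇒< j∈))))
                   (cong (λ b → (if b then A else 0ℚ) * g ℓ) (Colourings.≡ᵇ-refl ℓ)))
            (solve 1 (λ X → con 0ℚ :+ (X :+ con 0ℚ) := X) refl (A * g ℓ))

module TreePolynomials where

  open import Data.Nat as ℕ using (_≤_; _<_; _⊓_; _∸_; s≤s)
  import Data.Nat.Properties as ℕₚ
  open import Data.Nat.ListAction using (sum)
  open import Data.Rational using (ℚ; 0ℚ; 1ℚ; _+_; _*_; _-_; 1/_; NonZero; ≢-nonZero)
  open import Data.Rational.Properties using (*-zeroˡ; *-zeroʳ; *-assoc; *-identityʳ; *-inverseˡ)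
  open import Data.Rational.Solver using (module +-*-Solver)
  open +-*-Solver
  open Colourings using (∑; χ; ontoCount; exponents; ∑-coeffX-exponents; ontoCount-vanishes; χ-ontoCount; χ-pathForest; sublists;
                         AllPositive; length≤sum; ∈-upTo⇒<; ≢⇒≡ᵇ-false)
  open Polynomials

  partitions-valid : ∀ f n m λs → λs ∈ partsF f n m → sum λs ≡ n × AllPositive λs
  partitions-valid zero zero m .[] (here refl) = refl , tt
  partitions-valid (suc f) zero m .[] (here refl) = refl , tt
  partitions-valid (suc f) (suc n) m λs λs∈
    with p , p∈ , λs∈′ ← find (∈-concatMap⁻ (λ p → map (p ∷_) (partsF f (suc n ∸ p) p)) {map suc (upTo (m ⊓ suc n))} λs∈)
    with μ , μ∈ , refl ← ∈-map⁻ (p ∷_) λs∈′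
    with i , i∈ , refl ← ∈-map⁻ suc p∈
    with sum-μ , μ-positive ← partitions-valid f (suc n ∸ suc i) (suc i) μ μ∈ =
      trans (cong (suc i ℕ.+_) sum-μ) (ℕₚ.m+[n∸m]≡n {suc i} {suc n} (ℕₚ.≤-trans (∈-upTo⇒< i∈) (ℕₚ.m⊓n≤n m (suc n))))
      , μ-positive

  denominator : ℕ → ℚ
  denominator m = ℕtoℚ (suc m)

  denominator-nonZero : ∀ m → NonZero (denominator m)
  denominator-nonZero m = ≢-nonZero {denominator m} (λ e → ℕₚ.0≢1+n (ℕtoℚ-injective {0} {suc m} (sym e)))

  reciprocal : ℕ → ℚ
  reciprocal m = (1/ denominator m) {{denominator-nonZero m}}

  reciprocal-inverse : ∀ m → reciprocal m * denominator m ≡ 1ℚ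
  reciprocal-inverse m = *-inverseˡ (denominator m) {{denominator-nonZero m}}

  -- With t = m + 2 colours, the tree polynomial is evaluated at t / (t - 1).
  point : ℕ → ℚ
  point m = ℕtoℚ (suc (suc m)) * reciprocal m

  point≡w+1 : ∀ m → point m ≡ reciprocal m + 1ℚ
  point≡w+1 m = begin
    ℕtoℚ (suc (suc m)) * w   ≡⟨ cong (_* w) (ℕtoℚ-+ 1 (suc m)) ⟩
    (1ℚ + d) * w             ≡⟨ solve 2 (λ d w → (con 1ℚ :+ d) :* w := w :+ w :* d) refl d w ⟩
    w + w * d                ≡⟨ cong (w +_) (reciprocal-inverse m) ⟩
    w + 1ℚ                   ∎
    where
    open ≡-Reasoning
    d = denominator m
    w = reciprocal m

  point*denominator : ∀ m → point m * denominator m ≡ ℕtoℚ (suc (suc m))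
  point*denominator m = trans (*-assoc t (reciprocal m) (denominator m))
                              (trans (cong (t *_) (reciprocal-inverse m)) (*-identityʳ t))
    where t = ℕtoℚ (suc (suc m))

  point-injective : ∀ {m m′} → point m ≡ point m′ → m ≡ m′
  point-injective {m} {m′} e = ℕₚ.suc-injective (ℕtoℚ-injective (*-cancelˡ-≡ w w≢0 (begin
    w * d      ≡⟨ reciprocal-inverse m ⟩
    1ℚ         ≡⟨ sym (reciprocal-inverse m′) ⟩
    w′ * d′    ≡⟨ cong (_* d′) (sym w≡w′) ⟩
    w * d′     ∎)))
    where
    open ≡-Reasoning
    d = denominator m
    d′ = denominator m′
    w = reciprocal m
    w′ = reciprocal m′
    w≡w′ : w ≡ w′
    w≡w′ = begin
      w               ≡⟨ solve 1 (λ w → w := (w :+ con 1ℚ) :- con 1ℚ) refl w ⟩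
      (w + 1ℚ) - 1ℚ   ≡⟨ cong (_- 1ℚ) (trans (sym (point≡w+1 m)) (trans e (point≡w+1 m′))) ⟩
      (w′ + 1ℚ) - 1ℚ  ≡⟨ solve 1 (λ w → (w :+ con 1ℚ) :- con 1ℚ := w) refl w′ ⟩
      w′              ∎
    w≢0 : w ≢ 0ℚ
    w≢0 w≡0 = 1≢0 (trans (sym (reciprocal-inverse m)) (trans (cong (_* d) w≡0) (*-zeroˡ d)))
      where
      1≢0 : 1ℚ ≢ 0ℚ
      1≢0 ()

  module PathExpansion (G : Graph) (a : List ℕ → ℚ) (expansion : IsPathExpansion G a) where

    private
      n = size G
      Ps = partitions n

      valid : ∀ {λs} → λs ∈ Ps → sum λs ≡ n × AllPositive λs
      valid = partitions-valid n n n _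

      length≤n : ∀ {λs} → λs ∈ Ps → length λs ≤ n
      length≤n {λs} λs∈ = subst (length λs ≤_) (proj₁ (valid λs∈)) (length≤sum λs (proj₂ (valid λs∈)))

    private
      ontoCount-expansion-≤ : ∀ j → j ≤ n → ℕtoℚ (ontoCount (adj G) j) ≡ ∑ℚ Ps (λ λs → a λs * ℕtoℚ (ontoCount (pathAdj λs) j))
      ontoCount-expansion-≤ j j≤n = begin
        ℕtoℚ (ontoCount (adj G) j)
          ≡⟨ cong ℕtoℚ (sym (∑-coeffX-exponents n n (adj G) j j≤n)) ⟩
        ℕtoℚ (∑ (exponents n n j) (coeffX n n (adj G)))
          ≡⟨ ℕtoℚ-∑ (exponents n n j) (coeffX n n (adj G)) ⟩
        ∑ℚ (exponents n n j) (λ α → ℕtoℚ (coeffX n n (adj G) α))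
          ≡⟨ ∑ℚ-ext (exponents n n j) expansion ⟩
        ∑ℚ (exponents n n j) (λ α → ∑ℚ Ps (λ λs → a λs * X λs α))
          ≡⟨ ∑ℚ-comm (exponents n n j) Ps _ ⟩
        ∑ℚ Ps (λ λs → ∑ℚ (exponents n n j) (λ α → a λs * X λs α))
          ≡⟨ ∑ℚ-cong Ps (λ λs λs∈ → trans (∑ℚ-*ˡ (exponents n n j) (a λs) (X λs)) (cong (a λs *_) (path-coefficients λs∈))) ⟩
        ∑ℚ Ps (λ λs → a λs * ℕtoℚ (ontoCount (pathAdj λs) j)) ∎
        where
        open ≡-Reasoning
        X : List ℕ → (Fin n → ℕ) → ℚ
        X λs α = ℕtoℚ (coeffX (sum λs) n (pathAdj λs) α)
        path-coefficients : ∀ {λs} → λs ∈ Ps → ∑ℚ (exponents n n j) (X λs) ≡ ℕtoℚ (ontoCount (pathAdj λs) j)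
        path-coefficients {λs} λs∈ = begin
          ∑ℚ (exponents n n j) (X λs)
            ≡⟨ cong (λ N → ∑ℚ (exponents n N j) (X λs)) (sym (proj₁ (valid λs∈))) ⟩
          ∑ℚ (exponents n (sum λs) j) (X λs)
            ≡⟨ sym (ℕtoℚ-∑ (exponents n (sum λs) j) (coeffX (sum λs) n (pathAdj λs))) ⟩
          ℕtoℚ (∑ (exponents n (sum λs) j) (coeffX (sum λs) n (pathAdj λs)))
            ≡⟨ cong ℕtoℚ (∑-coeffX-exponents (sum λs) n (pathAdj λs) j j≤n) ⟩
          ℕtoℚ (ontoCount (pathAdj λs) j) ∎

      ontoCount-expansion-> : ∀ j → n < j → ℕtoℚ (ontoCount (adj G) j) ≡ ∑ℚ Ps (λ λs → a λs * ℕtoℚ (ontoCount (pathAdj λs) j))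
      ontoCount-expansion-> j n<j = begin
        ℕtoℚ (ontoCount (adj G) j)
          ≡⟨ cong ℕtoℚ (ontoCount-vanishes (adj G) j n<j) ⟩
        0ℚ
          ≡⟨ sym (∑ℚ-zero Ps (λ λs λs∈ → trans (cong (λ z → a λs * ℕtoℚ z) (vanishes λs∈)) (*-zeroʳ (a λs)))) ⟩
        ∑ℚ Ps (λ λs → a λs * ℕtoℚ (ontoCount (pathAdj λs) j)) ∎
        where
        open ≡-Reasoning
        vanishes : ∀ {λs} → λs ∈ Ps → ontoCount (pathAdj λs) j ≡ 0
        vanishes {λs} λs∈ = ontoCount-vanishes (pathAdj λs) j (subst (_< j) (sym (proj₁ (valid λs∈))) n<j)

    ontoCount-expansion : ∀ j → ℕtoℚ (ontoCount (adj G) j) ≡ ∑ℚ Ps (λ λs → a λs * ℕtoℚ (ontoCount (pathAdj λs) j))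
    ontoCount-expansion j = [ ontoCount-expansion-≤ j , ontoCount-expansion-> j ]′ (ℕₚ.≤-<-connex j n)

    χ-expansion : ∀ t → ℕtoℚ (χ (adj G) t) ≡ ∑ℚ Ps (λ λs → a λs * ℕtoℚ (χ (pathAdj λs) t))
    χ-expansion t = begin
      ℕtoℚ (χ (adj G) t)
        ≡⟨ cong ℕtoℚ (χ-ontoCount (adj G) t) ⟩
      ℕtoℚ (∑ (sublists (upTo t)) (λ F → ontoCount (adj G) (length F)))
        ≡⟨ ℕtoℚ-∑ (sublists (upTo t)) _ ⟩
      ∑ℚ (sublists (upTo t)) (λ F → ℕtoℚ (ontoCount (adj G) (length F)))
        ≡⟨ ∑ℚ-ext (sublists (upTo t)) (λ F → ontoCount-expansion (length F)) ⟩
      ∑ℚ (sublists (upTo t)) (λ F → ∑ℚ Ps (λ λs → a λs * ℕtoℚ (ontoCount (pathAdj λs) (length F))))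
        ≡⟨ ∑ℚ-comm (sublists (upTo t)) Ps _ ⟩
      ∑ℚ Ps (λ λs → ∑ℚ (sublists (upTo t)) (λ F → a λs * ℕtoℚ (ontoCount (pathAdj λs) (length F))))
        ≡⟨ ∑ℚ-ext Ps (λ λs → trans (∑ℚ-*ˡ (sublists (upTo t)) (a λs) _)
             (cong (a λs *_) (trans (sym (ℕtoℚ-∑ (sublists (upTo t)) (λ F → ontoCount (pathAdj λs) (length F))))
                                    (cong ℕtoℚ (sym (χ-ontoCount (pathAdj λs) t)))))) ⟩
      ∑ℚ Ps (λ λs → a λs * ℕtoℚ (χ (pathAdj λs) t)) ∎
      where open ≡-Reasoning

    treePoly-∑ : ∀ j → treePoly G a j ≡ ∑ℚ Ps (λ λs → if length λs ≡ᵇ j then a λs else 0ℚ)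
    treePoly-∑ j = ∑ℚ-filterᵇ Ps (λ λs → length λs ≡ᵇ j) a

    treePoly-degree : DegreeAtMost n (treePoly G a)
    treePoly-degree j n<j = trans (treePoly-∑ j) (∑ℚ-zero Ps λ λs λs∈ →
      cong (λ b → if b then a λs else 0ℚ) (≢⇒≡ᵇ-false (λ ℓ≡j → ℕₚ.<-irrefl ℓ≡j (ℕₚ.≤-<-trans (length≤n λs∈) n<j))))

    eval-treePoly : ∀ x → eval (treePoly G a) (suc n) x ≡ ∑ℚ Ps (λ λs → a λs * x ^ length λs)
    eval-treePoly x = begin
      eval (treePoly G a) (suc n) x
        ≡⟨ eval-∑ (suc n) (treePoly G a) x ⟩
      ∑ℚ (upTo (suc n)) (λ j → treePoly G a j * x ^ j)
        ≡⟨ ∑ℚ-ext (upTo (suc n)) (λ j → trans (cong (_* x ^ j) (treePoly-∑ j)) (sym (∑ℚ-*ʳ Ps (x ^ j) _))) ⟩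
      ∑ℚ (upTo (suc n)) (λ j → ∑ℚ Ps (λ λs → (if length λs ≡ᵇ j then a λs else 0ℚ) * x ^ j))
        ≡⟨ ∑ℚ-comm (upTo (suc n)) Ps _ ⟩
      ∑ℚ Ps (λ λs → ∑ℚ (upTo (suc n)) (λ j → (if length λs ≡ᵇ j then a λs else 0ℚ) * x ^ j))
        ≡⟨ ∑ℚ-cong Ps (λ λs λs∈ → ∑ℚ-upTo-select (suc n) (length λs) (a λs) (x ^_) (s≤s (length≤n λs∈))) ⟩
      ∑ℚ Ps (λ λs → a λs * x ^ length λs) ∎
      where open ≡-Reasoning

    χ-pathForest-at-point : ∀ m {λs} → λs ∈ Ps → ℕtoℚ (χ (pathAdj λs) (suc (suc m))) ≡ denominator m ^ n * point m ^ length λs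
    χ-pathForest-at-point m {λs} λs∈ = begin
      ℕtoℚ (χ (pathAdj λs) t)
        ≡⟨ cong ℕtoℚ (χ-pathForest λs (proj₂ (valid λs∈)) t) ⟩
      ℕtoℚ (t ℕ.^ ℓ ℕ.* suc m ℕ.^ (sum λs ∸ ℓ))
        ≡⟨ cong (λ N → ℕtoℚ (t ℕ.^ ℓ ℕ.* suc m ℕ.^ (N ∸ ℓ))) (proj₁ (valid λs∈)) ⟩
      ℕtoℚ (t ℕ.^ ℓ ℕ.* suc m ℕ.^ (n ∸ ℓ))
        ≡⟨ trans (ℕtoℚ-* (t ℕ.^ ℓ) _) (cong₂ _*_ (ℕtoℚ-^ t ℓ) (ℕtoℚ-^ (suc m) (n ∸ ℓ))) ⟩
      ℕtoℚ t ^ ℓ * d ^ (n ∸ ℓ)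
        ≡⟨ cong (λ z → z ^ ℓ * d ^ (n ∸ ℓ)) (sym (point*denominator m)) ⟩
      (point m * d) ^ ℓ * d ^ (n ∸ ℓ)
        ≡⟨ cong (_* d ^ (n ∸ ℓ)) (^-distrib-* (point m) d ℓ) ⟩
      point m ^ ℓ * d ^ ℓ * d ^ (n ∸ ℓ)
        ≡⟨ solve 3 (λ P A B → P :* A :* B := A :* B :* P) refl (point m ^ ℓ) (d ^ ℓ) (d ^ (n ∸ ℓ)) ⟩
      d ^ ℓ * d ^ (n ∸ ℓ) * point m ^ ℓ
        ≡⟨ cong (_* point m ^ ℓ) (trans (sym (^-homo-* d ℓ (n ∸ ℓ))) (cong (d ^_) (ℕₚ.m+[n∸m]≡n (length≤n λs∈)))) ⟩
      d ^ n * point m ^ ℓ ∎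
      where
      open ≡-Reasoning
      t = suc (suc m)
      ℓ = length λs
      d = denominator m

    χ-treePoly : ∀ m → ℕtoℚ (χ (adj G) (suc (suc m))) ≡ denominator m ^ n * eval (treePoly G a) (suc n) (point m)
    χ-treePoly m = begin
      ℕtoℚ (χ (adj G) (suc (suc m)))
        ≡⟨ χ-expansion (suc (suc m)) ⟩
      ∑ℚ Ps (λ λs → a λs * ℕtoℚ (χ (pathAdj λs) (suc (suc m))))
        ≡⟨ ∑ℚ-cong Ps (λ λs λs∈ → cong (a λs *_) (χ-pathForest-at-point m λs∈)) ⟩
      ∑ℚ Ps (λ λs → a λs * (denominator m ^ n * point m ^ length λs))
        ≡⟨ ∑ℚ-ext Ps (λ λs → solve 3 (λ A R S → A :* (R :* S) := R :* (A :* S)) refl (a λs) (denominator m ^ n) (point m ^ length λs)) ⟩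
      ∑ℚ Ps (λ λs → denominator m ^ n * (a λs * point m ^ length λs))
        ≡⟨ ∑ℚ-*ˡ Ps (denominator m ^ n) _ ⟩
      denominator m ^ n * ∑ℚ Ps (λ λs → a λs * point m ^ length λs)
        ≡⟨ cong (denominator m ^ n *_) (sym (eval-treePoly (point m))) ⟩
      denominator m ^ n * eval (treePoly G a) (suc n) (point m) ∎
      where open ≡-Reasoning

  denominator^≢0 : ∀ m N → denominator m ^ N ≢ 0ℚ
  denominator^≢0 m N d^N≡0 with () ← ℕₚ.m^n≡0⇒m≡0 (suc m) N (ℕtoℚ-injective (trans (ℕtoℚ-^ (suc m) N) d^N≡0))

  module _ (A B : Graph) {a b : List ℕ → ℚ} (expansionA : IsPathExpansion A a) (expansionB : IsPathExpansion B b) where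

    private
      nA = size A
      nB = size B
      τA = treePoly A a
      τB = treePoly B b

    polyMul-treePoly-degree : ∀ {N} → nA ℕ.+ nB ≡ N → DegreeAtMost N (polyMul τA τB)
    polyMul-treePoly-degree refl = polyMul-degree nA nB τA τB (PathExpansion.treePoly-degree A a expansionA)
                                                              (PathExpansion.treePoly-degree B b expansionB)

    χ*χ-treePoly : ∀ {N} → nA ℕ.+ nB ≡ N → ∀ m → ℕtoℚ (χ (adj A) (suc (suc m)) ℕ.* χ (adj B) (suc (suc m)))
                                               ≡ denominator m ^ N * eval (polyMul τA τB) (suc N) (point m)
    χ*χ-treePoly refl m = begin
      ℕtoℚ (χ (adj A) t ℕ.* χ (adj B) t)
        ≡⟨ ℕtoℚ-* (χ (adj A) t) (χ (adj B) t) ⟩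
      ℕtoℚ (χ (adj A) t) * ℕtoℚ (χ (adj B) t)
        ≡⟨ cong₂ _*_ (PathExpansion.χ-treePoly A a expansionA m) (PathExpansion.χ-treePoly B b expansionB m) ⟩
      (d ^ nA * eval τA (suc nA) x) * (d ^ nB * eval τB (suc nB) x)
        ≡⟨ solve 4 (λ P Q X Y → (P :* X) :* (Q :* Y) := (P :* Q) :* (X :* Y)) refl
                   (d ^ nA) (d ^ nB) (eval τA (suc nA) x) (eval τB (suc nB) x) ⟩
      (d ^ nA * d ^ nB) * (eval τA (suc nA) x * eval τB (suc nB) x)
        ≡⟨ cong₂ _*_ (sym (^-homo-* d nA nB))
                     (sym (eval-polyMul nA nB τA τB x (PathExpansion.treePoly-degree A a expansionA)
                                                      (PathExpansion.treePoly-degree B b expansionB))) ⟩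
      d ^ (nA ℕ.+ nB) * eval (polyMul τA τB) (suc (nA ℕ.+ nB)) x ∎
      where
      open ≡-Reasoning
      t = suc (suc m)
      d = denominator m
      x = point m

  polyMul-treePoly-≡ : ∀ (A B C D : Graph) {a b c d : List ℕ → ℚ} →
    IsPathExpansion A a → IsPathExpansion B b → IsPathExpansion C c → IsPathExpansion D d →
    size A ℕ.+ size B ≡ size C ℕ.+ size D →
    (∀ t → χ (adj A) t ℕ.* χ (adj B) t ≡ χ (adj C) t ℕ.* χ (adj D) t) →
    ∀ j → polyMul (treePoly A a) (treePoly B b) j ≡ polyMul (treePoly C c) (treePoly D d) j
  polyMul-treePoly-≡ A B C D {a} {b} {c} {d} eA eB eC eD sizes χ*χ≡χ*χ =
    coefficients-≡ N τAB τCD (polyMul-treePoly-degree A B eA eB sizes) (polyMul-treePoly-degree C D eC eD refl)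
                   point point-injective agree
    where
    N = size C ℕ.+ size D
    τAB = polyMul (treePoly A a) (treePoly B b)
    τCD = polyMul (treePoly C c) (treePoly D d)
    χAB χCD : ℕ → ℕ
    χAB t = χ (adj A) t ℕ.* χ (adj B) t
    χCD t = χ (adj C) t ℕ.* χ (adj D) t
    agree : ∀ m → eval τAB (suc N) (point m) ≡ eval τCD (suc N) (point m)
    agree m = *-cancelˡ-≡ (denominator m ^ N) (denominator^≢0 m N) (begin
      denominator m ^ N * eval τAB (suc N) (point m)
        ≡⟨ sym (χ*χ-treePoly A B eA eB sizes m) ⟩
      ℕtoℚ (χAB (suc (suc m)))
        ≡⟨ cong ℕtoℚ (χ*χ≡χ*χ (suc (suc m))) ⟩
      ℕtoℚ (χCD (suc (suc m)))
        ≡⟨ χ*χ-treePoly C D eC eD refl m ⟩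
      denominator m ^ N * eval τCD (suc N) (point m) ∎)
      where open ≡-Reasoning

open Colourings using (size-gluing; module Gluing)
open TreePolynomials using (polyMul-treePoly-≡)

corollary4p1 : (G₁ G₂ : Graph) (k : ℕ)
    (u : Fin k → Fin (size G₁)) (v : Fin k → Fin (size G₂)) →
    IsClique G₁ k u → IsClique G₂ k v →
    (H : Graph) (f₁ : Fin (size G₁) → Fin (size H)) (f₂ : Fin (size G₂) → Fin (size H)) →
    IsGluing G₁ G₂ k u v H f₁ f₂ →
    (a₁ a₂ aH aK : List ℕ → ℚ) →
    IsPathExpansion G₁ a₁ → IsPathExpansion G₂ a₂ →
    IsPathExpansion H aH → IsPathExpansion (completeGraph k) aK →
    ∀ j → polyMul (treePoly H aH) (treePoly (completeGraph k) aK) j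
          ≡ polyMul (treePoly G₁ a₁) (treePoly G₂ a₂) j
corollary4p1 G₁ G₂ k u v cl₁ cl₂ H f₁ f₂ gl a₁ a₂ aH aK e₁ e₂ eH eK =
  polyMul-treePoly-≡ H (completeGraph k) G₁ G₂ eH eK e₁ e₂ (size-gluing cl₁ gl) (Gluing.χ-gluing cl₁ cl₂ gl)
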